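{- For every $\mathcal{V}\text{ - }\mathsf{Cat}_{\mathsf{sep}}$-enriched autonomous category $\mathcal{C}$ there is a $\mathcal{V}\text{ - }\mathsf{Cat}_{\mathsf{sep}}$-enriched equivalence of categories $\mathrm{Syn}(\mathrm{Lang}(\mathcal{C}))\simeq\mathcal{C}$.
   Context: Standing assumptions on $\mathcal{V}$: commutative unital quantale (complete lattice, commutative associative $\otimes$ distributing over joins, unit $k$), integral ($k=\top$), underlying lattice continuous (every $x$ equals $\bigvee\{y\mid y\ll x\}$, with $y\ll x$ meaning: whenever $x\le\bigvee X$ some finite $A\subseteq X$ has $y\le\bigvee A$), with a fixed basis $B$ (for each $x$, $B\cap\{y\mid y\ll x\}$ is directed with join $x$) closed under finite joins and $\otimes$ and containing $k$. $\mathcal{V}$-categories $(X,a)$: $k\le a(x,x)$, $a(x,y)\otimes a(y,z)\le a(x,z)$; separated if $k\le a(x,y),a(y,x)$ imply $x=y$; $\mathcal{V}$-functors: $a(x,y)\le b(fx,fy)$. A $\mathcal{V}\text{ - }\mathsf{Cat}_{\mathsf{sep}}$-enriched autonomous category: symmetric monoidal closed category whose hom-sets are small separated $\mathcal{V}$-categories, with composition and the action of $\otimes$ on homs being $\mathcal{V}$-functors (pointwise tensor of $\mathcal{V}$-categories), and $-\otimes X\dashv X\multimap-$ an enriched adjunction (functors act by $\mathcal{V}$-functors on homs, currying bijections are $\mathcal{V}$-isomorphisms). A $\mathcal{V}\text{ - }\mathsf{Cat}_{\mathsf{sep}}$-equivalence is an equivalence of categories whose functors act by $\mathcal{V}$-functors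 on homs. Linear $\mathcal{V}\lambda$-theories: over ground types $G$ and operation symbols $\Sigma$ ($f:A_1,\dots,A_n\to A$, $n\ge1$), linear $\lambda$-terms with types $X\in G$, $I$, $A\otimes B$, $A\multimap B$ and constructors $f(\vec v)$, variables, $\ast$, $v\ \mathtt{to}\ \ast.\,w$, $v\otimes w$, $\mathtt{pm}\ v\ \mathtt{to}\ x\otimes y.\,w$, $\lambda x.\,v$, $v\,w$; axioms are $\mathcal{V}$-equations-in-context $\Gamma\rhd v=_q w:A$ with $q\in B$; theorems are derived from axioms and the $\beta\eta$/commuting-conversion equations (an equation $v=w$ meaning $v=_\top w$ and $w=_\top v$) by reflexivity ($v=_\top v$), transitivity ($q\otimes r$), weakening of labels, the Archimedean rule (if $v=_r w$ for all $r\ll q$ then $v=_q w$), finite joins, compatibility of constructors and substitution (labels combined by $\otimes$; $\lambda$ preserves labels), and context permutation. $\mathrm{Syn}(T)$: objects are types; the hom-object from $A$ to $B$ is the separated quotient of the $\mathcal{V}$-category of terms $x:A\rhd v:B$ with $a(v,w)=\bigvee\{q\mid v=_q w$ is a theorem$\}$ (identify $v,w$ when $a(v,w),a(w,v)\ge k$); composition is substitution. $\mathrm{Lang}(\mathcal{C})$: ground types = objects of $\mathcal{C}$; operation symbols = all morphisms of $\mathcal{C}$ plus, for each type $A$, isomorphisms between $A$ and $i(A)$, where $i(I)=\hat I$, $i(X)=X$, $i(A\otimes B)=i(A)\hat\otimes i(B)$, $i(A\multimap B)=i(A)\hat\multimap i(B)$ (hats = structure of $\mathcal{C}$); axioms =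 all $\mathcal{V}$-equations-in-context satisfied ($a(\llbracket v\rrbracket,\llbracket w\rrbracket)\ge q$) by the obvious interpretation in $\mathcal{C}$. -}

module Defs where

open import Level using (Level; Lift) renaming (suc to lsuc)
open import Data.Unit using (⊤)
open import Data.Empty using (⊥)
open import Data.Product using (Σ; _×_; _,_; proj₁)
open import Data.Sum using (_⊎_; inj₁; inj₂)
open import Data.List using (List; []; _∷_; foldr)
open import Data.List.Relation.Unary.All using (All)
open import Relation.Binary.PropositionalEquality using (_≡_; refl; sym; subst)
open import Function.Bundles using (_⇔_)

record Quantale (ℓ : Level) : Set (lsuc ℓ) where
  infix 4 _≤_ _≪_
  infixr 7 _⊗_
  infixr 6 _∨_
  field
    Carrier   : Set ℓ
    _≤_       : Carrier → Carrier → Set ℓ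
    ≤-refl    : ∀ {x} → x ≤ x
    ≤-trans   : ∀ {x y z} → x ≤ y → y ≤ z → x ≤ z
    ≤-antisym : ∀ {x y} → x ≤ y → y ≤ x → x ≡ y
    ⋁         : (Carrier → Set ℓ) → Carrier
    ⋁-ub      : ∀ (S : Carrier → Set ℓ) {x} → S x → x ≤ ⋁ S
    ⋁-least   : ∀ (S : Carrier → Set ℓ) {y} → (∀ {x} → S x → x ≤ y) → ⋁ S ≤ y
    _⊗_       : Carrier → Carrier → Carrier
    k         : Carrier
    ⊗-comm    : ∀ x y → x ⊗ y ≡ y ⊗ x
    ⊗-assoc   : ∀ x y z → (x ⊗ y) ⊗ z ≡ x ⊗ (y ⊗ z)
    ⊗-unit    : ∀ x → k ⊗ x ≡ x
    ⊗-distrib : ∀ x (S : Carrier → Set ℓ) →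
                x ⊗ ⋁ S ≡ ⋁ (λ z → Σ Carrier (λ y → S y × z ≡ x ⊗ y))

  ⊤V : Carrier
  ⊤V = ⋁ (λ _ → Lift ℓ ⊤)

  ⊥V : Carrier
  ⊥V = ⋁ (λ _ → Lift ℓ ⊥)

  _∨_ : Carrier → Carrier → Carrier
  a ∨ b = ⋁ (λ z → (z ≡ a) ⊎ (z ≡ b))

  ⋁fin : List Carrier → Carrier
  ⋁fin = foldr _∨_ ⊥V

  WayBelow : Carrier → Carrier → Set (lsuc ℓ)
  WayBelow y x = ∀ (X : Carrier → Set ℓ) → x ≤ ⋁ X →
                 Σ (List Carrier) (λ A → All X A × y ≤ ⋁fin A)

  field
    -- a small relation _≪_ that is (logically) the way-below relation
    _≪_        : Carrier → Carrier → Set ℓ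
    ≪-is-waybelow : ∀ y x → (y ≪ x) ⇔ WayBelow y x
    integral   : k ≡ ⊤V
    continuous : ∀ x → x ≡ ⋁ (λ y → y ≪ x)
    B          : Carrier → Set ℓ
    B-nonempty : ∀ x → Σ Carrier (λ y → B y × y ≪ x)
    B-directed : ∀ x {y z} → B y → y ≪ x → B z → z ≪ x →
                 Σ Carrier (λ u → B u × u ≪ x × y ≤ u × z ≤ u)
    B-join     : ∀ x → x ≡ ⋁ (λ y → B y × y ≪ x)
    B-⊥        : B ⊥V
    B-∨        : ∀ {x y} → B x → B y → B (x ∨ y)
    B-⊗        : ∀ {x y} → B x → B y → B (x ⊗ y)
    B-k        : B k

-- 2. Categories whose homs are separated V-categories.
-- A hom-set is a type with a V-valued distance d; the separated quotient is
-- presented as a setoid:  f ≈ g  iff  k ≤ d f g  and  k ≤ d g f.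

module _ {ℓ : Level} (V : Quantale ℓ) where
  open Quantale V

  -- bare data of a category enriched in separated V-categories
  -- (laws are stated separately where needed)
  record VCatStr : Set (lsuc ℓ) where
    infixr 9 _∘_
    infix 4 _≈_
    field
      Obj : Set ℓ
      Hom : Obj → Obj → Set ℓ
      d   : ∀ {A B} → Hom A B → Hom A B → Carrier
      id  : ∀ {A} → Hom A A
      _∘_ : ∀ {A B C} → Hom B C → Hom A B → Hom A C

    _≈_ : ∀ {A B} → Hom A B → Hom A B → Set ℓ
    f ≈ g = (k ≤ d f g) × (k ≤ d g f)

  record EnrAutCat : Set (lsuc ℓ) where
    infixr 9 _∘_
    infix 4 _≈_
    infixr 10 _⊗₀_ _⊗₁_
    infixr 8 _⊸₀_
    field
      Obj : Set ℓ
      Hom : Obj → Obj → Set ℓ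
      d   : ∀ {A B} → Hom A B → Hom A B → Carrier
      d-refl  : ∀ {A B} (f : Hom A B) → k ≤ d f f
      d-trans : ∀ {A B} (f g h : Hom A B) → d f g ⊗ d g h ≤ d f h
      id  : ∀ {A} → Hom A A
      _∘_ : ∀ {A B C} → Hom B C → Hom A B → Hom A C

    _≈_ : ∀ {A B} → Hom A B → Hom A B → Set ℓ
    f ≈ g = (k ≤ d f g) × (k ≤ d g f)

    field
      ∘-vfun : ∀ {A B C} (g g' : Hom B C) (f f' : Hom A B) →
               d g g' ⊗ d f f' ≤ d (g ∘ f) (g' ∘ f')
      idˡ    : ∀ {A B} (f : Hom A B) → id ∘ f ≈ f
      idʳ    : ∀ {A B} (f : Hom A B) → f ∘ id ≈ f
      assoc  : ∀ {A B C D} (h : Hom C D) (g : Hom B C) (f : Hom A B) →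
               (h ∘ g) ∘ f ≈ h ∘ (g ∘ f)
      𝟙      : Obj
      _⊗₀_   : Obj → Obj → Obj
      _⊗₁_   : ∀ {A B C D} → Hom A B → Hom C D → Hom (A ⊗₀ C) (B ⊗₀ D)
      ⊗-vfun : ∀ {A B C D} (f f' : Hom A B) (g g' : Hom C D) →
               d f f' ⊗ d g g' ≤ d (f ⊗₁ g) (f' ⊗₁ g')
      ⊗-id   : ∀ {A C} → id {A} ⊗₁ id {C} ≈ id
      ⊗-∘    : ∀ {A B C D E F} (f : Hom A B) (f' : Hom B C) (g : Hom D E) (g' : Hom E F) →
               (f' ∘ f) ⊗₁ (g' ∘ g) ≈ (f' ⊗₁ g') ∘ (f ⊗₁ g)
      α      : ∀ {A B C} → Hom ((A ⊗₀ B) ⊗₀ C) (A ⊗₀ (B ⊗₀ C))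
      α⁻¹    : ∀ {A B C} → Hom (A ⊗₀ (B ⊗₀ C)) ((A ⊗₀ B) ⊗₀ C)
      lu     : ∀ {A} → Hom (𝟙 ⊗₀ A) A
      lu⁻¹   : ∀ {A} → Hom A (𝟙 ⊗₀ A)
      ru     : ∀ {A} → Hom (A ⊗₀ 𝟙) A
      ru⁻¹   : ∀ {A} → Hom A (A ⊗₀ 𝟙)
      σ      : ∀ {A B} → Hom (A ⊗₀ B) (B ⊗₀ A)
      α-iso₁ : ∀ {A B C} → α {A} {B} {C} ∘ α⁻¹ ≈ id
      α-iso₂ : ∀ {A B C} → α⁻¹ ∘ α {A} {B} {C} ≈ id
      lu-iso₁ : ∀ {A} → lu {A} ∘ lu⁻¹ ≈ id
      lu-iso₂ : ∀ {A} → lu⁻¹ ∘ lu {A} ≈ id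
      ru-iso₁ : ∀ {A} → ru {A} ∘ ru⁻¹ ≈ id
      ru-iso₂ : ∀ {A} → ru⁻¹ ∘ ru {A} ≈ id
      σ-invol : ∀ {A B} → σ {B} {A} ∘ σ {A} {B} ≈ id
      α-nat  : ∀ {A A' B B' C C'} (f : Hom A A') (g : Hom B B') (h : Hom C C') →
               α ∘ ((f ⊗₁ g) ⊗₁ h) ≈ (f ⊗₁ (g ⊗₁ h)) ∘ α
      lu-nat : ∀ {A A'} (f : Hom A A') → lu ∘ (id ⊗₁ f) ≈ f ∘ lu
      ru-nat : ∀ {A A'} (f : Hom A A') → ru ∘ (f ⊗₁ id) ≈ f ∘ ru
      σ-nat  : ∀ {A A' B B'} (f : Hom A A') (g : Hom B B') →
               σ ∘ (f ⊗₁ g) ≈ (g ⊗₁ f) ∘ σ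
      pentagon : ∀ {A B C D} →
                 (id {A} ⊗₁ α {B} {C} {D}) ∘ α ∘ (α ⊗₁ id) ≈ α ∘ α
      triangle : ∀ {A B} → (id {A} ⊗₁ lu {B}) ∘ α ≈ ru ⊗₁ id
      hexagon  : ∀ {A B C} →
                 (id {B} ⊗₁ σ {A} {C}) ∘ α ∘ (σ ⊗₁ id) ≈ α ∘ σ ∘ α
      _⊸₀_  : Obj → Obj → Obj
      ev    : ∀ {X B} → Hom ((X ⊸₀ B) ⊗₀ X) B
      cur   : ∀ {A X B} → Hom (A ⊗₀ X) B → Hom A (X ⊸₀ B)
      cur-β : ∀ {A X B} (f : Hom (A ⊗₀ X) B) → ev ∘ (cur f ⊗₁ id) ≈ f
      cur-η : ∀ {A X B} (g : Hom A (X ⊸₀ B)) → cur (ev ∘ (g ⊗₁ id)) ≈ g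
      -- currying is a V-functor (its inverse g ↦ ev ∘ (g ⊗₁ id) is one by
      -- ∘-vfun and ⊗-vfun), so the currying bijection is a V-isomorphism
      cur-vfun : ∀ {A X B} (f f' : Hom (A ⊗₀ X) B) → d f f' ≤ d (cur f) (cur f')

  underlying : EnrAutCat → VCatStr
  underlying 𝒞 = record
    { Obj = Obj ; Hom = Hom ; d = d ; id = id ; _∘_ = _∘_ }
    where open EnrAutCat 𝒞

  record VFunctor (𝒞 𝒟 : VCatStr) : Set ℓ where
    private
      module 𝒞 = VCatStr 𝒞
      module 𝒟 = VCatStr 𝒟
    field
      F₀     : 𝒞.Obj → 𝒟.Obj
      F₁     : ∀ {A B} → 𝒞.Hom A B → 𝒟.Hom (F₀ A) (F₀ B)
      F-vfun : ∀ {A B} (f g : 𝒞.Hom A B) → 𝒞.d f g ≤ 𝒟.d (F₁ f) (F₁ g)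
      F-id   : ∀ {A} → F₁ (𝒞.id {A}) 𝒟.≈ 𝒟.id
      F-∘    : ∀ {A B C} (g : 𝒞.Hom B C) (f : 𝒞.Hom A B) →
               F₁ (g 𝒞.∘ f) 𝒟.≈ F₁ g 𝒟.∘ F₁ f

  record VEquivalence (𝒞 𝒟 : VCatStr) : Set ℓ where
    private
      module 𝒞 = VCatStr 𝒞
      module 𝒟 = VCatStr 𝒟
    field
      F : VFunctor 𝒞 𝒟
      G : VFunctor 𝒟 𝒞
    private
      module F = VFunctor F
      module G = VFunctor G
    field
      η     : ∀ X → 𝒞.Hom (G.F₀ (F.F₀ X)) X
      η⁻¹   : ∀ X → 𝒞.Hom X (G.F₀ (F.F₀ X))
      η-iso₁ : ∀ X → η X 𝒞.∘ η⁻¹ X 𝒞.≈ 𝒞.id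
      η-iso₂ : ∀ X → η⁻¹ X 𝒞.∘ η X 𝒞.≈ 𝒞.id
      η-nat : ∀ {X Y} (f : 𝒞.Hom X Y) → η Y 𝒞.∘ G.F₁ (F.F₁ f) 𝒞.≈ f 𝒞.∘ η X
      ε     : ∀ Y → 𝒟.Hom (F.F₀ (G.F₀ Y)) Y
      ε⁻¹   : ∀ Y → 𝒟.Hom Y (F.F₀ (G.F₀ Y))
      ε-iso₁ : ∀ Y → ε Y 𝒟.∘ ε⁻¹ Y 𝒟.≈ 𝒟.id
      ε-iso₂ : ∀ Y → ε⁻¹ Y 𝒟.∘ ε Y 𝒟.≈ 𝒟.id
      ε-nat : ∀ {X Y} (f : 𝒟.Hom X Y) → ε Y 𝒟.∘ F.F₁ (G.F₁ f) 𝒟.≈ f 𝒟.∘ ε X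

-- 3. Linear λ-terms (intrinsically typed, contexts as lists, context
-- splitting by interleaving; a variable is the term  x:A ▷ x : A)

infixr 6 _⊗ᵗ_
infixr 5 _⊸ᵗ_

data Ty {ℓ} (G : Set ℓ) : Set ℓ where
  gr    : G → Ty G
  𝕀     : Ty G
  _⊗ᵗ_  : Ty G → Ty G → Ty G
  _⊸ᵗ_  : Ty G → Ty G → Ty G

record Signature (ℓ : Level) : Set (lsuc ℓ) where
  field
    G    : Set ℓ
    Op   : Set ℓ                 -- operation symbols f : A₁,…,Aₙ → A  (n ≥ 1)
    dom₀ : Op → Ty G             -- A₁
    domₛ : Op → List (Ty G)      -- A₂,…,Aₙ
    cod  : Op → Ty G

module Terms {ℓ : Level} (Sg : Signature ℓ) where
  open Signature Sg

  Type : Set ℓ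
  Type = Ty G

  Ctx : Set ℓ
  Ctx = List Type

  infix 4 _≈_⋈_
  data _≈_⋈_ : Ctx → Ctx → Ctx → Set ℓ where
    []    : [] ≈ [] ⋈ []
    left  : ∀ {A Γ Γ₁ Γ₂} → Γ ≈ Γ₁ ⋈ Γ₂ → (A ∷ Γ) ≈ (A ∷ Γ₁) ⋈ Γ₂
    right : ∀ {A Γ Γ₁ Γ₂} → Γ ≈ Γ₁ ⋈ Γ₂ → (A ∷ Γ) ≈ Γ₁ ⋈ (A ∷ Γ₂)

  infix 3 _⊢_
  mutual
    data _⊢_ : Ctx → Type → Set ℓ where
      var  : ∀ {A} → (A ∷ []) ⊢ A
      op   : ∀ {Γ} (f : Op) → Args Γ (dom₀ f) (domₛ f) → Γ ⊢ cod f
      unit : [] ⊢ 𝕀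
      letu : ∀ {Γ Γ₁ Γ₂ A} → Γ ≈ Γ₁ ⋈ Γ₂ → Γ₁ ⊢ 𝕀 → Γ₂ ⊢ A → Γ ⊢ A          -- v to ∗. w
      pair : ∀ {Γ Γ₁ Γ₂ A B} → Γ ≈ Γ₁ ⋈ Γ₂ → Γ₁ ⊢ A → Γ₂ ⊢ B → Γ ⊢ A ⊗ᵗ B
      pm   : ∀ {Γ Γ₁ Γ₂ A B C} → Γ ≈ Γ₁ ⋈ Γ₂ → Γ₁ ⊢ A ⊗ᵗ B →
             (A ∷ B ∷ Γ₂) ⊢ C → Γ ⊢ C                                      -- pm v to x⊗y. w
      lam  : ∀ {Γ A B} → (A ∷ Γ) ⊢ B → Γ ⊢ A ⊸ᵗ B
      app  : ∀ {Γ Γ₁ Γ₂ A B} → Γ ≈ Γ₁ ⋈ Γ₂ → Γ₁ ⊢ A ⊸ᵗ B → Γ₂ ⊢ A → Γ ⊢ B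

    -- argument lists v₁,…,vₙ (n ≥ 1) for types A₁ , [A₂,…,Aₙ]
    data Args : Ctx → Type → List Type → Set ℓ where
      one  : ∀ {Γ A} → Γ ⊢ A → Args Γ A []
      cons : ∀ {Γ Γ₁ Γ₂ A B Bs} → Γ ≈ Γ₁ ⋈ Γ₂ → Γ₁ ⊢ A → Args Γ₂ B Bs →
             Args Γ A (B ∷ Bs)

  allL : ∀ {Γ} → Γ ≈ Γ ⋈ []
  allL {[]}    = []
  allL {_ ∷ Γ} = left allL

  allR : ∀ {Γ} → Γ ≈ [] ⋈ Γ
  allR {[]}    = []
  allR {_ ∷ Γ} = right allR

  comm : ∀ {Γ Γ₁ Γ₂} → Γ ≈ Γ₁ ⋈ Γ₂ → Γ ≈ Γ₂ ⋈ Γ₁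
  comm []        = []
  comm (left s)  = right (comm s)
  comm (right s) = left (comm s)

  allL-inv : ∀ {Γ Δ} → Γ ≈ Δ ⋈ [] → Γ ≡ Δ
  allL-inv []       = refl
  allL-inv (left s) with allL-inv s
  ... | refl = refl

  allR-inv : ∀ {Γ Δ} → Γ ≈ [] ⋈ Δ → Γ ≡ Δ
  allR-inv []        = refl
  allR-inv (right s) with allR-inv s
  ... | refl = refl

  assocˡ : ∀ {Ψ Δ Γ Γ₁ Γ₂} → Ψ ≈ Δ ⋈ Γ → Γ ≈ Γ₁ ⋈ Γ₂ →
           Σ Ctx (λ Ψ₁ → (Ψ₁ ≈ Δ ⋈ Γ₁) × (Ψ ≈ Ψ₁ ⋈ Γ₂))
  assocˡ [] [] = [] , [] , []
  assocˡ (left s) r with assocˡ s r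
  ... | Ψ₁ , a , b = _ , left a , left b
  assocˡ (right s) (left r) with assocˡ s r
  ... | Ψ₁ , a , b = _ , right a , left b
  assocˡ (right s) (right r) with assocˡ s r
  ... | Ψ₁ , a , b = Ψ₁ , a , right b

  assocʳ : ∀ {Γ Γ₁ Γ₂ Γ₁₁ Γ₁₂} → Γ ≈ Γ₁ ⋈ Γ₂ → Γ₁ ≈ Γ₁₁ ⋈ Γ₁₂ →
           Σ Ctx (λ Ψ → (Γ ≈ Γ₁₁ ⋈ Ψ) × (Ψ ≈ Γ₁₂ ⋈ Γ₂))
  assocʳ [] [] = [] , [] , []
  assocʳ (left s) (left s') with assocʳ s s'
  ... | Ψ , a , b = Ψ , left a , b
  assocʳ (left s) (right s') with assocʳ s s'
  ... | Ψ , a , b = _ , right a , left b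
  assocʳ (right s) s' with assocʳ s s'
  ... | Ψ , a , b = _ , right a , right b

  -- where does the (unique) variable of a singleton split go in a binary split
  locate : ∀ {Ξ Ξ₁ Ξ₂ Γ A} → Ξ ≈ Ξ₁ ⋈ Ξ₂ → Ξ ≈ (A ∷ []) ⋈ Γ →
           (Σ Ctx (λ Γ₁ → (Ξ₁ ≈ (A ∷ []) ⋈ Γ₁) × (Γ ≈ Γ₁ ⋈ Ξ₂))) ⊎
           (Σ Ctx (λ Γ₂ → (Ξ₂ ≈ (A ∷ []) ⋈ Γ₂) × (Γ ≈ Ξ₁ ⋈ Γ₂)))
  locate (left s) (left p) with allR-inv p
  ... | refl = inj₁ (_ , left allR , s)
  locate (left s) (right p) with locate s p
  ... | inj₁ (Γ₁ , q , r) = inj₁ (_ , right q , left r)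
  ... | inj₂ (Γ₂ , q , r) = inj₂ (Γ₂ , q , left r)
  locate (right s) (left p) with allR-inv p
  ... | refl = inj₂ (_ , left allR , s)
  locate (right s) (right p) with locate s p
  ... | inj₁ (Γ₁ , q , r) = inj₁ (Γ₁ , q , right r)
  ... | inj₂ (Γ₂ , q , r) = inj₂ (_ , right q , right r)

  head : ∀ {A Γ} → (A ∷ Γ) ≈ (A ∷ []) ⋈ Γ
  head = left allR

  -- Linear substitution  v[t/x] : the variable x of Ξ (given by p) is
  -- replaced by t : Δ ⊢ A, the result living in any interleaving Ψ of Δ with
  -- the remaining context Γ.
  mutual
    sub : ∀ {Ξ Γ Δ Ψ A B} → Ξ ⊢ B → Ξ ≈ (A ∷ []) ⋈ Γ → Ψ ≈ Δ ⋈ Γ → Δ ⊢ A → Ψ ⊢ B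
    sub var (left []) s t with allL-inv s
    ... | refl = t
    sub var (right ()) s t
    sub (op f as) p s t = op f (subArgs as p s t)
    sub unit () s t
    sub (letu q v w) p s t with locate q p
    ... | inj₁ (_ , p₁ , r) with assocˡ s r
    ...   | _ , s₁ , q' = letu q' (sub v p₁ s₁ t) w
    sub (letu q v w) p s t | inj₂ (_ , p₂ , r) with assocˡ s (comm r)
    ...   | _ , s₂ , q' = letu (comm q') v (sub w p₂ s₂ t)
    sub (pair q v w) p s t with locate q p
    ... | inj₁ (_ , p₁ , r) with assocˡ s r
    ...   | _ , s₁ , q' = pair q' (sub v p₁ s₁ t) w
    sub (pair q v w) p s t | inj₂ (_ , p₂ , r) with assocˡ s (comm r)
    ...   | _ , s₂ , q' = pair (comm q') v (sub w p₂ s₂ t)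
    sub (pm q v w) p s t with locate q p
    ... | inj₁ (_ , p₁ , r) with assocˡ s r
    ...   | _ , s₁ , q' = pm q' (sub v p₁ s₁ t) w
    sub (pm q v w) p s t | inj₂ (_ , p₂ , r) with assocˡ s (comm r)
    ...   | _ , s₂ , q' = pm (comm q') v (sub w (right (right p₂)) (right (right s₂)) t)
    sub (lam v) p s t = lam (sub v (right p) (right s) t)
    sub (app q v w) p s t with locate q p
    ... | inj₁ (_ , p₁ , r) with assocˡ s r
    ...   | _ , s₁ , q' = app q' (sub v p₁ s₁ t) w
    sub (app q v w) p s t | inj₂ (_ , p₂ , r) with assocˡ s (comm r)
    ...   | _ , s₂ , q' = app (comm q') v (sub w p₂ s₂ t)

    subArgs : ∀ {Ξ Γ Δ Ψ A B Bs} → Args Ξ B Bs → Ξ ≈ (A ∷ []) ⋈ Γ → Ψ ≈ Δ ⋈ Γ →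
              Δ ⊢ A → Args Ψ B Bs
    subArgs (one v) p s t = one (sub v p s t)
    subArgs (cons q v as) p s t with locate q p
    ... | inj₁ (_ , p₁ , r) with assocˡ s r
    ...   | _ , s₁ , q' = cons q' (sub v p₁ s₁ t) as
    subArgs (cons q v as) p s t | inj₂ (_ , p₂ , r) with assocˡ s (comm r)
    ...   | _ , s₂ , q' = cons (comm q') v (subArgs as p₂ s₂ t)

  -- right-hand side of β for ⊗:  u[v/x, w/y]
  β⊗-rhs : ∀ {Γ Γ₁ Γ₂ Γ₁₁ Γ₁₂ A B C} → Γ ≈ Γ₁ ⋈ Γ₂ → Γ₁ ≈ Γ₁₁ ⋈ Γ₁₂ →
           Γ₁₁ ⊢ A → Γ₁₂ ⊢ B → (A ∷ B ∷ Γ₂) ⊢ C → Γ ⊢ C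
  β⊗-rhs s s' v w u with assocʳ s s'
  ... | _ , a , b = sub (sub u (right head) (right b) w) head a v

  -- v to ∗. u[w/z]  (commuting conversion, right-hand side)
  ccI-rhs : ∀ {Γ Γ₁ Γ₂ Γ₁₁ Γ₁₂ A C} → Γ ≈ Γ₁ ⋈ Γ₂ → Γ₁ ≈ Γ₁₁ ⋈ Γ₁₂ →
            Γ₁₁ ⊢ 𝕀 → Γ₁₂ ⊢ A → (A ∷ Γ₂) ⊢ C → Γ ⊢ C
  ccI-rhs s s' v w u with assocʳ s s'
  ... | _ , a , b = letu a v (sub u head b w)

  -- pm v to x⊗y. u[w/z]  (commuting conversion, right-hand side)
  cc⊗-rhs : ∀ {Γ Γ₁ Γ₂ Γ₁₁ Γ₁₂ A B D C} → Γ ≈ Γ₁ ⋈ Γ₂ → Γ₁ ≈ Γ₁₁ ⋈ Γ₁₂ →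
            Γ₁₁ ⊢ A ⊗ᵗ B → (A ∷ B ∷ Γ₁₂) ⊢ D → (D ∷ Γ₂) ⊢ C → Γ ⊢ C
  cc⊗-rhs s s' v w u with assocʳ s s'
  ... | _ , a , b = pm a v (sub u head (left (left b)) w)

  data Conv : (Γ : Ctx) (A : Type) → Γ ⊢ A → Γ ⊢ A → Set ℓ where
    β⊸  : ∀ {Γ Γ₁ Γ₂ A B} (s : Γ ≈ Γ₁ ⋈ Γ₂) (v : (A ∷ Γ₁) ⊢ B) (w : Γ₂ ⊢ A) →
          Conv Γ B (app s (lam v) w) (sub v head (comm s) w)
    η⊸  : ∀ {Γ A B} (v : Γ ⊢ A ⊸ᵗ B) →
          Conv Γ (A ⊸ᵗ B) v (lam (app (right allL) v var))
    β𝕀  : ∀ {Γ A} (v : Γ ⊢ A) → Conv Γ A (letu allR unit v) v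
    η𝕀  : ∀ {Γ} (v : Γ ⊢ 𝕀) → Conv Γ 𝕀 (letu allL v unit) v
    β⊗  : ∀ {Γ Γ₁ Γ₂ Γ₁₁ Γ₁₂ A B C} (s : Γ ≈ Γ₁ ⋈ Γ₂) (s' : Γ₁ ≈ Γ₁₁ ⋈ Γ₁₂)
          (v : Γ₁₁ ⊢ A) (w : Γ₁₂ ⊢ B) (u : (A ∷ B ∷ Γ₂) ⊢ C) →
          Conv Γ C (pm s (pair s' v w) u) (β⊗-rhs s s' v w u)
    η⊗  : ∀ {Γ A B} (v : Γ ⊢ A ⊗ᵗ B) →
          Conv Γ (A ⊗ᵗ B) (pm allL v (pair (left (right [])) var var)) v
    -- v to ∗. u[∗/z] = u[v/z]
    η𝕀' : ∀ {Γ Γ₁ Γ₂ C} (s : Γ ≈ Γ₁ ⋈ Γ₂) (v : Γ₁ ⊢ 𝕀) (u : (𝕀 ∷ Γ₂) ⊢ C) →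
          Conv Γ C (letu s v (sub u head allR unit)) (sub u head s v)
    -- pm v to x⊗y. u[x⊗y/z] = u[v/z]
    η⊗' : ∀ {Γ Γ₁ Γ₂ A B C} (s : Γ ≈ Γ₁ ⋈ Γ₂) (v : Γ₁ ⊢ A ⊗ᵗ B) (u : ((A ⊗ᵗ B) ∷ Γ₂) ⊢ C) →
          Conv Γ C (pm s v (sub u head (left (left allR)) (pair (left (right [])) var var)))
                   (sub u head s v)
    -- u[(v to ∗. w)/z] = v to ∗. u[w/z]
    cc𝕀 : ∀ {Γ Γ₁ Γ₂ Γ₁₁ Γ₁₂ A C} (s : Γ ≈ Γ₁ ⋈ Γ₂) (s' : Γ₁ ≈ Γ₁₁ ⋈ Γ₁₂)
          (v : Γ₁₁ ⊢ 𝕀) (w : Γ₁₂ ⊢ A) (u : (A ∷ Γ₂) ⊢ C) →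
          Conv Γ C (sub u head s (letu s' v w)) (ccI-rhs s s' v w u)
    -- u[(pm v to x⊗y. w)/z] = pm v to x⊗y. u[w/z]
    cc⊗ : ∀ {Γ Γ₁ Γ₂ Γ₁₁ Γ₁₂ A B D C} (s : Γ ≈ Γ₁ ⋈ Γ₂) (s' : Γ₁ ≈ Γ₁₁ ⋈ Γ₁₂)
          (v : Γ₁₁ ⊢ A ⊗ᵗ B) (w : (A ∷ B ∷ Γ₁₂) ⊢ D) (u : (D ∷ Γ₂) ⊢ C) →
          Conv Γ C (sub u head s (pm s' v w)) (cc⊗-rhs s s' v w u)

module _ {ℓ : Level} (V : Quantale ℓ) where
  open Quantale V

  record Theory : Set (lsuc ℓ) where
    field
      sig : Signature ℓ
    open Terms sig public
    field
      Ax   : (Γ : Ctx) (A : Type) → Γ ⊢ A → Γ ⊢ A → Carrier → Set ℓ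
      Ax-B : ∀ {Γ A v w q} → Ax Γ A v w q → B q

  module TheoryThm (T : Theory) where
    open Theory T
    open Signature sig

    mutual
      data Thm : (Γ : Ctx) (A : Type) → Γ ⊢ A → Γ ⊢ A → Carrier → Set ℓ where
        ax     : ∀ {Γ A v w q} → Ax Γ A v w q → Thm Γ A v w q
        conv   : ∀ {Γ A v w} → Conv Γ A v w → Thm Γ A v w ⊤V
        conv⁻  : ∀ {Γ A v w} → Conv Γ A v w → Thm Γ A w v ⊤V
        refl   : ∀ {Γ A v} → Thm Γ A v v ⊤V
        trans  : ∀ {Γ A u v w q r} → Thm Γ A u v q → Thm Γ A v w r → Thm Γ A u w (q ⊗ r)
        weak   : ∀ {Γ A v w q r} → r ≤ q → Thm Γ A v w q → Thm Γ A v w r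
        arch   : ∀ {Γ A v w q} → (∀ r → r ≪ q → Thm Γ A v w r) → Thm Γ A v w q
        join⊥  : ∀ {Γ A v w} → Thm Γ A v w ⊥V
        join∨  : ∀ {Γ A v w q r} → Thm Γ A v w q → Thm Γ A v w r → Thm Γ A v w (q ∨ r)
        c-op   : ∀ {Γ} (f : Op) {as as' q} → ThmArgs Γ (dom₀ f) (domₛ f) as as' q →
                 Thm Γ (cod f) (op f as) (op f as') q
        c-letu : ∀ {Γ Γ₁ Γ₂ A v v' w w' q r} (s : Γ ≈ Γ₁ ⋈ Γ₂) →
                 Thm Γ₁ 𝕀 v v' q → Thm Γ₂ A w w' r →
                 Thm Γ A (letu s v w) (letu s v' w') (q ⊗ r)
        c-pair : ∀ {Γ Γ₁ Γ₂ A B v v' w w' q r} (s : Γ ≈ Γ₁ ⋈ Γ₂) →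
                 Thm Γ₁ A v v' q → Thm Γ₂ B w w' r →
                 Thm Γ (A ⊗ᵗ B) (pair s v w) (pair s v' w') (q ⊗ r)
        c-pm   : ∀ {Γ Γ₁ Γ₂ A B C v v' w w' q r} (s : Γ ≈ Γ₁ ⋈ Γ₂) →
                 Thm Γ₁ (A ⊗ᵗ B) v v' q → Thm (A ∷ B ∷ Γ₂) C w w' r →
                 Thm Γ C (pm s v w) (pm s v' w') (q ⊗ r)
        c-lam  : ∀ {Γ A B v w q} → Thm (A ∷ Γ) B v w q →
                 Thm Γ (A ⊸ᵗ B) (lam v) (lam w) q
        c-app  : ∀ {Γ Γ₁ Γ₂ A B v v' w w' q r} (s : Γ ≈ Γ₁ ⋈ Γ₂) →
                 Thm Γ₁ (A ⊸ᵗ B) v v' q → Thm Γ₂ A w w' r →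
                 Thm Γ B (app s v w) (app s v' w') (q ⊗ r)
        c-sub  : ∀ {Γ Δ Ψ A B v w v' w' q r} →
                 Thm (A ∷ Γ) B v w q → Thm Δ A v' w' r → (s : Ψ ≈ Δ ⋈ Γ) →
                 Thm Ψ B (sub v head s v') (sub w head s w') (q ⊗ r)
        -- context permutation (moving the head variable to any position;
        -- these moves generate all permutations)
        perm   : ∀ {Γ Ψ A B v w q} → Thm (A ∷ Γ) B v w q → (s : Ψ ≈ (A ∷ []) ⋈ Γ) →
                 Thm Ψ B (sub v head s var) (sub w head s var) q

      data ThmArgs : (Γ : Ctx) (A : Type) (As : List Type) →
                     Args Γ A As → Args Γ A As → Carrier → Set ℓ where
        one  : ∀ {Γ A v w q} → Thm Γ A v w q → ThmArgs Γ A [] (one v) (one w) q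
        cons : ∀ {Γ Γ₁ Γ₂ A B Bs v w as as' q r} (s : Γ ≈ Γ₁ ⋈ Γ₂) →
               Thm Γ₁ A v w q → ThmArgs Γ₂ B Bs as as' r →
               ThmArgs Γ A (B ∷ Bs) (cons s v as) (cons s w as') (q ⊗ r)

  Syn : Theory → VCatStr V
  Syn T = record
    { Obj = Type
    ; Hom = λ A B → (A ∷ []) ⊢ B
    ; d   = λ {A} {B} v w → ⋁ (λ q → Thm (A ∷ []) B v w q)
    ; id  = var
    ; _∘_ = λ g f → sub g head (left []) f
    }
    where
      open Theory T
      open TheoryThm T

module _ {ℓ : Level} {V : Quantale ℓ} (𝒞 : EnrAutCat V) where
  open Quantale V
  open EnrAutCat 𝒞

  iTy : Ty Obj → Obj
  iTy (gr X)   = X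
  iTy 𝕀        = 𝟙
  iTy (A ⊗ᵗ B) = iTy A ⊗₀ iTy B
  iTy (A ⊸ᵗ B) = iTy A ⊸₀ iTy B

  data LangOp : Set ℓ where
    mor  : ∀ {X Y} → Hom X Y → LangOp
    isoᵢ : Ty Obj → LangOp
    isoₒ : Ty Obj → LangOp

  LangSig : Signature ℓ
  LangSig = record
    { G    = Obj
    ; Op   = LangOp
    ; dom₀ = dom₀'
    ; domₛ = λ _ → []
    ; cod  = cod'
    }
    where
      dom₀' : LangOp → Ty Obj
      dom₀' (mor {X} {Y} f) = gr X
      dom₀' (isoᵢ A) = A
      dom₀' (isoₒ A) = gr (iTy A)
      cod' : LangOp → Ty Obj
      cod' (mor {X} {Y} f) = gr Y
      cod' (isoᵢ A) = gr (iTy A)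
      cod' (isoₒ A) = A

  open Terms LangSig

  ⟦_⟧ty : Type → Obj
  ⟦_⟧ty = iTy

  ⟦_⟧ctx : Ctx → Obj
  ⟦ [] ⟧ctx    = 𝟙
  ⟦ A ∷ Γ ⟧ctx = ⟦ A ⟧ty ⊗₀ ⟦ Γ ⟧ctx

  ⟦_,_⟧args : Type → List Type → Obj
  ⟦ A , [] ⟧args     = ⟦ A ⟧ty
  ⟦ A , B ∷ Bs ⟧args = ⟦ A ⟧ty ⊗₀ ⟦ B , Bs ⟧args

  ⟦_⟧sp : ∀ {Γ Γ₁ Γ₂} → Γ ≈ Γ₁ ⋈ Γ₂ → Hom ⟦ Γ ⟧ctx (⟦ Γ₁ ⟧ctx ⊗₀ ⟦ Γ₂ ⟧ctx)
  ⟦ [] ⟧sp      = lu⁻¹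
  ⟦ left s ⟧sp  = α⁻¹ ∘ (id ⊗₁ ⟦ s ⟧sp)
  ⟦ right s ⟧sp = α ∘ (σ ⊗₁ id) ∘ α⁻¹ ∘ (id ⊗₁ ⟦ s ⟧sp)

  ⟦_⟧op : (f : LangOp) → Hom ⟦ Signature.dom₀ LangSig f , Signature.domₛ LangSig f ⟧args
                              ⟦ Signature.cod LangSig f ⟧ty
  ⟦ mor f ⟧op  = f
  ⟦ isoᵢ A ⟧op = id
  ⟦ isoₒ A ⟧op = id

  mutual
    ⟦_⟧tm : ∀ {Γ A} → Γ ⊢ A → Hom ⟦ Γ ⟧ctx ⟦ A ⟧ty
    ⟦ var ⟧tm        = ru
    ⟦ op f as ⟧tm    = ⟦ f ⟧op ∘ ⟦ as ⟧as
    ⟦ unit ⟧tm       = id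
    ⟦ letu s v w ⟧tm = lu ∘ (⟦ v ⟧tm ⊗₁ ⟦ w ⟧tm) ∘ ⟦ s ⟧sp
    ⟦ pair s v w ⟧tm = (⟦ v ⟧tm ⊗₁ ⟦ w ⟧tm) ∘ ⟦ s ⟧sp
    ⟦ pm s v w ⟧tm   = ⟦ w ⟧tm ∘ α ∘ (⟦ v ⟧tm ⊗₁ id) ∘ ⟦ s ⟧sp
    ⟦ lam v ⟧tm      = cur (⟦ v ⟧tm ∘ σ)
    ⟦ app s v w ⟧tm  = ev ∘ (⟦ v ⟧tm ⊗₁ ⟦ w ⟧tm) ∘ ⟦ s ⟧sp

    ⟦_⟧as : ∀ {Γ A As} → Args Γ A As → Hom ⟦ Γ ⟧ctx ⟦ A , As ⟧args
    ⟦ one v ⟧as       = ⟦ v ⟧tm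
    ⟦ cons s v as ⟧as = (⟦ v ⟧tm ⊗₁ ⟦ as ⟧as) ∘ ⟦ s ⟧sp

  Lang : Theory V
  Lang = record
    { sig  = LangSig
    ; Ax   = λ Γ A v w q → B q × (q ≤ d ⟦ v ⟧tm ⟦ w ⟧tm)
    ; Ax-B = λ x → proj₁ x
    }

{-# OPTIONS --safe #-}
-- Soundness: interpreting x:A ▷ v : B as ⟦v⟧ ∘ ru⁻¹ sends every theorem v =_q w of Lang 𝒞 to
-- q ≤ d ⟦v⟧ ⟦w⟧. The heart of this is the substitution lemma ⟦v[t/x]⟧ = ⟦v⟧ ∘ plug ⟦t⟧, which
-- reduces, via the symmetric monoidal coherence of the maps interpreting context splittings, to
-- naturality; the βη- and commuting conversions then follow from it, and the closure rules of
-- theorems are matched by the V-functoriality of ∘, ⊗ and currying and by continuity of V.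
-- So ⟦_⟧ is a V-functor Syn(Lang 𝒞) → 𝒞. Conversely a morphism f is named by the term f(x), and
-- since every equation valid in 𝒞 is an axiom of Lang 𝒞, ⟦_⟧ reflects equality. The operation
-- symbols A ≅ i(A) give the unit of the equivalence; the counit is the identity, as i(X) = X.

module Submission where

open import Level using (Level; lift)
open import Data.Product using (Σ; _×_; _,_; proj₁; proj₂)
open import Data.Sum using (_⊎_; inj₁; inj₂)
open import Data.List using ([]; _∷_)
open import Data.List.Relation.Unary.All using (All) renaming ([] to []ᴬ; _∷_ to _∷ᴬ_)
open import Relation.Binary.Bundles using (Setoid)
open import Relation.Binary.PropositionalEquality as PE using (_≡_)
import Relation.Binary.Reasoning.Setoid as SetoidReasoning
open import Function.Bundles using (Equivalence)
open import Defs

module QuantaleProperties {ℓ : Level} (V : Quantale ℓ) where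
  open Quantale V

  ≤-reflexive : ∀ {x y} → x ≡ y → x ≤ y
  ≤-reflexive PE.refl = ≤-refl

  k≤⇒⊤≤ : ∀ {x} → k ≤ x → ⊤V ≤ x
  k≤⇒⊤≤ = ≤-trans (≤-reflexive (PE.sym integral))

  ⊥-least : ∀ {x} → ⊥V ≤ x
  ⊥-least = ⋁-least _ (λ { (lift ()) })

  ∨-least : ∀ {x y z} → x ≤ z → y ≤ z → x ∨ y ≤ z
  ∨-least x≤z y≤z = ⋁-least _ (λ { (inj₁ PE.refl) → x≤z ; (inj₂ PE.refl) → y≤z })

  ∨-absorb : ∀ {x y} → x ≤ y → x ∨ y ≡ y
  ∨-absorb x≤y = ≤-antisym (∨-least x≤y ≤-refl) (⋁-ub _ (inj₂ PE.refl))

  -- Monotonicity of ⊗ is not an axiom: it comes from distributivity over the join x ∨ y = y.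
  ⊗-monoʳ : ∀ z {x y} → x ≤ y → z ⊗ x ≤ z ⊗ y
  ⊗-monoʳ z {x} x≤y =
    ≤-trans (⋁-ub _ (x , inj₁ PE.refl , PE.refl))
      (≤-reflexive (PE.trans (PE.sym (⊗-distrib z _)) (PE.cong (z ⊗_) (∨-absorb x≤y))))

  ⊗-monoˡ : ∀ z {x y} → x ≤ y → x ⊗ z ≤ y ⊗ z
  ⊗-monoˡ z {x} {y} x≤y =
    ≤-trans (≤-reflexive (⊗-comm x z)) (≤-trans (⊗-monoʳ z x≤y) (≤-reflexive (⊗-comm z y)))

  ⊗-mono : ∀ {x y x' y'} → x ≤ x' → y ≤ y' → x ⊗ y ≤ x' ⊗ y'
  ⊗-mono {y = y} {x'} p q = ≤-trans (⊗-monoˡ y p) (⊗-monoʳ x' q)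

  ≤-k⊗ : ∀ {x} → x ≤ k ⊗ x
  ≤-k⊗ {x} = ≤-reflexive (PE.sym (⊗-unit x))

  ≤-⊗k : ∀ {x} → x ≤ x ⊗ k
  ≤-⊗k {x} = ≤-reflexive (PE.sym (PE.trans (⊗-comm x k) (⊗-unit x)))

  k≤-⊗ : ∀ {x y} → k ≤ x → k ≤ y → k ≤ x ⊗ y
  k≤-⊗ p q = ≤-trans ≤-k⊗ (⊗-mono p q)

  ≪⇒≤ : ∀ {y x} → y ≪ x → y ≤ x
  ≪⇒≤ {y} {x} y≪x with Equivalence.to (≪-is-waybelow y x) y≪x (_≡ x) (⋁-ub _ PE.refl)
  ... | A , A≡x , y≤⋁A = ≤-trans y≤⋁A (⋁fin-≤ A≡x)
    where
    ⋁fin-≤ : ∀ {A} → All (_≡ x) A → ⋁fin A ≤ x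
    ⋁fin-≤ []ᴬ                = ⊥-least
    ⋁fin-≤ (PE.refl ∷ᴬ A≡x) = ∨-least ≤-refl (⋁fin-≤ A≡x)

module HomReasoning {ℓ : Level} {V : Quantale ℓ} (𝒞 : EnrAutCat V) where
  open Quantale V using (_≤_; ≤-refl; ≤-trans; _⊗_)
  open QuantaleProperties V
  open EnrAutCat 𝒞 public

  ≈-refl : ∀ {A B} {f : Hom A B} → f ≈ f
  ≈-refl {f = f} = d-refl f , d-refl f

  ≈-sym : ∀ {A B} {f g : Hom A B} → f ≈ g → g ≈ f
  ≈-sym (p , q) = q , p

  ≈-trans : ∀ {A B} {f g h : Hom A B} → f ≈ g → g ≈ h → f ≈ h
  ≈-trans {f = f} {g} {h} (p , q) (p' , q') =
    ≤-trans (k≤-⊗ p p') (d-trans f g h) , ≤-trans (k≤-⊗ q' q) (d-trans h g f)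

  hom-setoid : Obj → Obj → Setoid ℓ ℓ
  hom-setoid A B = record
    { Carrier = Hom A B
    ; _≈_ = _≈_
    ; isEquivalence = record { refl = ≈-refl ; sym = ≈-sym ; trans = ≈-trans }
    }

  module _ {A B : Obj} where
    open SetoidReasoning (hom-setoid A B) public using (begin_; step-≈-⟩; step-≈-⟨; _∎)

  d-resp-≈ : ∀ {A B} {f f' g g' : Hom A B} → f ≈ f' → g ≈ g' → d f g ≤ d f' g'
  d-resp-≈ {f = f} {f'} {g} {g'} (_ , f'≥f) (g≤g' , _) =
    ≤-trans ≤-k⊗ (≤-trans (⊗-mono f'≥f (≤-trans ≤-⊗k (⊗-mono ≤-refl g≤g')))
      (≤-trans (⊗-monoʳ (d f' f) (d-trans f g g')) (d-trans f' f g')))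

  d-∘ : ∀ {A B C} {g g' : Hom B C} {f f' : Hom A B} {q r} →
        q ≤ d g g' → r ≤ d f f' → q ⊗ r ≤ d (g ∘ f) (g' ∘ f')
  d-∘ p p' = ≤-trans (⊗-mono p p') (∘-vfun _ _ _ _)

  d-⊗ : ∀ {A B C D} {f f' : Hom A B} {g g' : Hom C D} {q r} →
        q ≤ d f f' → r ≤ d g g' → q ⊗ r ≤ d (f ⊗₁ g) (f' ⊗₁ g')
  d-⊗ p p' = ≤-trans (⊗-mono p p') (⊗-vfun _ _ _ _)

  d-∘ʳ : ∀ {A B C} {f f' : Hom B C} (m : Hom A B) → d f f' ≤ d (f ∘ m) (f' ∘ m)
  d-∘ʳ m = ≤-trans ≤-⊗k (d-∘ ≤-refl (d-refl m))

  d-∘ˡ : ∀ {A B C} {f f' : Hom A B} (h : Hom B C) → d f f' ≤ d (h ∘ f) (h ∘ f')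
  d-∘ˡ h = ≤-trans ≤-k⊗ (d-∘ (d-refl h) ≤-refl)

  d-⊗id : ∀ {A B C} {f f' : Hom A B} → d f f' ≤ d (f ⊗₁ id {C}) (f' ⊗₁ id)
  d-⊗id = ≤-trans ≤-⊗k (d-⊗ ≤-refl (d-refl id))

  infixr 4 _⟩∘⟨_ _⟩⊗⟨_
  infixr 3 refl⟩∘⟨_
  infixl 5 _⟩∘⟨refl
  _⟩∘⟨_ : ∀ {A B C} {g g' : Hom B C} {f f' : Hom A B} → g ≈ g' → f ≈ f' → g ∘ f ≈ g' ∘ f'
  _⟩∘⟨_ {g = g} {g'} {f} {f'} (p , q) (p' , q') =
    ≤-trans (k≤-⊗ p p') (∘-vfun g g' f f') , ≤-trans (k≤-⊗ q q') (∘-vfun g' g f' f)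

  _⟩⊗⟨_ : ∀ {A B C D} {f f' : Hom A B} {g g' : Hom C D} → f ≈ f' → g ≈ g' → f ⊗₁ g ≈ f' ⊗₁ g'
  _⟩⊗⟨_ {f = f} {f'} {g} {g'} (p , q) (p' , q') =
    ≤-trans (k≤-⊗ p p') (⊗-vfun f f' g g') , ≤-trans (k≤-⊗ q q') (⊗-vfun f' f g' g)

  refl⟩∘⟨_ : ∀ {A B C} {g : Hom B C} {f f' : Hom A B} → f ≈ f' → g ∘ f ≈ g ∘ f'
  refl⟩∘⟨ p = ≈-refl ⟩∘⟨ p

  _⟩∘⟨refl : ∀ {A B C} {g g' : Hom B C} {f : Hom A B} → g ≈ g' → g ∘ f ≈ g' ∘ f
  p ⟩∘⟨refl = p ⟩∘⟨ ≈-refl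

  cur-cong : ∀ {A X B'} {f f' : Hom (A ⊗₀ X) B'} → f ≈ f' → cur f ≈ cur f'
  cur-cong {f = f} {f'} (p , q) = ≤-trans p (cur-vfun f f') , ≤-trans q (cur-vfun f' f)

  assoc⁻ : ∀ {A B C D} {h : Hom C D} {g : Hom B C} {f : Hom A B} → h ∘ (g ∘ f) ≈ (h ∘ g) ∘ f
  assoc⁻ = ≈-sym (assoc _ _ _)

  assoc⁺ : ∀ {A B C D} {h : Hom C D} {g : Hom B C} {f : Hom A B} → (h ∘ g) ∘ f ≈ h ∘ (g ∘ f)
  assoc⁺ = assoc _ _ _

  assoc₃⁺ : ∀ {A B C D E} {a : Hom D E} {b : Hom C D} {c : Hom B C} {d' : Hom A B} → (a ∘ b ∘ c) ∘ d' ≈ a ∘ b ∘ c ∘ d'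
  assoc₃⁺ = ≈-trans assoc⁺ (refl⟩∘⟨ assoc⁺)

  assoc₄⁻ : ∀ {A B C D E F} {u : Hom E F} {x : Hom D E} {y : Hom C D} {z : Hom B C} {R : Hom A B} →
           u ∘ x ∘ y ∘ z ∘ R ≈ (u ∘ x ∘ y ∘ z) ∘ R
  assoc₄⁻ = ≈-trans (refl⟩∘⟨ refl⟩∘⟨ assoc⁻) (≈-trans (refl⟩∘⟨ assoc⁻) assoc⁻)

  idL : ∀ {A B} {f : Hom A B} → id ∘ f ≈ f
  idL = idˡ _
  idR : ∀ {A B} {f : Hom A B} → f ∘ id ≈ f
  idR = idʳ _

  pullˡ : ∀ {A B C D} {a : Hom C D} {b : Hom B C} {c : Hom B D} {f : Hom A B} →
          a ∘ b ≈ c → a ∘ (b ∘ f) ≈ c ∘ f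
  pullˡ p = ≈-trans assoc⁻ (p ⟩∘⟨refl)

  pushˡ : ∀ {A B C D} {a : Hom C D} {b : Hom B C} {c : Hom B D} {f : Hom A B} →
          c ≈ a ∘ b → c ∘ f ≈ a ∘ (b ∘ f)
  pushˡ p = ≈-sym (pullˡ (≈-sym p))

  swapˡ : ∀ {A B C C' D} {a : Hom C D} {b : Hom B C} {c : Hom C' D} {e : Hom B C'} {f : Hom A B} →
          a ∘ b ≈ c ∘ e → a ∘ (b ∘ f) ≈ c ∘ (e ∘ f)
  swapˡ p = ≈-trans (pullˡ p) assoc⁺

  cancelˡ : ∀ {A B C} {a : Hom C B} {b : Hom B C} {f : Hom A B} → a ∘ b ≈ id → a ∘ (b ∘ f) ≈ f
  cancelˡ p = ≈-trans (pullˡ p) idL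

  insertˡ : ∀ {A B C} {a : Hom C B} {b : Hom B C} {f : Hom A B} → a ∘ b ≈ id → f ≈ a ∘ (b ∘ f)
  insertˡ p = ≈-sym (cancelˡ p)

  cancelʳ : ∀ {A B C} {a : Hom C B} {b : Hom B C} {f : Hom B A} → a ∘ b ≈ id → (f ∘ a) ∘ b ≈ f
  cancelʳ p = ≈-trans assoc⁺ (≈-trans (refl⟩∘⟨ p) idR)

  ⊗-merge : ∀ {A B C D E F} {f : Hom A B} {f' : Hom B C} {g : Hom D E} {g' : Hom E F} →
       (f' ⊗₁ g') ∘ (f ⊗₁ g) ≈ (f' ∘ f) ⊗₁ (g' ∘ g)
  ⊗-merge = ≈-sym (⊗-∘ _ _ _ _)

  serialize₁₂ : ∀ {A B C D} {f : Hom A B} {g : Hom C D} → f ⊗₁ g ≈ (f ⊗₁ id) ∘ (id ⊗₁ g)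
  serialize₁₂ = ≈-trans (≈-sym idR ⟩⊗⟨ ≈-sym idL) (≈-sym ⊗-merge)

  serialize₂₁ : ∀ {A B C D} {f : Hom A B} {g : Hom C D} → f ⊗₁ g ≈ (id ⊗₁ g) ∘ (f ⊗₁ id)
  serialize₂₁ = ≈-trans (≈-sym idL ⟩⊗⟨ ≈-sym idR) (≈-sym ⊗-merge)

  ⊗-commute : ∀ {A B C D} {f : Hom A B} {g : Hom C D} → (f ⊗₁ id) ∘ (id ⊗₁ g) ≈ (id ⊗₁ g) ∘ (f ⊗₁ id)
  ⊗-commute = ≈-trans ⊗-merge (≈-trans (idR ⟩⊗⟨ idL) serialize₂₁)

  id⊗-cong : ∀ {A B C} {f g : Hom A B} → f ≈ g → id {C} ⊗₁ f ≈ id ⊗₁ g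
  id⊗-cong p = ≈-refl ⟩⊗⟨ p


module MonoidalCoherence {ℓ : Level} {V : Quantale ℓ} (𝒞 : EnrAutCat V) where
  open HomReasoning 𝒞 public

  Iso : ∀ {A B} → Hom A B → Hom B A → Set ℓ
  Iso f g = (f ∘ g ≈ id) × (g ∘ f ≈ id)

  iso-resp-≈ : ∀ {A B} {f f₂ : Hom A B} {g} → f ≈ f₂ → Iso f g → Iso f₂ g
  iso-resp-≈ p (i , j) = ≈-trans (≈-sym p ⟩∘⟨refl) i , ≈-trans (refl⟩∘⟨ ≈-sym p) j

  iso-sym : ∀ {A B} {f : Hom A B} {g} → Iso f g → Iso g f
  iso-sym (p , q) = q , p

  iso-cancelˡ : ∀ {A B C} {a : Hom B C} {a' : Hom C B} {x y : Hom A B} → a' ∘ a ≈ id → a ∘ x ≈ a ∘ y → x ≈ y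
  iso-cancelˡ {a = a} {a'} {x} {y} i p = begin
    x ≈⟨ cancelˡ i ⟨ a' ∘ a ∘ x ≈⟨ refl⟩∘⟨ p ⟩ a' ∘ a ∘ y ≈⟨ cancelˡ i ⟩ y ∎

  iso-cancelʳ : ∀ {A B C} {a : Hom A B} {a' : Hom B A} {x y : Hom B C} → a ∘ a' ≈ id → x ∘ a ≈ y ∘ a → x ≈ y
  iso-cancelʳ {a = a} {a'} {x} {y} i p = begin
    x ≈⟨ cancelʳ i ⟨ (x ∘ a) ∘ a' ≈⟨ p ⟩∘⟨refl ⟩ (y ∘ a) ∘ a' ≈⟨ cancelʳ i ⟩ y ∎

  moveˡ : ∀ {A B C} {a : Hom B C} {a' : Hom C B} {x : Hom A B} {y : Hom A C} → a' ∘ a ≈ id → a ∘ x ≈ y → x ≈ a' ∘ y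
  moveˡ i p = ≈-trans (≈-sym (cancelˡ i)) (refl⟩∘⟨ p)

  moveʳ : ∀ {A B C} {a : Hom A B} {a' : Hom B A} {x : Hom B C} {y : Hom A C} → a ∘ a' ≈ id → x ∘ a ≈ y → x ≈ y ∘ a'
  moveʳ i p = ≈-trans (≈-sym (cancelʳ i)) (p ⟩∘⟨refl)

  iso-inverse-cong : ∀ {A B} {f g : Hom A B} {f' g' : Hom B A} → Iso f f' → Iso g g' → f ≈ g → f' ≈ g'
  iso-inverse-cong {f = f} {g} {f'} {g'} (i1 , i2) (j1 , j2) p = begin
    f' ≈⟨ idR ⟨ f' ∘ id ≈⟨ refl⟩∘⟨ ≈-sym j1 ⟩ f' ∘ g ∘ g' ≈⟨ refl⟩∘⟨ ≈-sym p ⟩∘⟨refl ⟩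
    f' ∘ f ∘ g' ≈⟨ cancelˡ i2 ⟩ g' ∎

  iso-∘ : ∀ {A B C} {f : Hom B C} {f' : Hom C B} {g : Hom A B} {g' : Hom B A} → Iso f f' → Iso g g' → Iso (f ∘ g) (g' ∘ f')
  iso-∘ (i1 , i2) (j1 , j2) =
    ≈-trans assoc⁺ (≈-trans (refl⟩∘⟨ cancelˡ j1) i1) ,
    ≈-trans assoc⁺ (≈-trans (refl⟩∘⟨ cancelˡ i2) j2)

  iso-⊗ : ∀ {A B C D} {f : Hom A B} {f'} {g : Hom C D} {g'} → Iso f f' → Iso g g' → Iso (f ⊗₁ g) (f' ⊗₁ g')
  iso-⊗ (i1 , i2) (j1 , j2) = ≈-trans ⊗-merge (≈-trans (i1 ⟩⊗⟨ j1) ⊗-id) , ≈-trans ⊗-merge (≈-trans (i2 ⟩⊗⟨ j2) ⊗-id)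

  iso-id : ∀ {A} → Iso (id {A}) id
  iso-id = idL , idL

  iso-α : ∀ {A B C} → Iso (α {A} {B} {C}) α⁻¹
  iso-α = α-iso₁ , α-iso₂
  iso-lu : ∀ {A} → Iso (lu {A}) lu⁻¹
  iso-lu = lu-iso₁ , lu-iso₂
  iso-ru : ∀ {A} → Iso (ru {A}) ru⁻¹
  iso-ru = ru-iso₁ , ru-iso₂
  iso-σ : ∀ {A B} → Iso (σ {A} {B}) σ
  iso-σ = σ-invol , σ-invol

  α⁻¹-nat : ∀ {A A' B B' C C'} (f : Hom A A') (g : Hom B B') (h : Hom C C') →
            α⁻¹ ∘ (f ⊗₁ (g ⊗₁ h)) ≈ ((f ⊗₁ g) ⊗₁ h) ∘ α⁻¹
  α⁻¹-nat f g h = moveʳ α-iso₁ (≈-trans assoc⁺ (≈-sym (moveˡ α-iso₂ (α-nat f g h))))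

  lu⁻¹-nat : ∀ {A A'} (f : Hom A A') → lu⁻¹ ∘ f ≈ (id ⊗₁ f) ∘ lu⁻¹
  lu⁻¹-nat f = moveʳ lu-iso₁ (≈-trans assoc⁺ (≈-sym (moveˡ lu-iso₂ (lu-nat f))))

  ru⁻¹-nat : ∀ {A A'} (f : Hom A A') → ru⁻¹ ∘ f ≈ (f ⊗₁ id) ∘ ru⁻¹
  ru⁻¹-nat f = moveʳ ru-iso₁ (≈-trans assoc⁺ (≈-sym (moveˡ ru-iso₂ (ru-nat f))))

  id𝟙⊗-injective : ∀ {A B} {f g : Hom A B} → id {𝟙} ⊗₁ f ≈ id ⊗₁ g → f ≈ g
  id𝟙⊗-injective {f = f} {g} p = iso-cancelʳ lu-iso₁ (≈-trans (≈-sym (lu-nat f)) (≈-trans (refl⟩∘⟨ p) (lu-nat g)))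

  ⊗id𝟙-injective : ∀ {A B} {f g : Hom A B} → f ⊗₁ id {𝟙} ≈ g ⊗₁ id → f ≈ g
  ⊗id𝟙-injective {f = f} {g} p = iso-cancelʳ ru-iso₁ (≈-trans (≈-sym (ru-nat f)) (≈-trans (refl⟩∘⟨ p) (ru-nat g)))

  α-comm : ∀ {A A' B B' C C'} {f : Hom A A'} {g : Hom B B'} {h : Hom C C'} →
           α ∘ ((f ⊗₁ g) ⊗₁ h) ≈ (f ⊗₁ (g ⊗₁ h)) ∘ α
  α-comm = α-nat _ _ _

  id⊗id⊗-α-⊗id : ∀ {A A' B C C'} {f : Hom A (A' ⊗₀ B)} {g : Hom C C'} →
                 (id ⊗₁ (id ⊗₁ g)) ∘ α ∘ (f ⊗₁ id) ≈ α ∘ (f ⊗₁ id) ∘ (id ⊗₁ g)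
  id⊗id⊗-α-⊗id {f = f} {g} = begin
    (id ⊗₁ (id ⊗₁ g)) ∘ α ∘ (f ⊗₁ id) ≈⟨ swapˡ α-comm ⟨
    α ∘ ((id ⊗₁ id) ⊗₁ g) ∘ (f ⊗₁ id) ≈⟨ refl⟩∘⟨ (⊗-id ⟩⊗⟨ ≈-refl) ⟩∘⟨refl ⟩
    α ∘ (id ⊗₁ g) ∘ (f ⊗₁ id)         ≈⟨ refl⟩∘⟨ ⊗-commute ⟨
    α ∘ (f ⊗₁ id) ∘ (id ⊗₁ g)         ∎

  -- Kelly's consequences of the pentagon, triangle and hexagon axioms.
  lu-α : ∀ {A B} → lu {A ⊗₀ B} ∘ α ≈ lu ⊗₁ id
  lu-α = id𝟙⊗-injective (iso-cancelʳ {a = α ∘ (α ⊗₁ id)} (proj₁ (iso-∘ iso-α (iso-⊗ iso-α iso-id))) (begin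
      (id ⊗₁ (lu ∘ α)) ∘ α ∘ (α ⊗₁ id)
        ≈⟨ ≈-trans (≈-sym idL ⟩⊗⟨ ≈-refl) (≈-sym ⊗-merge) ⟩∘⟨refl ⟩
      ((id ⊗₁ lu) ∘ (id ⊗₁ α)) ∘ α ∘ (α ⊗₁ id)
        ≈⟨ assoc⁺ ⟩
      (id ⊗₁ lu) ∘ (id ⊗₁ α) ∘ α ∘ (α ⊗₁ id)
        ≈⟨ refl⟩∘⟨ pentagon ⟩
      (id ⊗₁ lu) ∘ α ∘ α
        ≈⟨ pullˡ triangle ⟩
      (ru ⊗₁ id) ∘ α
        ≈⟨ (≈-refl ⟩⊗⟨ ≈-sym ⊗-id) ⟩∘⟨refl ⟩
      (ru ⊗₁ (id ⊗₁ id)) ∘ α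
        ≈⟨ α-comm ⟨
      α ∘ ((ru ⊗₁ id) ⊗₁ id)
        ≈⟨ refl⟩∘⟨ (≈-sym triangle ⟩⊗⟨ ≈-sym idL) ⟩
      α ∘ (((id ⊗₁ lu) ∘ α) ⊗₁ (id ∘ id))
        ≈⟨ refl⟩∘⟨ ≈-sym ⊗-merge ⟩
      α ∘ ((id ⊗₁ lu) ⊗₁ id) ∘ (α ⊗₁ id)
        ≈⟨ swapˡ α-comm ⟩
      (id ⊗₁ (lu ⊗₁ id)) ∘ α ∘ (α ⊗₁ id) ∎))

  id⊗ru-α : ∀ {A B} → (id {A} ⊗₁ ru {B}) ∘ α ≈ ru
  id⊗ru-α = ⊗id𝟙-injective (iso-cancelˡ {a = α} α-iso₂ (begin
      α ∘ (((id ⊗₁ ru) ∘ α) ⊗₁ id)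
        ≈⟨ refl⟩∘⟨ (≈-refl ⟩⊗⟨ ≈-sym idL) ⟩
      α ∘ (((id ⊗₁ ru) ∘ α) ⊗₁ (id ∘ id))
        ≈⟨ refl⟩∘⟨ ≈-sym ⊗-merge ⟩
      α ∘ ((id ⊗₁ ru) ⊗₁ id) ∘ (α ⊗₁ id)
        ≈⟨ swapˡ α-comm ⟩
      (id ⊗₁ (ru ⊗₁ id)) ∘ α ∘ (α ⊗₁ id)
        ≈⟨ (≈-refl ⟩⊗⟨ ≈-sym triangle) ⟩∘⟨refl ⟩
      (id ⊗₁ ((id ⊗₁ lu) ∘ α)) ∘ α ∘ (α ⊗₁ id)
        ≈⟨ ≈-trans (≈-sym idL ⟩⊗⟨ ≈-refl) (≈-sym ⊗-merge) ⟩∘⟨refl ⟩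
      ((id ⊗₁ (id ⊗₁ lu)) ∘ (id ⊗₁ α)) ∘ α ∘ (α ⊗₁ id)
        ≈⟨ assoc⁺ ⟩
      (id ⊗₁ (id ⊗₁ lu)) ∘ (id ⊗₁ α) ∘ α ∘ (α ⊗₁ id)
        ≈⟨ refl⟩∘⟨ pentagon ⟩
      (id ⊗₁ (id ⊗₁ lu)) ∘ α ∘ α
        ≈⟨ pullˡ (≈-sym α-comm) ⟩
      (α ∘ ((id ⊗₁ id) ⊗₁ lu)) ∘ α
        ≈⟨ assoc⁺ ⟩
      α ∘ ((id ⊗₁ id) ⊗₁ lu) ∘ α
        ≈⟨ refl⟩∘⟨ (⊗-id ⟩⊗⟨ ≈-refl) ⟩∘⟨refl ⟩
      α ∘ (id ⊗₁ lu) ∘ α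
        ≈⟨ refl⟩∘⟨ triangle ⟩
      α ∘ (ru ⊗₁ id) ∎))

  id𝟙⊗lu : ∀ {A} → id {𝟙} ⊗₁ lu {A} ≈ lu
  id𝟙⊗lu = iso-cancelˡ {a = lu} lu-iso₂ (lu-nat lu)

  lu≈ru : lu {𝟙} ≈ ru
  lu≈ru = ⊗id𝟙-injective (begin
    lu ⊗₁ id ≈⟨ lu-α ⟨ lu ∘ α ≈⟨ ≈-sym id𝟙⊗lu ⟩∘⟨refl ⟩ (id ⊗₁ lu) ∘ α ≈⟨ triangle ⟩ ru ⊗₁ id ∎)

  lu-σ : ∀ {A} → lu ∘ σ {A} {𝟙} ≈ ru
  lu-σ = ⊗id𝟙-injective (iso-cancelˡ {a = σ} σ-invol (begin
      σ ∘ ((lu ∘ σ) ⊗₁ id)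
        ≈⟨ refl⟩∘⟨ (≈-refl ⟩⊗⟨ ≈-sym idL) ⟩
      σ ∘ ((lu ∘ σ) ⊗₁ (id ∘ id))
        ≈⟨ refl⟩∘⟨ ≈-sym ⊗-merge ⟩
      σ ∘ (lu ⊗₁ id) ∘ (σ ⊗₁ id)
        ≈⟨ refl⟩∘⟨ ≈-sym lu-α ⟩∘⟨refl ⟩
      σ ∘ (lu ∘ α) ∘ (σ ⊗₁ id)
        ≈⟨ refl⟩∘⟨ assoc⁺ ⟩
      σ ∘ lu ∘ α ∘ (σ ⊗₁ id)
        ≈⟨ pullˡ (≈-sym (lu-nat σ)) ⟩
      (lu ∘ (id ⊗₁ σ)) ∘ α ∘ (σ ⊗₁ id)
        ≈⟨ assoc⁺ ⟩
      lu ∘ (id ⊗₁ σ) ∘ α ∘ (σ ⊗₁ id)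
        ≈⟨ refl⟩∘⟨ hexagon ⟩
      lu ∘ α ∘ σ ∘ α
        ≈⟨ pullˡ lu-α ⟩
      (lu ⊗₁ id) ∘ σ ∘ α
        ≈⟨ pullˡ (≈-sym (σ-nat id lu)) ⟩
      (σ ∘ (id ⊗₁ lu)) ∘ α
        ≈⟨ assoc⁺ ⟩
      σ ∘ (id ⊗₁ lu) ∘ α
        ≈⟨ refl⟩∘⟨ triangle ⟩
      σ ∘ (ru ⊗₁ id) ∎))

  σ-𝟙 : σ {𝟙} {𝟙} ≈ id
  σ-𝟙 = iso-cancelˡ {a = lu} lu-iso₂ (≈-trans lu-σ (≈-trans (≈-sym lu≈ru) (≈-sym idR)))

  id-square : ∀ {A B} {f : Hom A B} → id ∘ f ≈ f ∘ id
  id-square = ≈-trans idL (≈-sym idR)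

  ⊗-square : ∀ {A B C D A' B' C' D'} {a : Hom B D} {f : Hom A B} {f' : Hom C D} {a' : Hom A C}
           {b : Hom B' D'} {g : Hom A' B'} {g' : Hom C' D'} {b' : Hom A' C'} →
         a ∘ f ≈ f' ∘ a' → b ∘ g ≈ g' ∘ b' → (a ⊗₁ b) ∘ (f ⊗₁ g) ≈ (f' ⊗₁ g') ∘ (a' ⊗₁ b')
  ⊗-square p q = ≈-trans ⊗-merge (≈-trans (p ⟩⊗⟨ q) (≈-sym ⊗-merge))

  ∘-⊗id : ∀ {A B C D} {f : Hom B C} {g : Hom A B} → (f ∘ g) ⊗₁ id {D} ≈ (f ⊗₁ id) ∘ (g ⊗₁ id)
  ∘-⊗id = ≈-trans (≈-refl ⟩⊗⟨ ≈-sym idL) (≈-sym ⊗-merge)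

  id⊗-∘ : ∀ {A B C D} {f : Hom B C} {g : Hom A B} → id {D} ⊗₁ (f ∘ g) ≈ (id ⊗₁ f) ∘ (id ⊗₁ g)
  id⊗-∘ = ≈-trans (≈-sym idL ⟩⊗⟨ ≈-refl) (≈-sym ⊗-merge)

  -- prefixᵢⱼ rewrites an i-fold composite at the head of a composite into a j-fold one.
  prefix₂₃ : ∀ {A B C D E F} {a : Hom C F} {b : Hom B C} {c : Hom E F} {d' : Hom D E} {e : Hom B D} {f : Hom A B} →
          a ∘ b ≈ c ∘ d' ∘ e → a ∘ b ∘ f ≈ c ∘ d' ∘ e ∘ f
  prefix₂₃ p = ≈-trans (pullˡ p) (≈-trans assoc⁺ (refl⟩∘⟨ assoc⁺))

  prefix₃₂ : ∀ {A B C D E F} {a : Hom C F} {b : Hom B C} {c : Hom E F} {d' : Hom D E} {e : Hom B D} {f : Hom A B} →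
          c ∘ d' ∘ e ≈ a ∘ b → c ∘ d' ∘ e ∘ f ≈ a ∘ b ∘ f
  prefix₃₂ p = ≈-sym (prefix₂₃ (≈-sym p))

  prefix₃₁ : ∀ {A B D E F} {a : Hom B F} {c : Hom E F} {d' : Hom D E} {e : Hom B D} {f : Hom A B} →
          c ∘ d' ∘ e ≈ a → c ∘ d' ∘ e ∘ f ≈ a ∘ f
  prefix₃₁ p = ≈-trans (refl⟩∘⟨ assoc⁻) (≈-trans assoc⁻ (p ⟩∘⟨refl))

  prefix₁₃ : ∀ {A B D E F} {a : Hom B F} {c : Hom E F} {d' : Hom D E} {e : Hom B D} {f : Hom A B} →
          a ≈ c ∘ d' ∘ e → a ∘ f ≈ c ∘ d' ∘ e ∘ f
  prefix₁₃ p = ≈-sym (prefix₃₁ (≈-sym p))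

  prefix₃₃ : ∀ {A B C D E F H} {a : Hom D H} {b : Hom C D} {c : Hom B C}
               {d' : Hom F H} {e : Hom E F} {f' : Hom B E} {g : Hom A B} →
             a ∘ b ∘ c ≈ d' ∘ e ∘ f' → a ∘ b ∘ c ∘ g ≈ d' ∘ e ∘ f' ∘ g
  prefix₃₃ p = ≈-trans (prefix₃₁ p) (prefix₁₃ ≈-refl)

  -- ⟦ right s ⟧sp is exch ∘ (id ⊗₁ ⟦ s ⟧sp): exch brings the head variable of the context to the front.
  exch : ∀ {A B C} → Hom (A ⊗₀ (B ⊗₀ C)) (B ⊗₀ (A ⊗₀ C))
  exch = α ∘ (σ ⊗₁ id) ∘ α⁻¹

  exch-unfold : ∀ {A B C X} {f : Hom X (A ⊗₀ (B ⊗₀ C))} → exch ∘ f ≈ α ∘ (σ ⊗₁ id) ∘ α⁻¹ ∘ f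
  exch-unfold = ≈-trans assoc⁺ (refl⟩∘⟨ assoc⁺)

  exch-nat : ∀ {A A' B B' C C'} {f : Hom A A'} {g : Hom B B'} {h : Hom C C'} →
          exch ∘ (f ⊗₁ (g ⊗₁ h)) ≈ (g ⊗₁ (f ⊗₁ h)) ∘ exch
  exch-nat {f = f} {g} {h} = begin
    exch ∘ (f ⊗₁ (g ⊗₁ h)) ≈⟨ exch-unfold ⟩
    α ∘ (σ ⊗₁ id) ∘ α⁻¹ ∘ (f ⊗₁ (g ⊗₁ h)) ≈⟨ refl⟩∘⟨ refl⟩∘⟨ α⁻¹-nat f g h ⟩
    α ∘ (σ ⊗₁ id) ∘ ((f ⊗₁ g) ⊗₁ h) ∘ α⁻¹ ≈⟨ refl⟩∘⟨ swapˡ (⊗-square (σ-nat f g) id-square) ⟩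
    α ∘ ((g ⊗₁ f) ⊗₁ h) ∘ (σ ⊗₁ id) ∘ α⁻¹ ≈⟨ swapˡ α-comm ⟩
    (g ⊗₁ (f ⊗₁ h)) ∘ exch ∎

  exch-invol : ∀ {A B C} → exch {B} {A} {C} ∘ exch ≈ id
  exch-invol = begin
    exch ∘ exch ≈⟨ exch-unfold ⟩
    α ∘ (σ ⊗₁ id) ∘ α⁻¹ ∘ α ∘ (σ ⊗₁ id) ∘ α⁻¹ ≈⟨ refl⟩∘⟨ refl⟩∘⟨ cancelˡ α-iso₂ ⟩
    α ∘ (σ ⊗₁ id) ∘ (σ ⊗₁ id) ∘ α⁻¹ ≈⟨ refl⟩∘⟨ pullˡ (≈-trans ⊗-merge (≈-trans (σ-invol ⟩⊗⟨ idL) ⊗-id)) ⟩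
    α ∘ id ∘ α⁻¹ ≈⟨ refl⟩∘⟨ idL ⟩
    α ∘ α⁻¹ ≈⟨ α-iso₁ ⟩
    id ∎

  iso-exch : ∀ {A B C} → Iso (exch {A} {B} {C}) exch
  iso-exch = exch-invol , exch-invol

  exch-α : ∀ {A B C} → exch ∘ α {A} {B} {C} ≈ α ∘ (σ ⊗₁ id)
  exch-α = ≈-trans exch-unfold (refl⟩∘⟨ ≈-trans (refl⟩∘⟨ α-iso₂) idR)

  α⁻¹-exch : ∀ {A B C} → α⁻¹ ∘ exch {A} {B} {C} ≈ (σ ⊗₁ id) ∘ α⁻¹
  α⁻¹-exch = cancelˡ α-iso₂

  pentagon⁻¹ : ∀ {A B C D} → (α⁻¹ ⊗₁ id) ∘ α⁻¹ ∘ (id ⊗₁ α⁻¹) ≈ α⁻¹ ∘ α⁻¹ {A} {B} {C ⊗₀ D}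
  pentagon⁻¹ = ≈-trans assoc⁻
    (iso-inverse-cong (iso-∘ (iso-⊗ iso-id iso-α) (iso-∘ iso-α (iso-⊗ iso-α iso-id))) (iso-∘ iso-α iso-α) pentagon)

  α⁻¹-id⊗α⁻¹ : ∀ {A B C D} → α⁻¹ ∘ (id ⊗₁ α⁻¹) ≈ (α ⊗₁ id) ∘ α⁻¹ ∘ α⁻¹ {A} {B} {C ⊗₀ D}
  α⁻¹-id⊗α⁻¹ = moveˡ (proj₁ (iso-⊗ iso-α iso-id)) pentagon⁻¹

  α⊗id-α⁻¹ : ∀ {A B C D} → (α ⊗₁ id) ∘ α⁻¹ ≈ α⁻¹ ∘ (id ⊗₁ α⁻¹) ∘ α {A} {B} {C ⊗₀ D}
  α⊗id-α⁻¹ = iso-cancelʳ {a = α} α-iso₁ (begin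
    ((α ⊗₁ id) ∘ α⁻¹) ∘ α ≈⟨ cancelʳ α-iso₂ ⟩
    α ⊗₁ id ≈⟨ moveˡ α-iso₂ (moveˡ (proj₂ (iso-⊗ iso-id iso-α)) pentagon) ⟩
    α⁻¹ ∘ (id ⊗₁ α⁻¹) ∘ α ∘ α ≈⟨ refl⟩∘⟨ assoc⁻ ⟩
    α⁻¹ ∘ ((id ⊗₁ α⁻¹) ∘ α) ∘ α ≈⟨ assoc⁻ ⟩
    (α⁻¹ ∘ (id ⊗₁ α⁻¹) ∘ α) ∘ α ∎)

  α⁻¹-id⊗α : ∀ {A B C D} → α⁻¹ ∘ (id ⊗₁ α) ≈ α ∘ (α⁻¹ ⊗₁ id) ∘ α⁻¹ {A} {B ⊗₀ C} {D}
  α⁻¹-id⊗α = iso-cancelʳ {a = α ∘ (α ⊗₁ id)} (proj₁ (iso-∘ iso-α (iso-⊗ iso-α iso-id))) (begin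
    (α⁻¹ ∘ (id ⊗₁ α)) ∘ α ∘ (α ⊗₁ id) ≈⟨ assoc⁺ ⟩
    α⁻¹ ∘ (id ⊗₁ α) ∘ α ∘ (α ⊗₁ id) ≈⟨ refl⟩∘⟨ pentagon ⟩
    α⁻¹ ∘ α ∘ α ≈⟨ cancelˡ α-iso₂ ⟩
    α ≈⟨ idR ⟨
    α ∘ id ≈⟨ refl⟩∘⟨ ≈-sym (≈-trans ⊗-merge (≈-trans (α-iso₂ ⟩⊗⟨ idL) ⊗-id)) ⟩
    α ∘ (α⁻¹ ⊗₁ id) ∘ (α ⊗₁ id) ≈⟨ refl⟩∘⟨ refl⟩∘⟨ ≈-sym (cancelˡ α-iso₂) ⟩
    α ∘ (α⁻¹ ⊗₁ id) ∘ α⁻¹ ∘ α ∘ (α ⊗₁ id) ≈⟨ refl⟩∘⟨ assoc⁻ ⟩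
    α ∘ ((α⁻¹ ⊗₁ id) ∘ α⁻¹) ∘ α ∘ (α ⊗₁ id) ≈⟨ assoc⁻ ⟩
    (α ∘ (α⁻¹ ⊗₁ id) ∘ α⁻¹) ∘ α ∘ (α ⊗₁ id) ∎)

  exch⊗id-reassoc : ∀ {A B C D} → (exch ⊗₁ id) ∘ α⁻¹ ∘ (id ⊗₁ α⁻¹) ≈ α⁻¹ ∘ (id ⊗₁ α⁻¹) ∘ exch {A} {B} {C ⊗₀ D}
  exch⊗id-reassoc = begin
    (exch ⊗₁ id) ∘ α⁻¹ ∘ (id ⊗₁ α⁻¹) ≈⟨ ≈-trans ∘-⊗id (refl⟩∘⟨ ∘-⊗id) ⟩∘⟨refl ⟩
    ((α ⊗₁ id) ∘ ((σ ⊗₁ id) ⊗₁ id) ∘ (α⁻¹ ⊗₁ id)) ∘ α⁻¹ ∘ (id ⊗₁ α⁻¹) ≈⟨ ≈-trans assoc⁺ (refl⟩∘⟨ assoc⁺) ⟩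
    (α ⊗₁ id) ∘ ((σ ⊗₁ id) ⊗₁ id) ∘ (α⁻¹ ⊗₁ id) ∘ α⁻¹ ∘ (id ⊗₁ α⁻¹) ≈⟨ refl⟩∘⟨ refl⟩∘⟨ pentagon⁻¹ ⟩
    (α ⊗₁ id) ∘ ((σ ⊗₁ id) ⊗₁ id) ∘ α⁻¹ ∘ α⁻¹ ≈⟨ refl⟩∘⟨ swapˡ (≈-sym (α⁻¹-nat σ id id)) ⟩
    (α ⊗₁ id) ∘ α⁻¹ ∘ (σ ⊗₁ (id ⊗₁ id)) ∘ α⁻¹ ≈⟨ refl⟩∘⟨ refl⟩∘⟨ (≈-refl ⟩⊗⟨ ⊗-id) ⟩∘⟨refl ⟩
    (α ⊗₁ id) ∘ α⁻¹ ∘ (σ ⊗₁ id) ∘ α⁻¹ ≈⟨ prefix₂₃ α⊗id-α⁻¹ ⟩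
    α⁻¹ ∘ (id ⊗₁ α⁻¹) ∘ exch ∎

  σ-α : ∀ {A B C} → σ ∘ α {A} {B} {C} ≈ α⁻¹ ∘ (id ⊗₁ σ) ∘ α ∘ (σ ⊗₁ id)
  σ-α = moveˡ α-iso₂ (≈-sym hexagon)

  exch-id⊗α⁻¹ : ∀ {P B X Y} → exch ∘ (id ⊗₁ α⁻¹) ≈ α⁻¹ ∘ (id ⊗₁ exch) ∘ exch {P} {B} {X ⊗₀ Y}
  exch-id⊗α⁻¹ = begin
    exch ∘ (id ⊗₁ α⁻¹) ≈⟨ exch-unfold ⟩
    α ∘ (σ ⊗₁ id) ∘ α⁻¹ ∘ (id ⊗₁ α⁻¹) ≈⟨ refl⟩∘⟨ refl⟩∘⟨ α⁻¹-id⊗α⁻¹ ⟩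
    α ∘ (σ ⊗₁ id) ∘ (α ⊗₁ id) ∘ α⁻¹ ∘ α⁻¹ ≈⟨ refl⟩∘⟨ pullˡ (≈-sym ∘-⊗id) ⟩
    α ∘ ((σ ∘ α) ⊗₁ id) ∘ α⁻¹ ∘ α⁻¹ ≈⟨ refl⟩∘⟨ (σ-α ⟩⊗⟨ ≈-refl) ⟩∘⟨refl ⟩
    α ∘ ((α⁻¹ ∘ (id ⊗₁ σ) ∘ α ∘ (σ ⊗₁ id)) ⊗₁ id) ∘ α⁻¹ ∘ α⁻¹
      ≈⟨ refl⟩∘⟨ ≈-trans ∘-⊗id (refl⟩∘⟨ ≈-trans ∘-⊗id (refl⟩∘⟨ ∘-⊗id)) ⟩∘⟨refl ⟩
    α ∘ ((α⁻¹ ⊗₁ id) ∘ ((id ⊗₁ σ) ⊗₁ id) ∘ (α ⊗₁ id) ∘ ((σ ⊗₁ id) ⊗₁ id)) ∘ α⁻¹ ∘ α⁻¹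
      ≈⟨ refl⟩∘⟨ ≈-trans assoc⁺ (refl⟩∘⟨ ≈-trans assoc⁺ (refl⟩∘⟨ assoc⁺)) ⟩
    α ∘ (α⁻¹ ⊗₁ id) ∘ ((id ⊗₁ σ) ⊗₁ id) ∘ (α ⊗₁ id) ∘ ((σ ⊗₁ id) ⊗₁ id) ∘ α⁻¹ ∘ α⁻¹
      ≈⟨ refl⟩∘⟨ refl⟩∘⟨ refl⟩∘⟨ refl⟩∘⟨ swapˡ (≈-sym (α⁻¹-nat σ id id)) ⟩
    α ∘ (α⁻¹ ⊗₁ id) ∘ ((id ⊗₁ σ) ⊗₁ id) ∘ (α ⊗₁ id) ∘ α⁻¹ ∘ (σ ⊗₁ (id ⊗₁ id)) ∘ α⁻¹
      ≈⟨ refl⟩∘⟨ refl⟩∘⟨ refl⟩∘⟨ refl⟩∘⟨ refl⟩∘⟨ (≈-refl ⟩⊗⟨ ⊗-id) ⟩∘⟨refl ⟩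
    α ∘ (α⁻¹ ⊗₁ id) ∘ ((id ⊗₁ σ) ⊗₁ id) ∘ (α ⊗₁ id) ∘ α⁻¹ ∘ (σ ⊗₁ id) ∘ α⁻¹
      ≈⟨ refl⟩∘⟨ refl⟩∘⟨ refl⟩∘⟨ prefix₂₃ α⊗id-α⁻¹ ⟩
    α ∘ (α⁻¹ ⊗₁ id) ∘ ((id ⊗₁ σ) ⊗₁ id) ∘ α⁻¹ ∘ (id ⊗₁ α⁻¹) ∘ α ∘ (σ ⊗₁ id) ∘ α⁻¹
      ≈⟨ refl⟩∘⟨ refl⟩∘⟨ swapˡ (≈-sym (α⁻¹-nat id σ id)) ⟩
    α ∘ (α⁻¹ ⊗₁ id) ∘ α⁻¹ ∘ (id ⊗₁ (σ ⊗₁ id)) ∘ (id ⊗₁ α⁻¹) ∘ α ∘ (σ ⊗₁ id) ∘ α⁻¹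
      ≈⟨ prefix₃₂ (≈-sym α⁻¹-id⊗α) ⟩
    α⁻¹ ∘ (id ⊗₁ α) ∘ (id ⊗₁ (σ ⊗₁ id)) ∘ (id ⊗₁ α⁻¹) ∘ α ∘ (σ ⊗₁ id) ∘ α⁻¹
      ≈⟨ refl⟩∘⟨ prefix₃₁ (≈-sym (≈-trans id⊗-∘ (refl⟩∘⟨ id⊗-∘))) ⟩
    α⁻¹ ∘ (id ⊗₁ exch) ∘ exch ∎

  id⊗exch-exch : ∀ {P B X Y} → (id ⊗₁ exch) ∘ exch {P} {B} {X ⊗₀ Y} ≈ α ∘ exch ∘ (id ⊗₁ α⁻¹)
  id⊗exch-exch = moveˡ α-iso₁ (≈-sym exch-id⊗α⁻¹)

  exch-braid : ∀ {X Y Z W} → (id ⊗₁ exch) ∘ exch ∘ (id ⊗₁ exch) ≈ exch ∘ (id ⊗₁ exch) ∘ exch {X} {Y} {Z ⊗₀ W}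
  exch-braid = begin
    (id ⊗₁ exch) ∘ exch ∘ (id ⊗₁ exch) ≈⟨ pullˡ id⊗exch-exch ⟩
    (α ∘ exch ∘ (id ⊗₁ α⁻¹)) ∘ (id ⊗₁ exch) ≈⟨ ≈-trans assoc⁺ (refl⟩∘⟨ assoc⁺) ⟩
    α ∘ exch ∘ (id ⊗₁ α⁻¹) ∘ (id ⊗₁ exch)
      ≈⟨ refl⟩∘⟨ refl⟩∘⟨ ≈-trans (≈-sym id⊗-∘) (≈-trans (≈-refl ⟩⊗⟨ α⁻¹-exch) id⊗-∘) ⟩
    α ∘ exch ∘ (id ⊗₁ (σ ⊗₁ id)) ∘ (id ⊗₁ α⁻¹) ≈⟨ refl⟩∘⟨ swapˡ exch-nat ⟩
    α ∘ (σ ⊗₁ (id ⊗₁ id)) ∘ exch ∘ (id ⊗₁ α⁻¹) ≈⟨ refl⟩∘⟨ (≈-refl ⟩⊗⟨ ⊗-id) ⟩∘⟨refl ⟩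
    α ∘ (σ ⊗₁ id) ∘ exch ∘ (id ⊗₁ α⁻¹) ≈⟨ swapˡ exch-α ⟨
    exch ∘ α ∘ exch ∘ (id ⊗₁ α⁻¹) ≈⟨ refl⟩∘⟨ ≈-sym id⊗exch-exch ⟩
    exch ∘ (id ⊗₁ exch) ∘ exch ∎

  exch-id⊗σ : ∀ {A X Y} → exch ∘ (id ⊗₁ σ) ≈ σ ∘ α⁻¹ {A} {X} {Y}
  exch-id⊗σ = begin
    exch ∘ (id ⊗₁ σ) ≈⟨ exch-unfold ⟩
    α ∘ (σ ⊗₁ id) ∘ α⁻¹ ∘ (id ⊗₁ σ) ≈⟨ refl⟩∘⟨ ≈-trans assoc⁻ (iso-inverse-cong
        (iso-∘ (iso-⊗ iso-id iso-σ) (iso-∘ iso-α (iso-⊗ iso-σ iso-id))) (iso-∘ iso-α (iso-∘ iso-σ iso-α)) hexagon) ⟩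
    α ∘ (α⁻¹ ∘ σ) ∘ α⁻¹ ≈⟨ refl⟩∘⟨ assoc⁺ ⟩
    α ∘ α⁻¹ ∘ σ ∘ α⁻¹ ≈⟨ cancelˡ α-iso₁ ⟩
    σ ∘ α⁻¹ ∎

  triangle⁻¹ : ∀ {A B} → α⁻¹ ∘ (id ⊗₁ lu⁻¹) ≈ ru⁻¹ {A} ⊗₁ id {B}
  triangle⁻¹ = iso-inverse-cong (iso-∘ (iso-⊗ iso-id iso-lu) iso-α) (iso-⊗ iso-ru iso-id) triangle

  α⁻¹-id⊗ru⁻¹ : ∀ {A B} → α⁻¹ ∘ (id ⊗₁ ru⁻¹) ≈ ru⁻¹ {A ⊗₀ B}
  α⁻¹-id⊗ru⁻¹ = iso-inverse-cong (iso-∘ (iso-⊗ iso-id iso-ru) iso-α) iso-ru id⊗ru-α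

  α⁻¹-lu⁻¹ : ∀ {A B} → α⁻¹ ∘ lu⁻¹ ≈ lu⁻¹ {A} ⊗₁ id {B}
  α⁻¹-lu⁻¹ = iso-inverse-cong (iso-∘ iso-lu iso-α) (iso-⊗ iso-lu iso-id) lu-α

  α-lu⁻¹⊗id : ∀ {A B} → α ∘ (lu⁻¹ {A} ⊗₁ id {B}) ≈ lu⁻¹
  α-lu⁻¹⊗id = ≈-sym (moveˡ α-iso₁ α⁻¹-lu⁻¹)

  lu⁻¹≈ru⁻¹ : lu⁻¹ {𝟙} ≈ ru⁻¹
  lu⁻¹≈ru⁻¹ = iso-inverse-cong iso-lu iso-ru lu≈ru

  σ-lu⁻¹ : ∀ {A} → σ ∘ lu⁻¹ ≈ ru⁻¹ {A}
  σ-lu⁻¹ = iso-inverse-cong (iso-∘ iso-lu iso-σ) iso-ru lu-σ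

  σ-ru⁻¹ : ∀ {A} → σ ∘ ru⁻¹ ≈ lu⁻¹ {A}
  σ-ru⁻¹ = ≈-sym (moveˡ σ-invol σ-lu⁻¹)

  α⁻¹-id⊗exch : ∀ {P B X Y} → α⁻¹ ∘ (id ⊗₁ exch) ≈ exch ∘ (id ⊗₁ α⁻¹) ∘ exch {B} {P} {X ⊗₀ Y}
  α⁻¹-id⊗exch = ≈-sym (≈-trans assoc⁻ (≈-trans (exch-id⊗α⁻¹ ⟩∘⟨refl) (≈-trans assoc⁺ (refl⟩∘⟨ cancelʳ exch-invol))))

  id⊗α⁻¹-exch-id⊗α : ∀ {B D X Y} → (id ⊗₁ α⁻¹) ∘ exch ∘ (id ⊗₁ α) ≈ α ∘ (exch ⊗₁ id) ∘ α⁻¹ {B} {D ⊗₀ X} {Y}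
  id⊗α⁻¹-exch-id⊗α {B} {D} {X} {Y} = moveˡ α-iso₁ (≈-sym (≈-trans
    (moveʳ (proj₂ (iso-⊗ iso-id iso-α)) (≈-trans assoc⁺ (exch⊗id-reassoc {B} {D} {X} {Y})))
    (≈-trans assoc⁺ (refl⟩∘⟨ assoc⁺))))

  id⊗exch-exch-id⊗α : ∀ {B D X Y} → (id ⊗₁ exch) ∘ exch ∘ (id ⊗₁ α) ≈ α ∘ exch {B} {D ⊗₀ X} {Y}
  id⊗exch-exch-id⊗α = begin
    (id ⊗₁ exch) ∘ exch ∘ (id ⊗₁ α) ≈⟨ pullˡ id⊗exch-exch ⟩
    (α ∘ exch ∘ (id ⊗₁ α⁻¹)) ∘ (id ⊗₁ α) ≈⟨ ≈-trans assoc⁺ (refl⟩∘⟨ assoc⁺) ⟩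
    α ∘ exch ∘ (id ⊗₁ α⁻¹) ∘ (id ⊗₁ α) ≈⟨ refl⟩∘⟨ refl⟩∘⟨ proj₂ (iso-⊗ iso-id iso-α) ⟩
    α ∘ exch ∘ id ≈⟨ refl⟩∘⟨ idR ⟩
    α ∘ exch ∎

  σ-exch : ∀ {A X Y} → σ ∘ exch ≈ α⁻¹ {A} {X} {Y} ∘ (id ⊗₁ σ)
  σ-exch = moveʳ (proj₁ (iso-⊗ iso-id iso-σ)) (≈-trans assoc⁺ (≈-trans (refl⟩∘⟨ exch-id⊗σ) (cancelˡ σ-invol)))


module SplitSemantics {ℓ : Level} {V : Quantale ℓ} (𝒞 : EnrAutCat V) where
  open MonoidalCoherence 𝒞 public
  open Terms (LangSig 𝒞) public

  C⟦_⟧ : Ctx → Obj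
  C⟦ Γ ⟧ = ⟦_⟧ctx 𝒞 Γ

  S⟦_⟧ : ∀ {Γ Γ₁ Γ₂} → Γ ≈ Γ₁ ⋈ Γ₂ → Hom C⟦ Γ ⟧ (C⟦ Γ₁ ⟧ ⊗₀ C⟦ Γ₂ ⟧)
  S⟦ s ⟧ = ⟦_⟧sp 𝒞 s

  unsplit : ∀ {Γ Γ₁ Γ₂} → Γ ≈ Γ₁ ⋈ Γ₂ → Hom (C⟦ Γ₁ ⟧ ⊗₀ C⟦ Γ₂ ⟧) C⟦ Γ ⟧
  unsplit []        = lu
  unsplit (left s)  = (id ⊗₁ unsplit s) ∘ α
  unsplit (right s) = (id ⊗₁ unsplit s) ∘ exch

  split-right : ∀ {A Γ Γ₁ Γ₂} (s : Γ ≈ Γ₁ ⋈ Γ₂) → S⟦ right {A} s ⟧ ≈ exch ∘ (id ⊗₁ S⟦ s ⟧)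
  split-right s = ≈-sym exch-unfold

  iso-split : ∀ {Γ Γ₁ Γ₂} (s : Γ ≈ Γ₁ ⋈ Γ₂) → Iso S⟦ s ⟧ (unsplit s)
  iso-split []        = iso-sym iso-lu
  iso-split (left s)  = iso-∘ (iso-sym iso-α) (iso-⊗ iso-id (iso-split s))
  iso-split (right {A} s) = iso-resp-≈ (≈-sym (split-right {A} s)) (iso-∘ iso-exch (iso-⊗ iso-id (iso-split s)))

  split-allR : ∀ {Γ} (p : Γ ≈ [] ⋈ Γ) → S⟦ p ⟧ ≈ lu⁻¹
  split-allR []        = ≈-refl
  split-allR (right {A} p) = begin
    S⟦ right {A} p ⟧ ≈⟨ split-right {A} p ⟩
    exch ∘ (id ⊗₁ S⟦ p ⟧) ≈⟨ refl⟩∘⟨ id⊗-cong (split-allR p) ⟩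
    exch ∘ (id ⊗₁ lu⁻¹) ≈⟨ exch-unfold ⟩
    α ∘ (σ ⊗₁ id) ∘ α⁻¹ ∘ (id ⊗₁ lu⁻¹) ≈⟨ refl⟩∘⟨ refl⟩∘⟨ triangle⁻¹ ⟩
    α ∘ (σ ⊗₁ id) ∘ (ru⁻¹ ⊗₁ id) ≈⟨ refl⟩∘⟨ ≈-trans (≈-sym ∘-⊗id) (σ-ru⁻¹ ⟩⊗⟨ ≈-refl) ⟩
    α ∘ (lu⁻¹ ⊗₁ id) ≈⟨ α-lu⁻¹⊗id ⟩
    lu⁻¹ ∎

  split-allL : ∀ {Γ} (s : Γ ≈ Γ ⋈ []) → S⟦ s ⟧ ≈ ru⁻¹
  split-allL []       = lu⁻¹≈ru⁻¹
  split-allL (left s) = ≈-trans (refl⟩∘⟨ id⊗-cong (split-allL s)) α⁻¹-id⊗ru⁻¹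

  split-head : ∀ {A Γ} (p : Γ ≈ [] ⋈ Γ) → S⟦ left {A} p ⟧ ≈ ru⁻¹ ⊗₁ id
  split-head p = ≈-trans (refl⟩∘⟨ id⊗-cong (split-allR p)) triangle⁻¹

  split-comm : ∀ {Γ Γ₁ Γ₂} (s : Γ ≈ Γ₁ ⋈ Γ₂) → S⟦ comm s ⟧ ≈ σ ∘ S⟦ s ⟧
  split-comm []        = ≈-sym (≈-trans (σ-𝟙 ⟩∘⟨refl) idL)
  split-comm (left {A} s)  = begin
    S⟦ right {A} (comm s) ⟧ ≈⟨ split-right {A} (comm s) ⟩
    exch ∘ (id ⊗₁ S⟦ comm s ⟧) ≈⟨ refl⟩∘⟨ ≈-trans (id⊗-cong (split-comm s)) id⊗-∘ ⟩
    exch ∘ (id ⊗₁ σ) ∘ (id ⊗₁ S⟦ s ⟧) ≈⟨ swapˡ exch-id⊗σ ⟩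
    σ ∘ α⁻¹ ∘ (id ⊗₁ S⟦ s ⟧) ∎
  split-comm (right {A} s) = begin
    α⁻¹ ∘ (id ⊗₁ S⟦ comm s ⟧) ≈⟨ refl⟩∘⟨ ≈-trans (id⊗-cong (split-comm s)) id⊗-∘ ⟩
    α⁻¹ ∘ (id ⊗₁ σ) ∘ (id ⊗₁ S⟦ s ⟧) ≈⟨ swapˡ (≈-sym σ-exch) ⟩
    σ ∘ exch ∘ (id ⊗₁ S⟦ s ⟧) ≈⟨ refl⟩∘⟨ ≈-sym (split-right {A} s) ⟩
    σ ∘ S⟦ right {A} s ⟧ ∎

  -- The split rearrangements performed by locate, assocˡ and assocʳ are interpreted by α and exch.
  LocateResult : ∀ (Ξ Ξ₁ Ξ₂ Γ : Ctx) (A : Type) → Set ℓ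
  LocateResult Ξ Ξ₁ Ξ₂ Γ A = (Σ Ctx (λ Γ₁ → (Ξ₁ ≈ (A ∷ []) ⋈ Γ₁) × (Γ ≈ Γ₁ ⋈ Ξ₂))) ⊎
                             (Σ Ctx (λ Γ₂ → (Ξ₂ ≈ (A ∷ []) ⋈ Γ₂) × (Γ ≈ Ξ₁ ⋈ Γ₂)))

  LocateSplits : ∀ {Ξ Ξ₁ Ξ₂ Γ A} (q : Ξ ≈ Ξ₁ ⋈ Ξ₂) (p : Ξ ≈ (A ∷ []) ⋈ Γ) → LocateResult Ξ Ξ₁ Ξ₂ Γ A → Set ℓ
  LocateSplits q p (inj₁ (Γ₁ , p₁ , r)) = (S⟦ p₁ ⟧ ⊗₁ id) ∘ S⟦ q ⟧ ≈ α⁻¹ ∘ (id ⊗₁ S⟦ r ⟧) ∘ S⟦ p ⟧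
  LocateSplits q p (inj₂ (Γ₂ , p₂ , r)) = (id ⊗₁ S⟦ p₂ ⟧) ∘ S⟦ q ⟧ ≈ exch ∘ (id ⊗₁ S⟦ r ⟧) ∘ S⟦ p ⟧

  locate-splits : ∀ {Ξ Ξ₁ Ξ₂ Γ A} (q : Ξ ≈ Ξ₁ ⋈ Ξ₂) (p : Ξ ≈ (A ∷ []) ⋈ Γ) → LocateSplits q p (locate q p)
  locate-splits {A = A} (left {Γ₁ = Ξ₁} s) (left p) with allR-inv p
  ... | PE.refl =
    begin _ ≈⟨ (split-head {A} (allR {Ξ₁}) ⟩⊗⟨ ≈-refl) ⟩∘⟨refl ⟩
    ((ru⁻¹ ⊗₁ id) ⊗₁ id) ∘ α⁻¹ ∘ (id ⊗₁ S⟦ s ⟧) ≈⟨ swapˡ (≈-sym (α⁻¹-nat ru⁻¹ id id)) ⟩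
    α⁻¹ ∘ (ru⁻¹ ⊗₁ (id ⊗₁ id)) ∘ (id ⊗₁ S⟦ s ⟧) ≈⟨ refl⟩∘⟨ (≈-refl ⟩⊗⟨ ⊗-id) ⟩∘⟨refl ⟩
    α⁻¹ ∘ (ru⁻¹ ⊗₁ id) ∘ (id ⊗₁ S⟦ s ⟧) ≈⟨ refl⟩∘⟨ ⊗-commute ⟩
    α⁻¹ ∘ (id ⊗₁ S⟦ s ⟧) ∘ (ru⁻¹ ⊗₁ id) ≈⟨ refl⟩∘⟨ refl⟩∘⟨ ≈-sym (split-head {A} p) ⟩
    _ ∎
  locate-splits (left {B} s) (right p) with locate s p | locate-splits s p
  ... | inj₁ (Γ₁ , q , r) | ih =
    begin _ ≈⟨ (split-right {B} q ⟩⊗⟨ ≈-refl) ⟩∘⟨refl ⟩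
    ((exch ∘ (id ⊗₁ S⟦ q ⟧)) ⊗₁ id) ∘ α⁻¹ ∘ (id ⊗₁ S⟦ s ⟧) ≈⟨ pushˡ ∘-⊗id ⟩
    (exch ⊗₁ id) ∘ ((id ⊗₁ S⟦ q ⟧) ⊗₁ id) ∘ α⁻¹ ∘ (id ⊗₁ S⟦ s ⟧) ≈⟨ refl⟩∘⟨ swapˡ (≈-sym (α⁻¹-nat id S⟦ q ⟧ id)) ⟩
    (exch ⊗₁ id) ∘ α⁻¹ ∘ (id ⊗₁ (S⟦ q ⟧ ⊗₁ id)) ∘ (id ⊗₁ S⟦ s ⟧)
      ≈⟨ refl⟩∘⟨ refl⟩∘⟨ ≈-trans (≈-sym id⊗-∘) (id⊗-cong ih) ⟩
    (exch ⊗₁ id) ∘ α⁻¹ ∘ (id ⊗₁ (α⁻¹ ∘ (id ⊗₁ S⟦ r ⟧) ∘ S⟦ p ⟧)) ≈⟨ refl⟩∘⟨ refl⟩∘⟨ ≈-trans id⊗-∘ (refl⟩∘⟨ id⊗-∘) ⟩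
    (exch ⊗₁ id) ∘ α⁻¹ ∘ (id ⊗₁ α⁻¹) ∘ (id ⊗₁ (id ⊗₁ S⟦ r ⟧)) ∘ (id ⊗₁ S⟦ p ⟧) ≈⟨ prefix₃₃ exch⊗id-reassoc ⟩
    α⁻¹ ∘ (id ⊗₁ α⁻¹) ∘ exch ∘ (id ⊗₁ (id ⊗₁ S⟦ r ⟧)) ∘ (id ⊗₁ S⟦ p ⟧) ≈⟨ refl⟩∘⟨ refl⟩∘⟨ swapˡ exch-nat ⟩
    α⁻¹ ∘ (id ⊗₁ α⁻¹) ∘ (id ⊗₁ (id ⊗₁ S⟦ r ⟧)) ∘ exch ∘ (id ⊗₁ S⟦ p ⟧) ≈⟨ refl⟩∘⟨ pullˡ (≈-sym id⊗-∘) ⟩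
    α⁻¹ ∘ (id ⊗₁ (α⁻¹ ∘ (id ⊗₁ S⟦ r ⟧))) ∘ exch ∘ (id ⊗₁ S⟦ p ⟧) ≈⟨ refl⟩∘⟨ refl⟩∘⟨ ≈-sym (split-right {B} p) ⟩
    _ ∎
  ... | inj₂ (Γ₂ , q , r) | ih =
    begin _ ≈⟨ (≈-sym ⊗-id ⟩⊗⟨ ≈-refl) ⟩∘⟨refl ⟩
    ((id ⊗₁ id) ⊗₁ S⟦ q ⟧) ∘ α⁻¹ ∘ (id ⊗₁ S⟦ s ⟧) ≈⟨ swapˡ (≈-sym (α⁻¹-nat id id S⟦ q ⟧)) ⟩
    α⁻¹ ∘ (id ⊗₁ (id ⊗₁ S⟦ q ⟧)) ∘ (id ⊗₁ S⟦ s ⟧) ≈⟨ refl⟩∘⟨ ≈-trans (≈-sym id⊗-∘) (id⊗-cong ih) ⟩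
    α⁻¹ ∘ (id ⊗₁ (exch ∘ (id ⊗₁ S⟦ r ⟧) ∘ S⟦ p ⟧)) ≈⟨ refl⟩∘⟨ ≈-trans id⊗-∘ (refl⟩∘⟨ id⊗-∘) ⟩
    α⁻¹ ∘ (id ⊗₁ exch) ∘ (id ⊗₁ (id ⊗₁ S⟦ r ⟧)) ∘ (id ⊗₁ S⟦ p ⟧) ≈⟨ prefix₂₃ α⁻¹-id⊗exch ⟩
    exch ∘ (id ⊗₁ α⁻¹) ∘ exch ∘ (id ⊗₁ (id ⊗₁ S⟦ r ⟧)) ∘ (id ⊗₁ S⟦ p ⟧) ≈⟨ refl⟩∘⟨ refl⟩∘⟨ swapˡ exch-nat ⟩
    exch ∘ (id ⊗₁ α⁻¹) ∘ (id ⊗₁ (id ⊗₁ S⟦ r ⟧)) ∘ exch ∘ (id ⊗₁ S⟦ p ⟧) ≈⟨ refl⟩∘⟨ pullˡ (≈-sym id⊗-∘) ⟩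
    exch ∘ (id ⊗₁ (α⁻¹ ∘ (id ⊗₁ S⟦ r ⟧))) ∘ exch ∘ (id ⊗₁ S⟦ p ⟧) ≈⟨ refl⟩∘⟨ refl⟩∘⟨ ≈-sym (split-right {B} p) ⟩
    _ ∎
  locate-splits (right {B} {Γ₂ = Ξ₂} s) (left p) with allR-inv p
  ... | PE.refl =
    begin _ ≈⟨ (≈-refl ⟩⊗⟨ split-head {B} (allR {Ξ₂})) ⟩∘⟨ split-right {B} s ⟩
    (id ⊗₁ (ru⁻¹ ⊗₁ id)) ∘ exch ∘ (id ⊗₁ S⟦ s ⟧) ≈⟨ pullˡ (≈-sym exch-nat) ⟩
    (exch ∘ (ru⁻¹ ⊗₁ (id ⊗₁ id))) ∘ (id ⊗₁ S⟦ s ⟧) ≈⟨ assoc⁺ ⟩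
    exch ∘ (ru⁻¹ ⊗₁ (id ⊗₁ id)) ∘ (id ⊗₁ S⟦ s ⟧) ≈⟨ refl⟩∘⟨ (≈-refl ⟩⊗⟨ ⊗-id) ⟩∘⟨refl ⟩
    exch ∘ (ru⁻¹ ⊗₁ id) ∘ (id ⊗₁ S⟦ s ⟧) ≈⟨ refl⟩∘⟨ ⊗-commute ⟩
    exch ∘ (id ⊗₁ S⟦ s ⟧) ∘ (ru⁻¹ ⊗₁ id) ≈⟨ refl⟩∘⟨ refl⟩∘⟨ ≈-sym (split-head {B} p) ⟩
    _ ∎
  locate-splits (right {B} s) (right p) with locate s p | locate-splits s p
  ... | inj₁ (Γ₁ , q , r) | ih =
    begin _ ≈⟨ refl⟩∘⟨ split-right {B} s ⟩
    (S⟦ q ⟧ ⊗₁ id) ∘ exch ∘ (id ⊗₁ S⟦ s ⟧) ≈⟨ (≈-refl ⟩⊗⟨ ≈-sym ⊗-id) ⟩∘⟨refl ⟩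
    (S⟦ q ⟧ ⊗₁ (id ⊗₁ id)) ∘ exch ∘ (id ⊗₁ S⟦ s ⟧) ≈⟨ pullˡ (≈-sym exch-nat) ⟩
    (exch ∘ (id ⊗₁ (S⟦ q ⟧ ⊗₁ id))) ∘ (id ⊗₁ S⟦ s ⟧) ≈⟨ ≈-trans assoc⁺ (refl⟩∘⟨ ≈-trans (≈-sym id⊗-∘) (id⊗-cong ih)) ⟩
    exch ∘ (id ⊗₁ (α⁻¹ ∘ (id ⊗₁ S⟦ r ⟧) ∘ S⟦ p ⟧)) ≈⟨ refl⟩∘⟨ ≈-trans id⊗-∘ (refl⟩∘⟨ id⊗-∘) ⟩
    exch ∘ (id ⊗₁ α⁻¹) ∘ (id ⊗₁ (id ⊗₁ S⟦ r ⟧)) ∘ (id ⊗₁ S⟦ p ⟧) ≈⟨ prefix₂₃ exch-id⊗α⁻¹ ⟩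
    α⁻¹ ∘ (id ⊗₁ exch) ∘ exch ∘ (id ⊗₁ (id ⊗₁ S⟦ r ⟧)) ∘ (id ⊗₁ S⟦ p ⟧) ≈⟨ refl⟩∘⟨ refl⟩∘⟨ swapˡ exch-nat ⟩
    α⁻¹ ∘ (id ⊗₁ exch) ∘ (id ⊗₁ (id ⊗₁ S⟦ r ⟧)) ∘ exch ∘ (id ⊗₁ S⟦ p ⟧) ≈⟨ refl⟩∘⟨ pullˡ (≈-sym id⊗-∘) ⟩
    α⁻¹ ∘ (id ⊗₁ (exch ∘ (id ⊗₁ S⟦ r ⟧))) ∘ exch ∘ (id ⊗₁ S⟦ p ⟧)
      ≈⟨ refl⟩∘⟨ id⊗-cong (≈-sym (split-right {B} r)) ⟩∘⟨ ≈-sym (split-right {B} p) ⟩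
    _ ∎
  ... | inj₂ (Γ₂ , q , r) | ih =
    begin _ ≈⟨ id⊗-cong (split-right {B} q) ⟩∘⟨ split-right {B} s ⟩
    (id ⊗₁ (exch ∘ (id ⊗₁ S⟦ q ⟧))) ∘ exch ∘ (id ⊗₁ S⟦ s ⟧) ≈⟨ pushˡ id⊗-∘ ⟩
    (id ⊗₁ exch) ∘ (id ⊗₁ (id ⊗₁ S⟦ q ⟧)) ∘ exch ∘ (id ⊗₁ S⟦ s ⟧) ≈⟨ refl⟩∘⟨ swapˡ (≈-sym exch-nat) ⟩
    (id ⊗₁ exch) ∘ exch ∘ (id ⊗₁ (id ⊗₁ S⟦ q ⟧)) ∘ (id ⊗₁ S⟦ s ⟧)
      ≈⟨ refl⟩∘⟨ refl⟩∘⟨ ≈-trans (≈-sym id⊗-∘) (≈-trans (id⊗-cong ih) (≈-trans id⊗-∘ (refl⟩∘⟨ id⊗-∘))) ⟩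
    (id ⊗₁ exch) ∘ exch ∘ (id ⊗₁ exch) ∘ (id ⊗₁ (id ⊗₁ S⟦ r ⟧)) ∘ (id ⊗₁ S⟦ p ⟧) ≈⟨ prefix₃₃ exch-braid ⟩
    exch ∘ (id ⊗₁ exch) ∘ exch ∘ (id ⊗₁ (id ⊗₁ S⟦ r ⟧)) ∘ (id ⊗₁ S⟦ p ⟧) ≈⟨ refl⟩∘⟨ refl⟩∘⟨ swapˡ exch-nat ⟩
    exch ∘ (id ⊗₁ exch) ∘ (id ⊗₁ (id ⊗₁ S⟦ r ⟧)) ∘ exch ∘ (id ⊗₁ S⟦ p ⟧) ≈⟨ refl⟩∘⟨ pullˡ (≈-sym id⊗-∘) ⟩
    exch ∘ (id ⊗₁ (exch ∘ (id ⊗₁ S⟦ r ⟧))) ∘ exch ∘ (id ⊗₁ S⟦ p ⟧)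
      ≈⟨ refl⟩∘⟨ id⊗-cong (≈-sym (split-right {B} r)) ⟩∘⟨ ≈-sym (split-right {B} p) ⟩
    _ ∎

  id⊗-cong₃ : ∀ {A B C D E X} {f : Hom B E} {g : Hom A B} {a : Hom D E} {b : Hom C D} {c : Hom A C} →
         f ∘ g ≈ a ∘ b ∘ c → (id {X} ⊗₁ f) ∘ (id ⊗₁ g) ≈ (id ⊗₁ a) ∘ (id ⊗₁ b) ∘ (id ⊗₁ c)
  id⊗-cong₃ p = ≈-trans (≈-sym id⊗-∘) (≈-trans (id⊗-cong p) (≈-trans id⊗-∘ (refl⟩∘⟨ id⊗-∘)))

  AssocˡSplits : ∀ {Ψ Δ Γ Γ₁ Γ₂} (s : Ψ ≈ Δ ⋈ Γ) (r : Γ ≈ Γ₁ ⋈ Γ₂) →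
           Σ Ctx (λ Ψ₁ → (Ψ₁ ≈ Δ ⋈ Γ₁) × (Ψ ≈ Ψ₁ ⋈ Γ₂)) → Set ℓ
  AssocˡSplits s r (_ , s₁ , q') = (id ⊗₁ S⟦ r ⟧) ∘ S⟦ s ⟧ ≈ α ∘ (S⟦ s₁ ⟧ ⊗₁ id) ∘ S⟦ q' ⟧

  assocˡ-splits : ∀ {Ψ Δ Γ Γ₁ Γ₂} (s : Ψ ≈ Δ ⋈ Γ) (r : Γ ≈ Γ₁ ⋈ Γ₂) → AssocˡSplits s r (assocˡ s r)
  assocˡ-splits [] [] = begin _ ≈⟨ lu⁻¹-nat lu⁻¹ ⟨ lu⁻¹ ∘ lu⁻¹ ≈⟨ pullˡ α-lu⁻¹⊗id ⟨ _ ∎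
  assocˡ-splits (left s) r with assocˡ s r | assocˡ-splits s r
  ... | _ , a , b | ih =
    begin _ ≈⟨ (≈-sym ⊗-id ⟩⊗⟨ ≈-refl) ⟩∘⟨refl ⟩
    ((id ⊗₁ id) ⊗₁ S⟦ r ⟧) ∘ α⁻¹ ∘ (id ⊗₁ S⟦ s ⟧) ≈⟨ swapˡ (≈-sym (α⁻¹-nat id id S⟦ r ⟧)) ⟩
    α⁻¹ ∘ (id ⊗₁ (id ⊗₁ S⟦ r ⟧)) ∘ (id ⊗₁ S⟦ s ⟧) ≈⟨ refl⟩∘⟨ id⊗-cong₃ ih ⟩
    α⁻¹ ∘ (id ⊗₁ α) ∘ (id ⊗₁ (S⟦ a ⟧ ⊗₁ id)) ∘ (id ⊗₁ S⟦ b ⟧) ≈⟨ prefix₂₃ α⁻¹-id⊗α ⟩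
    α ∘ (α⁻¹ ⊗₁ id) ∘ α⁻¹ ∘ (id ⊗₁ (S⟦ a ⟧ ⊗₁ id)) ∘ (id ⊗₁ S⟦ b ⟧) ≈⟨ refl⟩∘⟨ refl⟩∘⟨ swapˡ (α⁻¹-nat id S⟦ a ⟧ id) ⟩
    α ∘ (α⁻¹ ⊗₁ id) ∘ ((id ⊗₁ S⟦ a ⟧) ⊗₁ id) ∘ α⁻¹ ∘ (id ⊗₁ S⟦ b ⟧) ≈⟨ refl⟩∘⟨ pullˡ (≈-sym ∘-⊗id) ⟩
    _ ∎
  assocˡ-splits (right {B} s) (left r) with assocˡ s r | assocˡ-splits s r
  ... | _ , a , b | ih =
    begin _ ≈⟨ refl⟩∘⟨ split-right {B} s ⟩
    (id ⊗₁ (α⁻¹ ∘ (id ⊗₁ S⟦ r ⟧))) ∘ exch ∘ (id ⊗₁ S⟦ s ⟧) ≈⟨ pushˡ id⊗-∘ ⟩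
    (id ⊗₁ α⁻¹) ∘ (id ⊗₁ (id ⊗₁ S⟦ r ⟧)) ∘ exch ∘ (id ⊗₁ S⟦ s ⟧) ≈⟨ refl⟩∘⟨ swapˡ (≈-sym exch-nat) ⟩
    (id ⊗₁ α⁻¹) ∘ exch ∘ (id ⊗₁ (id ⊗₁ S⟦ r ⟧)) ∘ (id ⊗₁ S⟦ s ⟧) ≈⟨ refl⟩∘⟨ refl⟩∘⟨ id⊗-cong₃ ih ⟩
    (id ⊗₁ α⁻¹) ∘ exch ∘ (id ⊗₁ α) ∘ (id ⊗₁ (S⟦ a ⟧ ⊗₁ id)) ∘ (id ⊗₁ S⟦ b ⟧) ≈⟨ prefix₃₃ id⊗α⁻¹-exch-id⊗α ⟩
    α ∘ (exch ⊗₁ id) ∘ α⁻¹ ∘ (id ⊗₁ (S⟦ a ⟧ ⊗₁ id)) ∘ (id ⊗₁ S⟦ b ⟧) ≈⟨ refl⟩∘⟨ refl⟩∘⟨ swapˡ (α⁻¹-nat id S⟦ a ⟧ id) ⟩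
    α ∘ (exch ⊗₁ id) ∘ ((id ⊗₁ S⟦ a ⟧) ⊗₁ id) ∘ α⁻¹ ∘ (id ⊗₁ S⟦ b ⟧)
      ≈⟨ refl⟩∘⟨ pullˡ (≈-trans (≈-sym ∘-⊗id) (≈-sym (split-right {B} a) ⟩⊗⟨ ≈-refl)) ⟩
    _ ∎
  assocˡ-splits (right {B} s) (right r) with assocˡ s r | assocˡ-splits s r
  ... | _ , a , b | ih =
    begin _ ≈⟨ id⊗-cong (split-right {B} r) ⟩∘⟨ split-right {B} s ⟩
    (id ⊗₁ (exch ∘ (id ⊗₁ S⟦ r ⟧))) ∘ exch ∘ (id ⊗₁ S⟦ s ⟧) ≈⟨ pushˡ id⊗-∘ ⟩
    (id ⊗₁ exch) ∘ (id ⊗₁ (id ⊗₁ S⟦ r ⟧)) ∘ exch ∘ (id ⊗₁ S⟦ s ⟧) ≈⟨ refl⟩∘⟨ swapˡ (≈-sym exch-nat) ⟩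
    (id ⊗₁ exch) ∘ exch ∘ (id ⊗₁ (id ⊗₁ S⟦ r ⟧)) ∘ (id ⊗₁ S⟦ s ⟧) ≈⟨ refl⟩∘⟨ refl⟩∘⟨ id⊗-cong₃ ih ⟩
    (id ⊗₁ exch) ∘ exch ∘ (id ⊗₁ α) ∘ (id ⊗₁ (S⟦ a ⟧ ⊗₁ id)) ∘ (id ⊗₁ S⟦ b ⟧) ≈⟨ prefix₃₂ id⊗exch-exch-id⊗α ⟩
    α ∘ exch ∘ (id ⊗₁ (S⟦ a ⟧ ⊗₁ id)) ∘ (id ⊗₁ S⟦ b ⟧) ≈⟨ refl⟩∘⟨ swapˡ exch-nat ⟩
    α ∘ (S⟦ a ⟧ ⊗₁ (id ⊗₁ id)) ∘ exch ∘ (id ⊗₁ S⟦ b ⟧) ≈⟨ refl⟩∘⟨ (≈-refl ⟩⊗⟨ ⊗-id) ⟩∘⟨ ≈-sym (split-right {B} b) ⟩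
    _ ∎

  AssocʳSplits : ∀ {Γ Γ₁ Γ₂ Γ₁₁ Γ₁₂} (s : Γ ≈ Γ₁ ⋈ Γ₂) (s' : Γ₁ ≈ Γ₁₁ ⋈ Γ₁₂) →
           Σ Ctx (λ Ψ → (Γ ≈ Γ₁₁ ⋈ Ψ) × (Ψ ≈ Γ₁₂ ⋈ Γ₂)) → Set ℓ
  AssocʳSplits s s' (_ , a , b) = (S⟦ s' ⟧ ⊗₁ id) ∘ S⟦ s ⟧ ≈ α⁻¹ ∘ (id ⊗₁ S⟦ b ⟧) ∘ S⟦ a ⟧

  assocʳ-splits : ∀ {Γ Γ₁ Γ₂ Γ₁₁ Γ₁₂} (s : Γ ≈ Γ₁ ⋈ Γ₂) (s' : Γ₁ ≈ Γ₁₁ ⋈ Γ₁₂) → AssocʳSplits s s' (assocʳ s s')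
  assocʳ-splits [] [] = begin _ ≈⟨ (lu⁻¹≈ru⁻¹ ⟩⊗⟨ ≈-refl) ⟩∘⟨refl ⟩ (ru⁻¹ ⊗₁ id) ∘ lu⁻¹ ≈⟨ pullˡ triangle⁻¹ ⟨ _ ∎
  assocʳ-splits (left s) (left s') with assocʳ s s' | assocʳ-splits s s'
  ... | _ , a , b | ih =
    begin _ ≈⟨ pushˡ ∘-⊗id ⟩
    (α⁻¹ ⊗₁ id) ∘ ((id ⊗₁ S⟦ s' ⟧) ⊗₁ id) ∘ α⁻¹ ∘ (id ⊗₁ S⟦ s ⟧) ≈⟨ refl⟩∘⟨ swapˡ (≈-sym (α⁻¹-nat id S⟦ s' ⟧ id)) ⟩
    (α⁻¹ ⊗₁ id) ∘ α⁻¹ ∘ (id ⊗₁ (S⟦ s' ⟧ ⊗₁ id)) ∘ (id ⊗₁ S⟦ s ⟧) ≈⟨ refl⟩∘⟨ refl⟩∘⟨ id⊗-cong₃ ih ⟩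
    (α⁻¹ ⊗₁ id) ∘ α⁻¹ ∘ (id ⊗₁ α⁻¹) ∘ (id ⊗₁ (id ⊗₁ S⟦ b ⟧)) ∘ (id ⊗₁ S⟦ a ⟧) ≈⟨ prefix₃₂ pentagon⁻¹ ⟩
    α⁻¹ ∘ α⁻¹ ∘ (id ⊗₁ (id ⊗₁ S⟦ b ⟧)) ∘ (id ⊗₁ S⟦ a ⟧) ≈⟨ refl⟩∘⟨ swapˡ (α⁻¹-nat id id S⟦ b ⟧) ⟩
    α⁻¹ ∘ ((id ⊗₁ id) ⊗₁ S⟦ b ⟧) ∘ α⁻¹ ∘ (id ⊗₁ S⟦ a ⟧) ≈⟨ refl⟩∘⟨ (⊗-id ⟩⊗⟨ ≈-refl) ⟩∘⟨refl ⟩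
    _ ∎
  assocʳ-splits (left {A} s) (right s') with assocʳ s s' | assocʳ-splits s s'
  ... | _ , a , b | ih =
    begin _ ≈⟨ (split-right {A} s' ⟩⊗⟨ ≈-refl) ⟩∘⟨refl ⟩
    ((exch ∘ (id ⊗₁ S⟦ s' ⟧)) ⊗₁ id) ∘ α⁻¹ ∘ (id ⊗₁ S⟦ s ⟧) ≈⟨ pushˡ ∘-⊗id ⟩
    (exch ⊗₁ id) ∘ ((id ⊗₁ S⟦ s' ⟧) ⊗₁ id) ∘ α⁻¹ ∘ (id ⊗₁ S⟦ s ⟧) ≈⟨ refl⟩∘⟨ swapˡ (≈-sym (α⁻¹-nat id S⟦ s' ⟧ id)) ⟩
    (exch ⊗₁ id) ∘ α⁻¹ ∘ (id ⊗₁ (S⟦ s' ⟧ ⊗₁ id)) ∘ (id ⊗₁ S⟦ s ⟧) ≈⟨ refl⟩∘⟨ refl⟩∘⟨ id⊗-cong₃ ih ⟩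
    (exch ⊗₁ id) ∘ α⁻¹ ∘ (id ⊗₁ α⁻¹) ∘ (id ⊗₁ (id ⊗₁ S⟦ b ⟧)) ∘ (id ⊗₁ S⟦ a ⟧) ≈⟨ prefix₃₃ exch⊗id-reassoc ⟩
    α⁻¹ ∘ (id ⊗₁ α⁻¹) ∘ exch ∘ (id ⊗₁ (id ⊗₁ S⟦ b ⟧)) ∘ (id ⊗₁ S⟦ a ⟧) ≈⟨ refl⟩∘⟨ refl⟩∘⟨ swapˡ exch-nat ⟩
    α⁻¹ ∘ (id ⊗₁ α⁻¹) ∘ (id ⊗₁ (id ⊗₁ S⟦ b ⟧)) ∘ exch ∘ (id ⊗₁ S⟦ a ⟧) ≈⟨ refl⟩∘⟨ pullˡ (≈-sym id⊗-∘) ⟩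
    α⁻¹ ∘ (id ⊗₁ (α⁻¹ ∘ (id ⊗₁ S⟦ b ⟧))) ∘ exch ∘ (id ⊗₁ S⟦ a ⟧) ≈⟨ refl⟩∘⟨ refl⟩∘⟨ ≈-sym (split-right {A} a) ⟩
    _ ∎
  assocʳ-splits (right {A} s) s' with assocʳ s s' | assocʳ-splits s s'
  ... | _ , a , b | ih =
    begin _ ≈⟨ refl⟩∘⟨ split-right {A} s ⟩
    (S⟦ s' ⟧ ⊗₁ id) ∘ exch ∘ (id ⊗₁ S⟦ s ⟧) ≈⟨ (≈-refl ⟩⊗⟨ ≈-sym ⊗-id) ⟩∘⟨refl ⟩
    (S⟦ s' ⟧ ⊗₁ (id ⊗₁ id)) ∘ exch ∘ (id ⊗₁ S⟦ s ⟧) ≈⟨ pullˡ (≈-sym exch-nat) ⟩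
    (exch ∘ (id ⊗₁ (S⟦ s' ⟧ ⊗₁ id))) ∘ (id ⊗₁ S⟦ s ⟧) ≈⟨ ≈-trans assoc⁺ (refl⟩∘⟨ id⊗-cong₃ ih) ⟩
    exch ∘ (id ⊗₁ α⁻¹) ∘ (id ⊗₁ (id ⊗₁ S⟦ b ⟧)) ∘ (id ⊗₁ S⟦ a ⟧) ≈⟨ prefix₂₃ exch-id⊗α⁻¹ ⟩
    α⁻¹ ∘ (id ⊗₁ exch) ∘ exch ∘ (id ⊗₁ (id ⊗₁ S⟦ b ⟧)) ∘ (id ⊗₁ S⟦ a ⟧) ≈⟨ refl⟩∘⟨ refl⟩∘⟨ swapˡ exch-nat ⟩
    α⁻¹ ∘ (id ⊗₁ exch) ∘ (id ⊗₁ (id ⊗₁ S⟦ b ⟧)) ∘ exch ∘ (id ⊗₁ S⟦ a ⟧) ≈⟨ refl⟩∘⟨ pullˡ (≈-sym id⊗-∘) ⟩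
    α⁻¹ ∘ (id ⊗₁ (exch ∘ (id ⊗₁ S⟦ b ⟧))) ∘ exch ∘ (id ⊗₁ S⟦ a ⟧)
      ≈⟨ refl⟩∘⟨ id⊗-cong (≈-sym (split-right {A} b)) ⟩∘⟨ ≈-sym (split-right {A} a) ⟩
    _ ∎


module SubstitutionLemma {ℓ : Level} {V : Quantale ℓ} (𝒞 : EnrAutCat V) where
  open SplitSemantics 𝒞 public

  T⟦_⟧ : ∀ {Γ A} → Γ ⊢ A → Hom C⟦ Γ ⟧ (iTy 𝒞 A)
  T⟦ v ⟧ = ⟦_⟧tm 𝒞 v

  A⟦_⟧ : ∀ {Γ A As} → Args Γ A As → Hom C⟦ Γ ⟧ (⟦_,_⟧args 𝒞 A As)
  A⟦ as ⟧ = ⟦_⟧as 𝒞 as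

  plug : ∀ {Ξ Γ Δ Ψ A} → Ξ ≈ (A ∷ []) ⋈ Γ → Ψ ≈ Δ ⋈ Γ → Hom C⟦ Δ ⟧ (iTy 𝒞 A) → Hom C⟦ Ψ ⟧ C⟦ Ξ ⟧
  plug p s f = unsplit p ∘ ((ru⁻¹ ∘ f) ⊗₁ id) ∘ S⟦ s ⟧

  plug-into-left : ∀ {Ξ Ξ₁ Ξ₂ X G G₁ Ψ Ψ₁ D}
           {Q : Hom Ξ (Ξ₁ ⊗₀ Ξ₂)} {P : Hom Ξ (X ⊗₀ G)} {P' : Hom (X ⊗₀ G) Ξ}
           {P₁ : Hom Ξ₁ (X ⊗₀ G₁)} {P₁' : Hom (X ⊗₀ G₁) Ξ₁} {R : Hom G (G₁ ⊗₀ Ξ₂)}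
           {S : Hom Ψ (D ⊗₀ G)} {S₁ : Hom Ψ₁ (D ⊗₀ G₁)} {Q' : Hom Ψ (Ψ₁ ⊗₀ Ξ₂)} {T : Hom D X} →
         Iso P P' → Iso P₁ P₁' →
         (P₁ ⊗₁ id) ∘ Q ≈ α⁻¹ ∘ (id ⊗₁ R) ∘ P →
         (id ⊗₁ R) ∘ S ≈ α ∘ (S₁ ⊗₁ id) ∘ Q' →
         Q ∘ P' ∘ (T ⊗₁ id) ∘ S ≈ ((P₁' ∘ (T ⊗₁ id) ∘ S₁) ⊗₁ id) ∘ Q'
  plug-into-left {Q = Q} {P} {P'} {P₁} {P₁'} {R} {S} {S₁} {Q'} {T} (i1 , i2) (j1 , j2) h1 h2 =
    begin _ ≈⟨ insertˡ (≈-trans ⊗-merge (≈-trans (j2 ⟩⊗⟨ idL) ⊗-id)) ⟩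
    (P₁' ⊗₁ id) ∘ (P₁ ⊗₁ id) ∘ Q ∘ P' ∘ (T ⊗₁ id) ∘ S ≈⟨ refl⟩∘⟨ prefix₂₃ h1 ⟩
    (P₁' ⊗₁ id) ∘ α⁻¹ ∘ (id ⊗₁ R) ∘ P ∘ P' ∘ (T ⊗₁ id) ∘ S ≈⟨ refl⟩∘⟨ refl⟩∘⟨ refl⟩∘⟨ cancelˡ i1 ⟩
    (P₁' ⊗₁ id) ∘ α⁻¹ ∘ (id ⊗₁ R) ∘ (T ⊗₁ id) ∘ S ≈⟨ refl⟩∘⟨ refl⟩∘⟨ swapˡ (≈-sym ⊗-commute) ⟩
    (P₁' ⊗₁ id) ∘ α⁻¹ ∘ (T ⊗₁ id) ∘ (id ⊗₁ R) ∘ S ≈⟨ refl⟩∘⟨ refl⟩∘⟨ refl⟩∘⟨ h2 ⟩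
    (P₁' ⊗₁ id) ∘ α⁻¹ ∘ (T ⊗₁ id) ∘ α ∘ (S₁ ⊗₁ id) ∘ Q' ≈⟨ refl⟩∘⟨ refl⟩∘⟨ (≈-refl ⟩⊗⟨ ≈-sym ⊗-id) ⟩∘⟨refl ⟩
    (P₁' ⊗₁ id) ∘ α⁻¹ ∘ (T ⊗₁ (id ⊗₁ id)) ∘ α ∘ (S₁ ⊗₁ id) ∘ Q' ≈⟨ refl⟩∘⟨ swapˡ (α⁻¹-nat T id id) ⟩
    (P₁' ⊗₁ id) ∘ ((T ⊗₁ id) ⊗₁ id) ∘ α⁻¹ ∘ α ∘ (S₁ ⊗₁ id) ∘ Q' ≈⟨ refl⟩∘⟨ refl⟩∘⟨ cancelˡ α-iso₂ ⟩
    (P₁' ⊗₁ id) ∘ ((T ⊗₁ id) ⊗₁ id) ∘ (S₁ ⊗₁ id) ∘ Q' ≈⟨ refl⟩∘⟨ pullˡ (≈-sym ∘-⊗id) ⟩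
    (P₁' ⊗₁ id) ∘ (((T ⊗₁ id) ∘ S₁) ⊗₁ id) ∘ Q' ≈⟨ pullˡ (≈-sym ∘-⊗id) ⟩
    _ ∎

  plug-into-right : ∀ {Ξ Ξ₁ Ξ₂ X G G₂ Ψ Ψ₂ D}
           {Q : Hom Ξ (Ξ₁ ⊗₀ Ξ₂)} {P : Hom Ξ (X ⊗₀ G)} {P' : Hom (X ⊗₀ G) Ξ}
           {P₂ : Hom Ξ₂ (X ⊗₀ G₂)} {P₂' : Hom (X ⊗₀ G₂) Ξ₂} {R : Hom G (Ξ₁ ⊗₀ G₂)} {Rc : Hom G (G₂ ⊗₀ Ξ₁)}
           {S : Hom Ψ (D ⊗₀ G)} {S₂ : Hom Ψ₂ (D ⊗₀ G₂)} {Q' : Hom Ψ (Ψ₂ ⊗₀ Ξ₁)} {Qc : Hom Ψ (Ξ₁ ⊗₀ Ψ₂)}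
           {T : Hom D X} →
         Iso P P' → Iso P₂ P₂' →
         (id ⊗₁ P₂) ∘ Q ≈ exch ∘ (id ⊗₁ R) ∘ P →
         (id ⊗₁ Rc) ∘ S ≈ α ∘ (S₂ ⊗₁ id) ∘ Q' →
         Rc ≈ σ ∘ R → Qc ≈ σ ∘ Q' →
         Q ∘ P' ∘ (T ⊗₁ id) ∘ S ≈ (id ⊗₁ (P₂' ∘ (T ⊗₁ id) ∘ S₂)) ∘ Qc
  plug-into-right {Q = Q} {P} {P'} {P₂} {P₂'} {R} {Rc} {S} {S₂} {Q'} {Qc} {T} (i1 , i2) (j1 , j2) h1 h2 c1 c2 =
    begin _ ≈⟨ insertˡ (≈-trans ⊗-merge (≈-trans (idL ⟩⊗⟨ j2) ⊗-id)) ⟩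
    (id ⊗₁ P₂') ∘ (id ⊗₁ P₂) ∘ Q ∘ P' ∘ (T ⊗₁ id) ∘ S ≈⟨ refl⟩∘⟨ prefix₂₃ h1 ⟩
    (id ⊗₁ P₂') ∘ exch ∘ (id ⊗₁ R) ∘ P ∘ P' ∘ (T ⊗₁ id) ∘ S ≈⟨ refl⟩∘⟨ refl⟩∘⟨ refl⟩∘⟨ cancelˡ i1 ⟩
    (id ⊗₁ P₂') ∘ exch ∘ (id ⊗₁ R) ∘ (T ⊗₁ id) ∘ S ≈⟨ refl⟩∘⟨ refl⟩∘⟨ swapˡ (≈-sym ⊗-commute) ⟩
    (id ⊗₁ P₂') ∘ exch ∘ (T ⊗₁ id) ∘ (id ⊗₁ R) ∘ S
      ≈⟨ refl⟩∘⟨ refl⟩∘⟨ refl⟩∘⟨ (id⊗-cong (≈-trans (≈-sym (cancelˡ σ-invol)) (refl⟩∘⟨ ≈-sym c1)) ⟩∘⟨refl) ⟩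
    (id ⊗₁ P₂') ∘ exch ∘ (T ⊗₁ id) ∘ (id ⊗₁ (σ ∘ Rc)) ∘ S ≈⟨ refl⟩∘⟨ refl⟩∘⟨ refl⟩∘⟨ pushˡ id⊗-∘ ⟩
    (id ⊗₁ P₂') ∘ exch ∘ (T ⊗₁ id) ∘ (id ⊗₁ σ) ∘ (id ⊗₁ Rc) ∘ S ≈⟨ refl⟩∘⟨ refl⟩∘⟨ refl⟩∘⟨ refl⟩∘⟨ h2 ⟩
    (id ⊗₁ P₂') ∘ exch ∘ (T ⊗₁ id) ∘ (id ⊗₁ σ) ∘ α ∘ (S₂ ⊗₁ id) ∘ Q'
      ≈⟨ refl⟩∘⟨ refl⟩∘⟨ (≈-refl ⟩⊗⟨ ≈-sym ⊗-id) ⟩∘⟨refl ⟩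
    (id ⊗₁ P₂') ∘ exch ∘ (T ⊗₁ (id ⊗₁ id)) ∘ (id ⊗₁ σ) ∘ α ∘ (S₂ ⊗₁ id) ∘ Q' ≈⟨ refl⟩∘⟨ swapˡ exch-nat ⟩
    (id ⊗₁ P₂') ∘ (id ⊗₁ (T ⊗₁ id)) ∘ exch ∘ (id ⊗₁ σ) ∘ α ∘ (S₂ ⊗₁ id) ∘ Q' ≈⟨ refl⟩∘⟨ refl⟩∘⟨ swapˡ exch-id⊗σ ⟩
    (id ⊗₁ P₂') ∘ (id ⊗₁ (T ⊗₁ id)) ∘ σ ∘ α⁻¹ ∘ α ∘ (S₂ ⊗₁ id) ∘ Q' ≈⟨ refl⟩∘⟨ refl⟩∘⟨ refl⟩∘⟨ cancelˡ α-iso₂ ⟩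
    (id ⊗₁ P₂') ∘ (id ⊗₁ (T ⊗₁ id)) ∘ σ ∘ (S₂ ⊗₁ id) ∘ Q' ≈⟨ refl⟩∘⟨ refl⟩∘⟨ swapˡ (σ-nat S₂ id) ⟩
    (id ⊗₁ P₂') ∘ (id ⊗₁ (T ⊗₁ id)) ∘ (id ⊗₁ S₂) ∘ σ ∘ Q' ≈⟨ refl⟩∘⟨ refl⟩∘⟨ refl⟩∘⟨ ≈-sym c2 ⟩
    (id ⊗₁ P₂') ∘ (id ⊗₁ (T ⊗₁ id)) ∘ (id ⊗₁ S₂) ∘ Qc ≈⟨ refl⟩∘⟨ pullˡ (≈-sym id⊗-∘) ⟩
    (id ⊗₁ P₂') ∘ (id ⊗₁ ((T ⊗₁ id) ∘ S₂)) ∘ Qc ≈⟨ pullˡ (≈-sym id⊗-∘) ⟩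
    _ ∎

  ⊗-plugˡ : ∀ {Ξ Ξ₁ Ξ₂ X₁ X₂ Ψ Ψ₁} {x : Hom Ξ₁ X₁} {y : Hom Ξ₂ X₂} {Q : Hom Ξ (Ξ₁ ⊗₀ Ξ₂)} {I : Hom Ψ Ξ}
         {I₁ : Hom Ψ₁ Ξ₁} {Q' : Hom Ψ (Ψ₁ ⊗₀ Ξ₂)} {x' : Hom Ψ₁ X₁} →
         x' ≈ x ∘ I₁ → Q ∘ I ≈ (I₁ ⊗₁ id) ∘ Q' → (x' ⊗₁ y) ∘ Q' ≈ (x ⊗₁ y) ∘ Q ∘ I
  ⊗-plugˡ p q = ≈-trans ((p ⟩⊗⟨ ≈-sym idR) ⟩∘⟨refl) (≈-trans (pushˡ (≈-sym ⊗-merge)) (refl⟩∘⟨ ≈-sym q))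

  ⊗-plugʳ : ∀ {Ξ Ξ₁ Ξ₂ X₁ X₂ Ψ Ψ₂} {x : Hom Ξ₁ X₁} {y : Hom Ξ₂ X₂} {Q : Hom Ξ (Ξ₁ ⊗₀ Ξ₂)} {I : Hom Ψ Ξ}
         {I₂ : Hom Ψ₂ Ξ₂} {Qc : Hom Ψ (Ξ₁ ⊗₀ Ψ₂)} {y' : Hom Ψ₂ X₂} →
         y' ≈ y ∘ I₂ → Q ∘ I ≈ (id ⊗₁ I₂) ∘ Qc → (x ⊗₁ y') ∘ Qc ≈ (x ⊗₁ y) ∘ Q ∘ I
  ⊗-plugʳ p q = ≈-trans ((≈-sym idR ⟩⊗⟨ p) ⟩∘⟨refl) (≈-trans (pushˡ (≈-sym ⊗-merge)) (refl⟩∘⟨ ≈-sym q))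

  plug-right : ∀ {Ξ Γ Δ Ψ A B} (p : Ξ ≈ (A ∷ []) ⋈ Γ) (s : Ψ ≈ Δ ⋈ Γ) (f : Hom C⟦ Δ ⟧ (iTy 𝒞 A)) →
              plug (right {B} p) (right {B} s) f ≈ id ⊗₁ plug p s f
  plug-right {B = B} p s f =
    begin _ ≈⟨ assoc⁺ ⟩
    (id ⊗₁ unsplit p) ∘ exch ∘ ((ru⁻¹ ∘ f) ⊗₁ id) ∘ S⟦ right {B} s ⟧
      ≈⟨ refl⟩∘⟨ refl⟩∘⟨ (≈-refl ⟩⊗⟨ ≈-sym ⊗-id) ⟩∘⟨ split-right {B} s ⟩
    (id ⊗₁ unsplit p) ∘ exch ∘ ((ru⁻¹ ∘ f) ⊗₁ (id ⊗₁ id)) ∘ exch ∘ (id ⊗₁ S⟦ s ⟧) ≈⟨ refl⟩∘⟨ swapˡ exch-nat ⟩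
    (id ⊗₁ unsplit p) ∘ (id ⊗₁ ((ru⁻¹ ∘ f) ⊗₁ id)) ∘ exch ∘ exch ∘ (id ⊗₁ S⟦ s ⟧)
      ≈⟨ refl⟩∘⟨ refl⟩∘⟨ cancelˡ exch-invol ⟩
    (id ⊗₁ unsplit p) ∘ (id ⊗₁ ((ru⁻¹ ∘ f) ⊗₁ id)) ∘ (id ⊗₁ S⟦ s ⟧) ≈⟨ ≈-trans id⊗-∘ (refl⟩∘⟨ id⊗-∘) ⟨
    _ ∎

  cur-natural : ∀ {A A' X B'} {f : Hom (A ⊗₀ X) B'} {g : Hom A' A} → cur f ∘ g ≈ cur (f ∘ (g ⊗₁ id))
  cur-natural {f = f} {g} =
    begin _ ≈⟨ cur-η _ ⟨
    cur (ev ∘ ((cur f ∘ g) ⊗₁ id)) ≈⟨ cur-cong (refl⟩∘⟨ ∘-⊗id) ⟩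
    cur (ev ∘ (cur f ⊗₁ id) ∘ (g ⊗₁ id)) ≈⟨ cur-cong (pullˡ (cur-β f)) ⟩
    _ ∎

  ru-plug-head : ∀ {A Δ} (s : Δ ≈ Δ ⋈ []) (f : Hom C⟦ Δ ⟧ (iTy 𝒞 A)) → ru ∘ plug (left {A} []) s f ≈ f
  ru-plug-head s f = begin
    ru ∘ ((id ⊗₁ lu) ∘ α) ∘ ((ru⁻¹ ∘ f) ⊗₁ id) ∘ S⟦ s ⟧ ≈⟨ refl⟩∘⟨ triangle ⟩∘⟨ (refl⟩∘⟨ split-allL s) ⟩
    ru ∘ (ru ⊗₁ id) ∘ ((ru⁻¹ ∘ f) ⊗₁ id) ∘ ru⁻¹       ≈⟨ refl⟩∘⟨ pullˡ (≈-trans ⊗-merge (cancelˡ ru-iso₁ ⟩⊗⟨ idL)) ⟩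
    ru ∘ (f ⊗₁ id) ∘ ru⁻¹                            ≈⟨ swapˡ (ru-nat f) ⟩
    f ∘ ru ∘ ru⁻¹                                    ≈⟨ refl⟩∘⟨ ru-iso₁ ⟩
    f ∘ id                                           ≈⟨ idR ⟩
    f                                                ∎

  cur-σ-natural : ∀ {A A' X B} {h : Hom (X ⊗₀ A) B} {g : Hom A' A} →
                  cur ((h ∘ (id ⊗₁ g)) ∘ σ) ≈ cur (h ∘ σ) ∘ g
  cur-σ-natural = begin
    cur ((_ ∘ (id ⊗₁ _)) ∘ σ) ≈⟨ cur-cong (≈-trans assoc⁺ (≈-trans (refl⟩∘⟨ ≈-sym (σ-nat _ _)) assoc⁻)) ⟩
    cur ((_ ∘ σ) ∘ (_ ⊗₁ id)) ≈⟨ cur-natural ⟨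
    cur (_ ∘ σ) ∘ _           ∎

  mutual
    ⟦sub⟧ : ∀ {Ξ Γ Δ Ψ A B} (v : Ξ ⊢ B) (p : Ξ ≈ (A ∷ []) ⋈ Γ) (s : Ψ ≈ Δ ⋈ Γ) (t : Δ ⊢ A) →
              T⟦ sub v p s t ⟧ ≈ T⟦ v ⟧ ∘ plug p s T⟦ t ⟧
    ⟦sub⟧ (var {A}) (left []) s t with allL-inv s
    ... | PE.refl = ≈-sym (ru-plug-head {A} s T⟦ t ⟧)
    ⟦sub⟧ var (right ()) s t
    ⟦sub⟧ unit () s t
    ⟦sub⟧ (op f as) p s t = ≈-trans (refl⟩∘⟨ ⟦subArgs⟧ as p s t) assoc⁻
    ⟦sub⟧ (letu q v w) p s t with locate q p | locate-splits q p
    ... | inj₁ (_ , p₁ , r) | h1 with assocˡ s r | assocˡ-splits s r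
    ...   | _ , s₁ , q' | h2 =
      ≈-trans (refl⟩∘⟨ ⊗-plugˡ (⟦sub⟧ v p₁ s₁ t) (plug-into-left (iso-split p) (iso-split p₁) h1 h2)) (≈-sym assoc₃⁺)
    ⟦sub⟧ (letu q v w) p s t | inj₂ (_ , p₂ , r) | h1 with assocˡ s (comm r) | assocˡ-splits s (comm r)
    ...   | _ , s₂ , q' | h2 =
      ≈-trans (refl⟩∘⟨ ⊗-plugʳ (⟦sub⟧ w p₂ s₂ t)
          (plug-into-right (iso-split p) (iso-split p₂) h1 h2 (split-comm r) (split-comm q'))) (≈-sym assoc₃⁺)
    ⟦sub⟧ (pair q v w) p s t with locate q p | locate-splits q p
    ... | inj₁ (_ , p₁ , r) | h1 with assocˡ s r | assocˡ-splits s r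
    ...   | _ , s₁ , q' | h2 =
      ≈-trans (⊗-plugˡ (⟦sub⟧ v p₁ s₁ t) (plug-into-left (iso-split p) (iso-split p₁) h1 h2)) assoc⁻
    ⟦sub⟧ (pair q v w) p s t | inj₂ (_ , p₂ , r) | h1 with assocˡ s (comm r) | assocˡ-splits s (comm r)
    ...   | _ , s₂ , q' | h2 =
      ≈-trans (⊗-plugʳ (⟦sub⟧ w p₂ s₂ t)
          (plug-into-right (iso-split p) (iso-split p₂) h1 h2 (split-comm r) (split-comm q'))) assoc⁻
    ⟦sub⟧ (app q v w) p s t with locate q p | locate-splits q p
    ... | inj₁ (_ , p₁ , r) | h1 with assocˡ s r | assocˡ-splits s r
    ...   | _ , s₁ , q' | h2 =
      ≈-trans (refl⟩∘⟨ ⊗-plugˡ (⟦sub⟧ v p₁ s₁ t) (plug-into-left (iso-split p) (iso-split p₁) h1 h2)) (≈-sym assoc₃⁺)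
    ⟦sub⟧ (app q v w) p s t | inj₂ (_ , p₂ , r) | h1 with assocˡ s (comm r) | assocˡ-splits s (comm r)
    ...   | _ , s₂ , q' | h2 =
      ≈-trans (refl⟩∘⟨ ⊗-plugʳ (⟦sub⟧ w p₂ s₂ t)
          (plug-into-right (iso-split p) (iso-split p₂) h1 h2 (split-comm r) (split-comm q'))) (≈-sym assoc₃⁺)
    ⟦sub⟧ (pm q v w) p s t with locate q p | locate-splits q p
    ... | inj₁ (_ , p₁ , r) | h1 with assocˡ s r | assocˡ-splits s r
    ...   | _ , s₁ , q' | h2 =
      ≈-trans (refl⟩∘⟨ refl⟩∘⟨ ⊗-plugˡ (⟦sub⟧ v p₁ s₁ t) (plug-into-left (iso-split p) (iso-split p₁) h1 h2))
              (≈-sym (≈-trans assoc⁺ (refl⟩∘⟨ assoc₃⁺)))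
    ⟦sub⟧ (pm {A = A'} {B = B'} q v w) p s t | inj₂ (_ , p₂ , r) | h1 with assocˡ s (comm r) | assocˡ-splits s (comm r)
    ...   | _ , s₂ , q' | h2 = begin
      T⟦ sub w (right (right p₂)) (right (right s₂)) t ⟧ ∘ α ∘ (T⟦ v ⟧ ⊗₁ id) ∘ S⟦ comm q' ⟧
        ≈⟨ ⟦sub⟧ w (right {A'} (right {B'} p₂)) (right {A'} (right {B'} s₂)) t ⟩∘⟨refl ⟩
      (T⟦ w ⟧ ∘ plug (right {A'} (right {B'} p₂)) (right (right s₂)) T⟦ t ⟧) ∘ α ∘ (T⟦ v ⟧ ⊗₁ id) ∘ S⟦ comm q' ⟧
        ≈⟨ (refl⟩∘⟨ ≈-trans (plug-right {B = A'} (right {B'} p₂) (right s₂) T⟦ t ⟧)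
                              (id⊗-cong (plug-right {B = B'} p₂ s₂ T⟦ t ⟧))) ⟩∘⟨refl ⟩
      (T⟦ w ⟧ ∘ (id ⊗₁ (id ⊗₁ plug p₂ s₂ T⟦ t ⟧))) ∘ α ∘ (T⟦ v ⟧ ⊗₁ id) ∘ S⟦ comm q' ⟧
        ≈⟨ ≈-trans assoc⁺ (refl⟩∘⟨ prefix₃₃ id⊗id⊗-α-⊗id) ⟩
      T⟦ w ⟧ ∘ α ∘ (T⟦ v ⟧ ⊗₁ id) ∘ (id ⊗₁ plug p₂ s₂ T⟦ t ⟧) ∘ S⟦ comm q' ⟧
        ≈⟨ refl⟩∘⟨ refl⟩∘⟨ refl⟩∘⟨ plug-into-right (iso-split p) (iso-split p₂) h1 h2 (split-comm r) (split-comm q') ⟨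
      T⟦ w ⟧ ∘ α ∘ (T⟦ v ⟧ ⊗₁ id) ∘ S⟦ q ⟧ ∘ plug p s T⟦ t ⟧
        ≈⟨ ≈-trans assoc⁺ (refl⟩∘⟨ assoc₃⁺) ⟨
      (T⟦ w ⟧ ∘ α ∘ (T⟦ v ⟧ ⊗₁ id) ∘ S⟦ q ⟧) ∘ plug p s T⟦ t ⟧ ∎
    ⟦sub⟧ (lam {A = A'} v) p s t = begin
      cur ((T⟦ sub v (right p) (right s) t ⟧) ∘ σ)      ≈⟨ cur-cong (⟦sub⟧ v (right {A'} p) (right {A'} s) t ⟩∘⟨refl) ⟩
      cur ((T⟦ v ⟧ ∘ plug (right {A'} p) (right s) T⟦ t ⟧) ∘ σ)
        ≈⟨ cur-cong ((refl⟩∘⟨ plug-right {B = A'} p s T⟦ t ⟧) ⟩∘⟨refl) ⟩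
      cur ((T⟦ v ⟧ ∘ (id ⊗₁ plug p s T⟦ t ⟧)) ∘ σ)    ≈⟨ cur-σ-natural ⟩
      cur (T⟦ v ⟧ ∘ σ) ∘ plug p s T⟦ t ⟧               ∎

    ⟦subArgs⟧ : ∀ {Ξ Γ Δ Ψ A B Bs} (as : Args Ξ B Bs) (p : Ξ ≈ (A ∷ []) ⋈ Γ) (s : Ψ ≈ Δ ⋈ Γ) (t : Δ ⊢ A) →
                  A⟦ subArgs as p s t ⟧ ≈ A⟦ as ⟧ ∘ plug p s T⟦ t ⟧
    ⟦subArgs⟧ (one v) p s t = ⟦sub⟧ v p s t
    ⟦subArgs⟧ (cons q v as) p s t with locate q p | locate-splits q p
    ... | inj₁ (_ , p₁ , r) | h1 with assocˡ s r | assocˡ-splits s r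
    ...   | _ , s₁ , q' | h2 =
      ≈-trans (⊗-plugˡ (⟦sub⟧ v p₁ s₁ t) (plug-into-left (iso-split p) (iso-split p₁) h1 h2)) assoc⁻
    ⟦subArgs⟧ (cons q v as) p s t | inj₂ (_ , p₂ , r) | h1 with assocˡ s (comm r) | assocˡ-splits s (comm r)
    ...   | _ , s₂ , q' | h2 =
      ≈-trans (⊗-plugʳ (⟦subArgs⟧ as p₂ s₂ t)
          (plug-into-right (iso-split p) (iso-split p₂) h1 h2 (split-comm r) (split-comm q'))) assoc⁻


module ConversionSoundness {ℓ : Level} {V : Quantale ℓ} (𝒞 : EnrAutCat V) where
  open SubstitutionLemma 𝒞 public

  unsplit-head : ∀ {A Γ} → unsplit (head {A} {Γ}) ≈ ru ⊗₁ id
  unsplit-head {A} {Γ} = iso-inverse-cong (iso-split (head {A} {Γ})) (iso-⊗ (iso-sym iso-ru) iso-id) (split-head {A} (allR {Γ}))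

  plug-head : ∀ {A Γ Δ Ψ} (s : Ψ ≈ Δ ⋈ Γ) (f : Hom C⟦ Δ ⟧ (iTy 𝒞 A)) → plug (head {A} {Γ}) s f ≈ (f ⊗₁ id) ∘ S⟦ s ⟧
  plug-head {A} {Γ} s f =
    begin _ ≈⟨ unsplit-head {A} {Γ} ⟩∘⟨refl ⟩
    (ru ⊗₁ id) ∘ ((ru⁻¹ ∘ f) ⊗₁ id) ∘ S⟦ s ⟧ ≈⟨ pullˡ ⊗-merge ⟩
    ((ru ∘ ru⁻¹ ∘ f) ⊗₁ (id ∘ id)) ∘ S⟦ s ⟧ ≈⟨ (cancelˡ ru-iso₁ ⟩⊗⟨ idL) ⟩∘⟨refl ⟩
    _ ∎

  ⟦sub-head⟧ : ∀ {A Γ Δ Ψ B} (u : (A ∷ Γ) ⊢ B) (s : Ψ ≈ Δ ⋈ Γ) (t : Δ ⊢ A) →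
             T⟦ sub u head s t ⟧ ≈ T⟦ u ⟧ ∘ (T⟦ t ⟧ ⊗₁ id) ∘ S⟦ s ⟧
  ⟦sub-head⟧ {A} u s t = ≈-trans (⟦sub⟧ u head s t) (refl⟩∘⟨ plug-head {A} s T⟦ t ⟧)

  β⊸-sound : ∀ {Γ Γ₁ Γ₂ A B} (s : Γ ≈ Γ₁ ⋈ Γ₂) (v : (A ∷ Γ₁) ⊢ B) (w : Γ₂ ⊢ A) →
              T⟦ app s (lam v) w ⟧ ≈ T⟦ sub v head (comm s) w ⟧
  β⊸-sound s v w =
    begin _ ≈⟨ refl⟩∘⟨ serialize₁₂ ⟩∘⟨refl ⟩
    ev ∘ ((cur (T⟦ v ⟧ ∘ σ) ⊗₁ id) ∘ (id ⊗₁ T⟦ w ⟧)) ∘ S⟦ s ⟧ ≈⟨ refl⟩∘⟨ assoc⁺ ⟩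
    ev ∘ (cur (T⟦ v ⟧ ∘ σ) ⊗₁ id) ∘ (id ⊗₁ T⟦ w ⟧) ∘ S⟦ s ⟧ ≈⟨ pullˡ (cur-β _) ⟩
    (T⟦ v ⟧ ∘ σ) ∘ (id ⊗₁ T⟦ w ⟧) ∘ S⟦ s ⟧ ≈⟨ assoc⁺ ⟩
    T⟦ v ⟧ ∘ σ ∘ (id ⊗₁ T⟦ w ⟧) ∘ S⟦ s ⟧ ≈⟨ refl⟩∘⟨ swapˡ (σ-nat id T⟦ w ⟧) ⟩
    T⟦ v ⟧ ∘ (T⟦ w ⟧ ⊗₁ id) ∘ σ ∘ S⟦ s ⟧ ≈⟨ refl⟩∘⟨ refl⟩∘⟨ ≈-sym (split-comm s) ⟩
    T⟦ v ⟧ ∘ (T⟦ w ⟧ ⊗₁ id) ∘ S⟦ comm s ⟧ ≈⟨ ⟦sub-head⟧ v (comm s) w ⟨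
    _ ∎

  η⊸-sound : ∀ {Γ A B} (v : Γ ⊢ A ⊸ᵗ B) → T⟦ v ⟧ ≈ T⟦ lam (app (right allL) v var) ⟧
  η⊸-sound {Γ} {A} v = ≈-trans (≈-sym (cur-η T⟦ v ⟧)) (cur-cong (≈-sym (
    begin _ ≈⟨ assoc₃⁺ ⟩
    ev ∘ (T⟦ v ⟧ ⊗₁ ru) ∘ S⟦ right {A} (allL {Γ}) ⟧ ∘ σ
      ≈⟨ refl⟩∘⟨ serialize₁₂ ⟩∘⟨ (split-right {A} (allL {Γ}) ⟩∘⟨refl) ⟩
    ev ∘ ((T⟦ v ⟧ ⊗₁ id) ∘ (id ⊗₁ ru)) ∘ (exch ∘ (id ⊗₁ S⟦ allL {Γ} ⟧)) ∘ σ ≈⟨ refl⟩∘⟨ assoc⁺ ⟩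
    ev ∘ (T⟦ v ⟧ ⊗₁ id) ∘ (id ⊗₁ ru) ∘ (exch ∘ (id ⊗₁ S⟦ allL {Γ} ⟧)) ∘ σ
      ≈⟨ refl⟩∘⟨ refl⟩∘⟨ refl⟩∘⟨ ((refl⟩∘⟨ id⊗-cong (split-allL (allL {Γ}))) ⟩∘⟨refl) ⟩
    ev ∘ (T⟦ v ⟧ ⊗₁ id) ∘ (id ⊗₁ ru) ∘ (exch ∘ (id ⊗₁ ru⁻¹)) ∘ σ ≈⟨ refl⟩∘⟨ refl⟩∘⟨ core ⟩
    ev ∘ (T⟦ v ⟧ ⊗₁ id) ∘ id ≈⟨ refl⟩∘⟨ idR ⟩
    _ ∎)))
    where
    core : ∀ {X Y} → (id ⊗₁ ru) ∘ (exch ∘ (id ⊗₁ ru⁻¹)) ∘ σ ≈ id {X ⊗₀ Y}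
    core =
      begin _ ≈⟨ refl⟩∘⟨ ≈-trans assoc⁺ (refl⟩∘⟨ assoc⁺) ⟩∘⟨refl ⟩
      (id ⊗₁ ru) ∘ (α ∘ (σ ⊗₁ id) ∘ α⁻¹ ∘ (id ⊗₁ ru⁻¹)) ∘ σ ≈⟨ refl⟩∘⟨ ≈-trans assoc⁺ (refl⟩∘⟨ assoc₃⁺) ⟩
      (id ⊗₁ ru) ∘ α ∘ (σ ⊗₁ id) ∘ α⁻¹ ∘ (id ⊗₁ ru⁻¹) ∘ σ ≈⟨ pullˡ id⊗ru-α ⟩
      ru ∘ (σ ⊗₁ id) ∘ α⁻¹ ∘ (id ⊗₁ ru⁻¹) ∘ σ ≈⟨ refl⟩∘⟨ refl⟩∘⟨ pullˡ α⁻¹-id⊗ru⁻¹ ⟩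
      ru ∘ (σ ⊗₁ id) ∘ ru⁻¹ ∘ σ ≈⟨ swapˡ (ru-nat σ) ⟩
      σ ∘ ru ∘ ru⁻¹ ∘ σ ≈⟨ refl⟩∘⟨ cancelˡ ru-iso₁ ⟩
      σ ∘ σ ≈⟨ σ-invol ⟩
      _ ∎

  β𝕀-sound : ∀ {Γ A} (v : Γ ⊢ A) → T⟦ letu allR unit v ⟧ ≈ T⟦ v ⟧
  β𝕀-sound {Γ} v =
    begin _ ≈⟨ refl⟩∘⟨ refl⟩∘⟨ split-allR (allR {Γ}) ⟩
    lu ∘ (id ⊗₁ T⟦ v ⟧) ∘ lu⁻¹ ≈⟨ pullˡ (lu-nat T⟦ v ⟧) ⟩
    (T⟦ v ⟧ ∘ lu) ∘ lu⁻¹ ≈⟨ cancelʳ lu-iso₁ ⟩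
    _ ∎

  η𝕀-sound : ∀ {Γ} (v : Γ ⊢ 𝕀) → T⟦ letu allL v unit ⟧ ≈ T⟦ v ⟧
  η𝕀-sound {Γ} v =
    begin _ ≈⟨ refl⟩∘⟨ refl⟩∘⟨ split-allL (allL {Γ}) ⟩
    lu ∘ (T⟦ v ⟧ ⊗₁ id) ∘ ru⁻¹ ≈⟨ refl⟩∘⟨ ≈-sym (ru⁻¹-nat T⟦ v ⟧) ⟩
    lu ∘ ru⁻¹ ∘ T⟦ v ⟧ ≈⟨ lu≈ru ⟩∘⟨refl ⟩
    ru ∘ ru⁻¹ ∘ T⟦ v ⟧ ≈⟨ cancelˡ ru-iso₁ ⟩
    _ ∎

  β⊗-sound : ∀ {Γ Γ₁ Γ₂ Γ₁₁ Γ₁₂ A B C} (s : Γ ≈ Γ₁ ⋈ Γ₂) (s' : Γ₁ ≈ Γ₁₁ ⋈ Γ₁₂)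
              (v : Γ₁₁ ⊢ A) (w : Γ₁₂ ⊢ B) (u : (A ∷ B ∷ Γ₂) ⊢ C) →
              T⟦ pm s (pair s' v w) u ⟧ ≈ T⟦ β⊗-rhs s s' v w u ⟧
  β⊗-sound {A = A} {B = B} s s' v w u with assocʳ s s' | assocʳ-splits s s'
  ... | _ , a , b | h =
    begin _ ≈⟨ refl⟩∘⟨ refl⟩∘⟨ pushˡ ∘-⊗id ⟩
    T⟦ u ⟧ ∘ α ∘ ((T⟦ v ⟧ ⊗₁ T⟦ w ⟧) ⊗₁ id) ∘ (S⟦ s' ⟧ ⊗₁ id) ∘ S⟦ s ⟧ ≈⟨ refl⟩∘⟨ refl⟩∘⟨ refl⟩∘⟨ h ⟩
    T⟦ u ⟧ ∘ α ∘ ((T⟦ v ⟧ ⊗₁ T⟦ w ⟧) ⊗₁ id) ∘ α⁻¹ ∘ (id ⊗₁ S⟦ b ⟧) ∘ S⟦ a ⟧ ≈⟨ refl⟩∘⟨ swapˡ α-comm ⟩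
    T⟦ u ⟧ ∘ (T⟦ v ⟧ ⊗₁ (T⟦ w ⟧ ⊗₁ id)) ∘ α ∘ α⁻¹ ∘ (id ⊗₁ S⟦ b ⟧) ∘ S⟦ a ⟧ ≈⟨ refl⟩∘⟨ refl⟩∘⟨ cancelˡ α-iso₁ ⟩
    T⟦ u ⟧ ∘ (T⟦ v ⟧ ⊗₁ (T⟦ w ⟧ ⊗₁ id)) ∘ (id ⊗₁ S⟦ b ⟧) ∘ S⟦ a ⟧ ≈⟨ refl⟩∘⟨ pullˡ (≈-trans ⊗-merge (idR ⟩⊗⟨ ≈-refl)) ⟩
    T⟦ u ⟧ ∘ (T⟦ v ⟧ ⊗₁ ((T⟦ w ⟧ ⊗₁ id) ∘ S⟦ b ⟧)) ∘ S⟦ a ⟧ ≈⟨ refl⟩∘⟨ serialize₂₁ ⟩∘⟨refl ⟩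
    T⟦ u ⟧ ∘ ((id ⊗₁ ((T⟦ w ⟧ ⊗₁ id) ∘ S⟦ b ⟧)) ∘ (T⟦ v ⟧ ⊗₁ id)) ∘ S⟦ a ⟧ ≈⟨ ≈-trans (refl⟩∘⟨ assoc⁺) assoc⁻ ⟩
    (T⟦ u ⟧ ∘ (id ⊗₁ ((T⟦ w ⟧ ⊗₁ id) ∘ S⟦ b ⟧))) ∘ (T⟦ v ⟧ ⊗₁ id) ∘ S⟦ a ⟧
      ≈⟨ ≈-sym (≈-trans (⟦sub⟧ u (right {A} head) (right {A} b) w)
                 (refl⟩∘⟨ ≈-trans (plug-right {B = A} (head {B}) b T⟦ w ⟧) (id⊗-cong (plug-head {B} b T⟦ w ⟧)))) ⟩∘⟨refl ⟩
    T⟦ sub u (right {A} head) (right {A} b) w ⟧ ∘ (T⟦ v ⟧ ⊗₁ id) ∘ S⟦ a ⟧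
      ≈⟨ ⟦sub-head⟧ (sub u (right {A} head) (right {A} b) w) a v ⟨
    _ ∎

  η⊗-sound : ∀ {Γ A B} (v : Γ ⊢ A ⊗ᵗ B) → T⟦ pm allL v (pair (left (right [])) var var) ⟧ ≈ T⟦ v ⟧
  η⊗-sound {Γ} {A} {B} v =
    begin _ ≈⟨ (refl⟩∘⟨ split-head {A} (right {B} [])) ⟩∘⟨ (refl⟩∘⟨ refl⟩∘⟨ split-allL (allL {Γ})) ⟩
    ((ru ⊗₁ ru) ∘ (ru⁻¹ ⊗₁ id)) ∘ α ∘ (T⟦ v ⟧ ⊗₁ id) ∘ ru⁻¹ ≈⟨ ≈-trans ⊗-merge (ru-iso₁ ⟩⊗⟨ idR) ⟩∘⟨refl ⟩
    (id ⊗₁ ru) ∘ α ∘ (T⟦ v ⟧ ⊗₁ id) ∘ ru⁻¹ ≈⟨ pullˡ id⊗ru-α ⟩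
    ru ∘ (T⟦ v ⟧ ⊗₁ id) ∘ ru⁻¹ ≈⟨ pullˡ (ru-nat T⟦ v ⟧) ⟩
    (T⟦ v ⟧ ∘ ru) ∘ ru⁻¹ ≈⟨ cancelʳ ru-iso₁ ⟩
    _ ∎

  η𝕀′-sound : ∀ {Γ Γ₁ Γ₂ C} (s : Γ ≈ Γ₁ ⋈ Γ₂) (v : Γ₁ ⊢ 𝕀) (u : (𝕀 ∷ Γ₂) ⊢ C) →
               T⟦ letu s v (sub u head allR unit) ⟧ ≈ T⟦ sub u head s v ⟧
  η𝕀′-sound {Γ₂ = Γ₂} s v u =
    begin _ ≈⟨ refl⟩∘⟨ (≈-refl ⟩⊗⟨ ≈-trans (⟦sub-head⟧ u (allR {Γ₂}) unit) (refl⟩∘⟨ ≈-trans (⊗-id ⟩∘⟨ split-allR (allR {Γ₂})) idL)) ⟩∘⟨refl ⟩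
    lu ∘ (T⟦ v ⟧ ⊗₁ (T⟦ u ⟧ ∘ lu⁻¹)) ∘ S⟦ s ⟧ ≈⟨ refl⟩∘⟨ serialize₂₁ ⟩∘⟨refl ⟩
    lu ∘ ((id ⊗₁ (T⟦ u ⟧ ∘ lu⁻¹)) ∘ (T⟦ v ⟧ ⊗₁ id)) ∘ S⟦ s ⟧ ≈⟨ refl⟩∘⟨ assoc⁺ ⟩
    lu ∘ (id ⊗₁ (T⟦ u ⟧ ∘ lu⁻¹)) ∘ (T⟦ v ⟧ ⊗₁ id) ∘ S⟦ s ⟧ ≈⟨ pullˡ (lu-nat _) ⟩
    ((T⟦ u ⟧ ∘ lu⁻¹) ∘ lu) ∘ (T⟦ v ⟧ ⊗₁ id) ∘ S⟦ s ⟧ ≈⟨ cancelʳ lu-iso₂ ⟩∘⟨refl ⟩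
    T⟦ u ⟧ ∘ (T⟦ v ⟧ ⊗₁ id) ∘ S⟦ s ⟧ ≈⟨ ⟦sub-head⟧ u s v ⟨
    _ ∎

  η⊗′-sound : ∀ {Γ Γ₁ Γ₂ A B C} (s : Γ ≈ Γ₁ ⋈ Γ₂) (v : Γ₁ ⊢ A ⊗ᵗ B) (u : ((A ⊗ᵗ B) ∷ Γ₂) ⊢ C) →
               T⟦ pm s v (sub u head (left (left allR)) (pair (left (right [])) var var)) ⟧ ≈ T⟦ sub u head s v ⟧
  η⊗′-sound {Γ₂ = Γ₂} {A} {B} s v u =
    begin _ ≈⟨ ⟦sub-head⟧ u (left (left (allR {Γ₂}))) _ ⟩∘⟨refl ⟩
    (T⟦ u ⟧ ∘ (((ru ⊗₁ ru) ∘ S⟦ left {A} (right {B} []) ⟧) ⊗₁ id) ∘ S⟦ left {A} (left {B} (allR {Γ₂})) ⟧) ∘ α ∘ (T⟦ v ⟧ ⊗₁ id) ∘ S⟦ s ⟧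
      ≈⟨ (refl⟩∘⟨ (≈-trans (refl⟩∘⟨ split-head {A} (right {B} [])) (≈-trans ⊗-merge (ru-iso₁ ⟩⊗⟨ idR)) ⟩⊗⟨ ≈-refl)
           ⟩∘⟨ (refl⟩∘⟨ id⊗-cong (split-head {B} (allR {Γ₂})))) ⟩∘⟨refl ⟩
    (T⟦ u ⟧ ∘ ((id ⊗₁ ru) ⊗₁ id) ∘ α⁻¹ ∘ (id ⊗₁ (ru⁻¹ ⊗₁ id))) ∘ α ∘ (T⟦ v ⟧ ⊗₁ id) ∘ S⟦ s ⟧
      ≈⟨ (refl⟩∘⟨ refl⟩∘⟨ α⁻¹-nat id ru⁻¹ id) ⟩∘⟨refl ⟩
    (T⟦ u ⟧ ∘ ((id ⊗₁ ru) ⊗₁ id) ∘ ((id ⊗₁ ru⁻¹) ⊗₁ id) ∘ α⁻¹) ∘ α ∘ (T⟦ v ⟧ ⊗₁ id) ∘ S⟦ s ⟧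
      ≈⟨ (refl⟩∘⟨ cancelˡ (≈-trans ⊗-merge (≈-trans (≈-trans ⊗-merge (idL ⟩⊗⟨ ru-iso₁) ⟩⊗⟨ idL) (≈-trans (⊗-id ⟩⊗⟨ ≈-refl) ⊗-id)))) ⟩∘⟨refl ⟩
    (T⟦ u ⟧ ∘ α⁻¹) ∘ α ∘ (T⟦ v ⟧ ⊗₁ id) ∘ S⟦ s ⟧ ≈⟨ ≈-trans assoc⁺ (refl⟩∘⟨ cancelˡ α-iso₂) ⟩
    T⟦ u ⟧ ∘ (T⟦ v ⟧ ⊗₁ id) ∘ S⟦ s ⟧ ≈⟨ ⟦sub-head⟧ u s v ⟨
    _ ∎

  cc𝕀-sound : ∀ {Γ Γ₁ Γ₂ Γ₁₁ Γ₁₂ A C} (s : Γ ≈ Γ₁ ⋈ Γ₂) (s' : Γ₁ ≈ Γ₁₁ ⋈ Γ₁₂)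
              (v : Γ₁₁ ⊢ 𝕀) (w : Γ₁₂ ⊢ A) (u : (A ∷ Γ₂) ⊢ C) →
              T⟦ sub u head s (letu s' v w) ⟧ ≈ T⟦ ccI-rhs s s' v w u ⟧
  cc𝕀-sound s s' v w u with assocʳ s s' | assocʳ-splits s s'
  ... | _ , a , b | h =
    begin _ ≈⟨ ⟦sub-head⟧ u s (letu s' v w) ⟩
    T⟦ u ⟧ ∘ ((lu ∘ (T⟦ v ⟧ ⊗₁ T⟦ w ⟧) ∘ S⟦ s' ⟧) ⊗₁ id) ∘ S⟦ s ⟧ ≈⟨ refl⟩∘⟨ ≈-trans ∘-⊗id (refl⟩∘⟨ ∘-⊗id) ⟩∘⟨refl ⟩
    T⟦ u ⟧ ∘ ((lu ⊗₁ id) ∘ ((T⟦ v ⟧ ⊗₁ T⟦ w ⟧) ⊗₁ id) ∘ (S⟦ s' ⟧ ⊗₁ id)) ∘ S⟦ s ⟧ ≈⟨ refl⟩∘⟨ assoc₃⁺ ⟩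
    T⟦ u ⟧ ∘ (lu ⊗₁ id) ∘ ((T⟦ v ⟧ ⊗₁ T⟦ w ⟧) ⊗₁ id) ∘ (S⟦ s' ⟧ ⊗₁ id) ∘ S⟦ s ⟧ ≈⟨ refl⟩∘⟨ refl⟩∘⟨ refl⟩∘⟨ h ⟩
    T⟦ u ⟧ ∘ (lu ⊗₁ id) ∘ ((T⟦ v ⟧ ⊗₁ T⟦ w ⟧) ⊗₁ id) ∘ α⁻¹ ∘ (id ⊗₁ S⟦ b ⟧) ∘ S⟦ a ⟧
      ≈⟨ refl⟩∘⟨ refl⟩∘⟨ swapˡ (≈-sym (α⁻¹-nat T⟦ v ⟧ T⟦ w ⟧ id)) ⟩
    T⟦ u ⟧ ∘ (lu ⊗₁ id) ∘ α⁻¹ ∘ (T⟦ v ⟧ ⊗₁ (T⟦ w ⟧ ⊗₁ id)) ∘ (id ⊗₁ S⟦ b ⟧) ∘ S⟦ a ⟧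
      ≈⟨ refl⟩∘⟨ pullˡ (≈-trans (≈-sym lu-α ⟩∘⟨refl) (cancelʳ α-iso₁)) ⟩
    T⟦ u ⟧ ∘ lu ∘ (T⟦ v ⟧ ⊗₁ (T⟦ w ⟧ ⊗₁ id)) ∘ (id ⊗₁ S⟦ b ⟧) ∘ S⟦ a ⟧
      ≈⟨ refl⟩∘⟨ refl⟩∘⟨ pullˡ (≈-trans ⊗-merge (idR ⟩⊗⟨ ≈-refl)) ⟩
    T⟦ u ⟧ ∘ lu ∘ (T⟦ v ⟧ ⊗₁ ((T⟦ w ⟧ ⊗₁ id) ∘ S⟦ b ⟧)) ∘ S⟦ a ⟧ ≈⟨ swapˡ (≈-sym (lu-nat T⟦ u ⟧)) ⟩
    lu ∘ (id ⊗₁ T⟦ u ⟧) ∘ (T⟦ v ⟧ ⊗₁ ((T⟦ w ⟧ ⊗₁ id) ∘ S⟦ b ⟧)) ∘ S⟦ a ⟧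
      ≈⟨ refl⟩∘⟨ pullˡ (≈-trans ⊗-merge (idL ⟩⊗⟨ ≈-refl)) ⟩
    lu ∘ (T⟦ v ⟧ ⊗₁ (T⟦ u ⟧ ∘ (T⟦ w ⟧ ⊗₁ id) ∘ S⟦ b ⟧)) ∘ S⟦ a ⟧
      ≈⟨ refl⟩∘⟨ (≈-refl ⟩⊗⟨ ≈-sym (⟦sub-head⟧ u b w)) ⟩∘⟨refl ⟩
    _ ∎

  cc⊗-sound : ∀ {Γ Γ₁ Γ₂ Γ₁₁ Γ₁₂ A B D C} (s : Γ ≈ Γ₁ ⋈ Γ₂) (s' : Γ₁ ≈ Γ₁₁ ⋈ Γ₁₂)
              (v : Γ₁₁ ⊢ A ⊗ᵗ B) (w : (A ∷ B ∷ Γ₁₂) ⊢ D) (u : (D ∷ Γ₂) ⊢ C) →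
              T⟦ sub u head s (pm s' v w) ⟧ ≈ T⟦ cc⊗-rhs s s' v w u ⟧
  cc⊗-sound {A = A} {B = B} s s' v w u with assocʳ s s' | assocʳ-splits s s'
  ... | _ , a , b | h =
    begin _ ≈⟨ ⟦sub-head⟧ u s (pm s' v w) ⟩
    T⟦ u ⟧ ∘ ((T⟦ w ⟧ ∘ α ∘ (T⟦ v ⟧ ⊗₁ id) ∘ S⟦ s' ⟧) ⊗₁ id) ∘ S⟦ s ⟧
      ≈⟨ refl⟩∘⟨ ≈-trans ∘-⊗id (refl⟩∘⟨ ≈-trans ∘-⊗id (refl⟩∘⟨ ∘-⊗id)) ⟩∘⟨refl ⟩
    T⟦ u ⟧ ∘ ((T⟦ w ⟧ ⊗₁ id) ∘ (α ⊗₁ id) ∘ ((T⟦ v ⟧ ⊗₁ id) ⊗₁ id) ∘ (S⟦ s' ⟧ ⊗₁ id)) ∘ S⟦ s ⟧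
      ≈⟨ refl⟩∘⟨ ≈-trans assoc⁺ (refl⟩∘⟨ assoc₃⁺) ⟩
    T⟦ u ⟧ ∘ (T⟦ w ⟧ ⊗₁ id) ∘ (α ⊗₁ id) ∘ ((T⟦ v ⟧ ⊗₁ id) ⊗₁ id) ∘ (S⟦ s' ⟧ ⊗₁ id) ∘ S⟦ s ⟧
      ≈⟨ refl⟩∘⟨ refl⟩∘⟨ refl⟩∘⟨ refl⟩∘⟨ h ⟩
    T⟦ u ⟧ ∘ (T⟦ w ⟧ ⊗₁ id) ∘ (α ⊗₁ id) ∘ ((T⟦ v ⟧ ⊗₁ id) ⊗₁ id) ∘ α⁻¹ ∘ (id ⊗₁ S⟦ b ⟧) ∘ S⟦ a ⟧
      ≈⟨ refl⟩∘⟨ refl⟩∘⟨ refl⟩∘⟨ swapˡ (≈-sym (α⁻¹-nat T⟦ v ⟧ id id)) ⟩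
    T⟦ u ⟧ ∘ (T⟦ w ⟧ ⊗₁ id) ∘ (α ⊗₁ id) ∘ α⁻¹ ∘ (T⟦ v ⟧ ⊗₁ (id ⊗₁ id)) ∘ (id ⊗₁ S⟦ b ⟧) ∘ S⟦ a ⟧
      ≈⟨ refl⟩∘⟨ refl⟩∘⟨ prefix₂₃ α⊗id-α⁻¹ ⟩
    T⟦ u ⟧ ∘ (T⟦ w ⟧ ⊗₁ id) ∘ α⁻¹ ∘ (id ⊗₁ α⁻¹) ∘ α ∘ (T⟦ v ⟧ ⊗₁ (id ⊗₁ id)) ∘ (id ⊗₁ S⟦ b ⟧) ∘ S⟦ a ⟧
      ≈⟨ refl⟩∘⟨ refl⟩∘⟨ refl⟩∘⟨ refl⟩∘⟨ refl⟩∘⟨ ≈-trans ((≈-refl ⟩⊗⟨ ⊗-id) ⟩∘⟨refl) (swapˡ ⊗-commute) ⟩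
    T⟦ u ⟧ ∘ (T⟦ w ⟧ ⊗₁ id) ∘ α⁻¹ ∘ (id ⊗₁ α⁻¹) ∘ α ∘ (id ⊗₁ S⟦ b ⟧) ∘ (T⟦ v ⟧ ⊗₁ id) ∘ S⟦ a ⟧
      ≈⟨ refl⟩∘⟨ refl⟩∘⟨ refl⟩∘⟨ refl⟩∘⟨ swapˡ (≈-trans (refl⟩∘⟨ (≈-sym ⊗-id ⟩⊗⟨ ≈-refl)) α-comm) ⟩
    T⟦ u ⟧ ∘ (T⟦ w ⟧ ⊗₁ id) ∘ α⁻¹ ∘ (id ⊗₁ α⁻¹) ∘ (id ⊗₁ (id ⊗₁ S⟦ b ⟧)) ∘ α ∘ (T⟦ v ⟧ ⊗₁ id) ∘ S⟦ a ⟧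
      ≈⟨ refl⟩∘⟨ refl⟩∘⟨ refl⟩∘⟨ pullˡ (≈-sym id⊗-∘) ⟩
    T⟦ u ⟧ ∘ (T⟦ w ⟧ ⊗₁ id) ∘ α⁻¹ ∘ (id ⊗₁ (α⁻¹ ∘ (id ⊗₁ S⟦ b ⟧))) ∘ α ∘ (T⟦ v ⟧ ⊗₁ id) ∘ S⟦ a ⟧
      ≈⟨ assoc₄⁻ ⟩
    (T⟦ u ⟧ ∘ (T⟦ w ⟧ ⊗₁ id) ∘ S⟦ left {A} (left {B} b) ⟧) ∘ α ∘ (T⟦ v ⟧ ⊗₁ id) ∘ S⟦ a ⟧
      ≈⟨ ≈-sym (⟦sub-head⟧ u (left (left b)) w) ⟩∘⟨refl ⟩
    _ ∎


  Conv-sound : ∀ {Γ A v w} → Conv Γ A v w → T⟦ v ⟧ ≈ T⟦ w ⟧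
  Conv-sound (β⊸ s v w) = β⊸-sound s v w
  Conv-sound (η⊸ v) = η⊸-sound v
  Conv-sound (β𝕀 v) = β𝕀-sound v
  Conv-sound (η𝕀 v) = η𝕀-sound v
  Conv-sound (β⊗ s s' v w u) = β⊗-sound s s' v w u
  Conv-sound (η⊗ v) = η⊗-sound v
  Conv-sound (η𝕀' s v u) = η𝕀′-sound s v u
  Conv-sound (η⊗' s v u) = η⊗′-sound s v u
  Conv-sound (cc𝕀 s s' v w u) = cc𝕀-sound s s' v w u
  Conv-sound (cc⊗ s s' v w u) = cc⊗-sound s s' v w u

module Soundness {ℓ : Level} {V : Quantale ℓ} (𝒞 : EnrAutCat V) where
  open ConversionSoundness 𝒞 public
  open Quantale V using (_≤_; ≤-trans; ⋁-least; _⊗_; continuous; ⊗-comm)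
  open QuantaleProperties V
  open TheoryThm V (Lang 𝒞)

  d-plug : ∀ {Ξ Γ Δ Ψ A} (p : Ξ ≈ (A ∷ []) ⋈ Γ) (s : Ψ ≈ Δ ⋈ Γ) {f g : Hom C⟦ Δ ⟧ (iTy 𝒞 A)} →
           d f g ≤ d (plug p s f) (plug p s g)
  d-plug p s = ≤-trans (d-∘ˡ ru⁻¹) (≤-trans d-⊗id (≤-trans (d-∘ʳ S⟦ s ⟧) (d-∘ˡ (unsplit p))))

  mutual
    Thm-sound : ∀ {Γ A v w q} → Thm Γ A v w q → q ≤ d T⟦ v ⟧ T⟦ w ⟧
    Thm-sound (ax (_ , le)) = le
    Thm-sound (conv c) = k≤⇒⊤≤ (proj₁ (Conv-sound c))
    Thm-sound (conv⁻ c) = k≤⇒⊤≤ (proj₂ (Conv-sound c))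
    Thm-sound refl = k≤⇒⊤≤ (d-refl _)
    Thm-sound (trans t1 t2) = ≤-trans (⊗-mono (Thm-sound t1) (Thm-sound t2)) (d-trans _ _ _)
    Thm-sound (weak r≤q t) = ≤-trans r≤q (Thm-sound t)
    Thm-sound (arch {q = q} f) = ≤-trans (≤-reflexive (continuous q)) (⋁-least _ (λ {r} r≪q → Thm-sound (f r r≪q)))
    Thm-sound join⊥ = ⊥-least
    Thm-sound (join∨ t1 t2) = ⋁-least _ (λ { (inj₁ PE.refl) → Thm-sound t1 ; (inj₂ PE.refl) → Thm-sound t2 })
    Thm-sound (c-op f ts) = ≤-trans ≤-k⊗ (d-∘ (d-refl _) (ThmArgs-sound ts))
    Thm-sound (c-letu s t1 t2) = ≤-trans (d-⊗ (Thm-sound t1) (Thm-sound t2)) (≤-trans (d-∘ʳ S⟦ s ⟧) (d-∘ˡ lu))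
    Thm-sound (c-pair s t1 t2) = ≤-trans (d-⊗ (Thm-sound t1) (Thm-sound t2)) (d-∘ʳ S⟦ s ⟧)
    Thm-sound (c-pm {q = q} {r} s t1 t2) =
      ≤-trans (≤-reflexive (⊗-comm q r))
        (d-∘ (Thm-sound t2) (≤-trans (Thm-sound t1) (≤-trans d-⊗id (≤-trans (d-∘ʳ S⟦ s ⟧) (d-∘ˡ α)))))
    Thm-sound (c-lam t) = ≤-trans (Thm-sound t) (≤-trans (d-∘ʳ σ) (cur-vfun _ _))
    Thm-sound (c-app s t1 t2) = ≤-trans (d-⊗ (Thm-sound t1) (Thm-sound t2)) (≤-trans (d-∘ʳ S⟦ s ⟧) (d-∘ˡ ev))
    Thm-sound (c-sub {A = A} {v = v} {w} {v'} {w'} t1 t2 s) =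
      ≤-trans (d-∘ (Thm-sound t1) (≤-trans (Thm-sound t2) (d-plug (head {A}) s)))
        (d-resp-≈ (≈-sym (⟦sub⟧ v head s v')) (≈-sym (⟦sub⟧ w head s w')))
    Thm-sound (perm {v = v} {w} t s) =
      ≤-trans (Thm-sound t) (≤-trans (d-∘ʳ _) (d-resp-≈ (≈-sym (⟦sub⟧ v head s var)) (≈-sym (⟦sub⟧ w head s var))))

    ThmArgs-sound : ∀ {Γ A As as as' q} → ThmArgs Γ A As as as' q → q ≤ d A⟦ as ⟧ A⟦ as' ⟧
    ThmArgs-sound (one t) = Thm-sound t
    ThmArgs-sound (cons s t ts) = ≤-trans (d-⊗ (Thm-sound t) (ThmArgs-sound ts)) (d-∘ʳ S⟦ s ⟧)

module InternalLanguageEquivalence {ℓ : Level} {V : Quantale ℓ} (𝒞 : EnrAutCat V) where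
  open Soundness 𝒞 public
  open Quantale V using (_≤_; ≤-trans; ⋁-ub; ⋁-least; B-k; B-join)
  open QuantaleProperties V using (≤-reflexive; ≪⇒≤)
  open TheoryThm V (Lang 𝒞)

  private
    module Syn = VCatStr (Syn V (Lang 𝒞))

  ⟦_⟧₁ : ∀ {A B} → (A ∷ []) ⊢ B → Hom (iTy 𝒞 A) (iTy 𝒞 B)
  ⟦ v ⟧₁ = T⟦ v ⟧ ∘ ru⁻¹

  -- Every equation valid in 𝒞 is an axiom of Lang 𝒞, with label k ∈ B.
  ⟦⟧₁-reflects-≈ : ∀ {A B} {v w : (A ∷ []) ⊢ B} → ⟦ v ⟧₁ ≈ ⟦ w ⟧₁ → v Syn.≈ w
  ⟦⟧₁-reflects-≈ e = ⋁-ub _ (ax (B-k , proj₁ e′)) , ⋁-ub _ (ax (B-k , proj₂ e′))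
    where e′ = iso-cancelʳ ru-iso₂ e

  ⟦var⟧₁ : ∀ {A} → ⟦ var {A} ⟧₁ ≈ id
  ⟦var⟧₁ = ru-iso₁

  ⟦op⟧₁ : (o : LangOp 𝒞) → ⟦ op o (one var) ⟧₁ ≈ ⟦_⟧op 𝒞 o
  ⟦op⟧₁ o = cancelʳ ru-iso₁

  ⟦∘⟧₁ : ∀ {A B C} (g : (B ∷ []) ⊢ C) (f : (A ∷ []) ⊢ B) → ⟦ g Syn.∘ f ⟧₁ ≈ ⟦ g ⟧₁ ∘ ⟦ f ⟧₁
  ⟦∘⟧₁ {A} g f = begin
    T⟦ g Syn.∘ f ⟧ ∘ ru⁻¹                 ≈⟨ ⟦sub-head⟧ g (left []) f ⟩∘⟨refl ⟩
    (T⟦ g ⟧ ∘ (T⟦ f ⟧ ⊗₁ id) ∘ S⟦ left {A} [] ⟧) ∘ ru⁻¹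
      ≈⟨ (refl⟩∘⟨ refl⟩∘⟨ split-head {A} []) ⟩∘⟨refl ⟩
    (T⟦ g ⟧ ∘ (T⟦ f ⟧ ⊗₁ id) ∘ (ru⁻¹ ⊗₁ id)) ∘ ru⁻¹ ≈⟨ assoc₃⁺ ⟩
    T⟦ g ⟧ ∘ (T⟦ f ⟧ ⊗₁ id) ∘ (ru⁻¹ ⊗₁ id) ∘ ru⁻¹  ≈⟨ refl⟩∘⟨ pullˡ (≈-trans ⊗-merge (≈-refl ⟩⊗⟨ idL)) ⟩
    T⟦ g ⟧ ∘ (⟦ f ⟧₁ ⊗₁ id) ∘ ru⁻¹                  ≈⟨ refl⟩∘⟨ ru⁻¹-nat ⟦ f ⟧₁ ⟨
    T⟦ g ⟧ ∘ ru⁻¹ ∘ ⟦ f ⟧₁                           ≈⟨ assoc⁻ ⟩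
    ⟦ g ⟧₁ ∘ ⟦ f ⟧₁                                  ∎

  ⌜_⌝ : ∀ {X Y} → Hom X Y → (gr X ∷ []) ⊢ gr Y
  ⌜ f ⌝ = op (mor f) (one var)

  pack : ∀ A → (A ∷ []) ⊢ gr (iTy 𝒞 A)
  pack A = op (isoᵢ A) (one var)

  unpack : ∀ A → (gr (iTy 𝒞 A) ∷ []) ⊢ A
  unpack A = op (isoₒ A) (one var)

  interpretation : VFunctor V (Syn V (Lang 𝒞)) (underlying V 𝒞)
  interpretation = record
    { F₀     = iTy 𝒞
    ; F₁     = ⟦_⟧₁
    ; F-vfun = λ v w → ⋁-least _ (λ t → ≤-trans (Thm-sound t) (d-∘ʳ ru⁻¹))
    ; F-id   = λ {A} → ⟦var⟧₁ {A}
    ; F-∘    = ⟦∘⟧₁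
    }

  naming : VFunctor V (underlying V 𝒞) (Syn V (Lang 𝒞))
  naming = record
    { F₀     = gr
    ; F₁     = ⌜_⌝
    ; F-vfun = ⌜⌝-vfun
    ; F-id   = λ {X} → ⟦⟧₁-reflects-≈ (≈-trans (⟦op⟧₁ (mor (id {X}))) (≈-sym (⟦var⟧₁ {gr X})))
    ; F-∘    = λ g f → ⟦⟧₁-reflects-≈ (begin
        ⟦ ⌜ g ∘ f ⌝ ⟧₁          ≈⟨ ⟦op⟧₁ (mor (g ∘ f)) ⟩
        g ∘ f                   ≈⟨ ⟦op⟧₁ (mor g) ⟩∘⟨ ⟦op⟧₁ (mor f) ⟨
        ⟦ ⌜ g ⌝ ⟧₁ ∘ ⟦ ⌜ f ⌝ ⟧₁ ≈⟨ ⟦∘⟧₁ ⌜ g ⌝ ⌜ f ⌝ ⟨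
        ⟦ ⌜ g ⌝ Syn.∘ ⌜ f ⌝ ⟧₁  ∎)
    }
    where
    -- d f g is the join of its basis elements way below it, and each of those labels an axiom.
    ⌜⌝-vfun : ∀ {X Y} (f g : Hom X Y) → d f g ≤ Syn.d ⌜ f ⌝ ⌜ g ⌝
    ⌜⌝-vfun f g = ≤-trans (≤-reflexive (B-join (d f g)))
      (⋁-least _ (λ { (By , y≪) → ⋁-ub _ (ax (By , ≤-trans (≪⇒≤ y≪) (d-∘ʳ ru))) }))

  pack-unpack : ∀ A → ⟦ pack A ⟧₁ ∘ ⟦ unpack A ⟧₁ ≈ id
  pack-unpack A = ≈-trans (⟦op⟧₁ (isoᵢ A) ⟩∘⟨ ⟦op⟧₁ (isoₒ A)) idL

  unpack-pack : ∀ A → ⟦ unpack A ⟧₁ ∘ ⟦ pack A ⟧₁ ≈ id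
  unpack-pack A = ≈-trans (⟦op⟧₁ (isoₒ A) ⟩∘⟨ ⟦op⟧₁ (isoᵢ A)) idL

  unpack-natural : ∀ {A B} (v : (A ∷ []) ⊢ B) →
                   ⟦ unpack B ⟧₁ ∘ ⟦ ⌜ ⟦ v ⟧₁ ⌝ ⟧₁ ≈ ⟦ v ⟧₁ ∘ ⟦ unpack A ⟧₁
  unpack-natural {A} {B} v = begin
    ⟦ unpack B ⟧₁ ∘ ⟦ ⌜ ⟦ v ⟧₁ ⌝ ⟧₁ ≈⟨ ⟦op⟧₁ (isoₒ B) ⟩∘⟨ ⟦op⟧₁ (mor ⟦ v ⟧₁) ⟩
    id ∘ ⟦ v ⟧₁                     ≈⟨ id-square ⟩
    ⟦ v ⟧₁ ∘ id                     ≈⟨ refl⟩∘⟨ ⟦op⟧₁ (isoₒ A) ⟨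
    ⟦ v ⟧₁ ∘ ⟦ unpack A ⟧₁          ∎

theorem3p18 : ∀ {ℓ : Level} (V : Quantale ℓ) (𝒞 : EnrAutCat V) →
    VEquivalence V (Syn V (Lang 𝒞)) (underlying V 𝒞)
theorem3p18 V 𝒞 = record
  { F      = interpretation
  ; G      = naming
  ; η      = unpack
  ; η⁻¹    = pack
  ; η-iso₁ = λ A → ⟦⟧₁-reflects-≈ (≈-trans (⟦∘⟧₁ (unpack A) (pack A)) (≈-trans (unpack-pack A) (≈-sym (⟦var⟧₁ {A}))))
  ; η-iso₂ = λ A → ⟦⟧₁-reflects-≈ (≈-trans (⟦∘⟧₁ (pack A) (unpack A)) (≈-trans (pack-unpack A) (≈-sym (⟦var⟧₁ {gr (iTy 𝒞 A)}))))
  ; η-nat  = λ {A} {B} v → ⟦⟧₁-reflects-≈ (begin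
      ⟦ unpack B ∘ˢ ⌜ ⟦ v ⟧₁ ⌝ ⟧₁     ≈⟨ ⟦∘⟧₁ (unpack B) ⌜ ⟦ v ⟧₁ ⌝ ⟩
      ⟦ unpack B ⟧₁ ∘ ⟦ ⌜ ⟦ v ⟧₁ ⌝ ⟧₁ ≈⟨ unpack-natural v ⟩
      ⟦ v ⟧₁ ∘ ⟦ unpack A ⟧₁          ≈⟨ ⟦∘⟧₁ v (unpack A) ⟨
      ⟦ v ∘ˢ unpack A ⟧₁              ∎)
  ; ε      = λ _ → id
  ; ε⁻¹    = λ _ → id
  ; ε-iso₁ = λ _ → idL
  ; ε-iso₂ = λ _ → idL
  ; ε-nat  = λ f → ≈-trans idL (≈-trans (⟦op⟧₁ (mor f)) (≈-sym idR))
  }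
  where
  open InternalLanguageEquivalence 𝒞
  open VCatStr (Syn V (Lang 𝒞)) using () renaming (_∘_ to _∘ˢ_)
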